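{- Let $n\ge2$ and $r,\tilde r\ge0$. In the ring $R(GL_{n-1})[q^{\alpha_1},\dots,q^{\alpha_{r+\tilde r}}]$ (with $q^{\alpha_i}$ formal variables), \[\Big(\sum_{\sigma\in S_{r+\tilde r}}\mathrm{sgn}(\sigma)\prod_{i=1}^{r+\tilde r}q^{(\sigma(i)-1)\alpha_i}\Big)\sum_{0\le d_1,\dots,d_{r+\tilde r}\le n-1}q^{\sum_i d_i\alpha_i}(-1)^{\sum_i d_i}\det{}^{ -\tilde r}\otimes\bigotimes_{i=1}^{r+\tilde r}\wedge^{d_i}\] \[=\sum_{\sigma\in S_{r+\tilde r}}\ \sum_{0\le d_1\le\dots\le d_{r+\tilde r}\le n-1}\mathrm{sgn}(\sigma)q^{\sum_i(d_i+i-1)\alpha_{\sigma(i)}}(-1)^{\sum_i d_i}V_{d_1,\dots,d_r\mid d_{r+1},\dots,d_{r+\tilde r}}.\]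
   Context: $R(GL_{n-1})$ is the representation ring of $GL_{n-1}$ over $\mathbb Z$; $\wedge^d$ denotes the $d$-th exterior power of the standard representation and $\det$ its determinant. For $0\le d_1\le\dots\le d_{r+\tilde r}\le n-1$, $V_{d_1,\dots,d_{r+\tilde r}}$ is the irreducible representation of $GL_{n-1}$ associated to the partition conjugate to $(d_{r+\tilde r},\dots,d_1)$, i.e. with highest weight $\lambda_1^{r+\tilde r}\cdots\lambda_{d_1}^{r+\tilde r}\lambda_{d_1+1}^{r+\tilde r-1}\cdots\lambda_{d_2}^{r+\tilde r-1}\cdots\lambda_{d_{r+\tilde r}}^{1}$, and $V_{d_1,\dots,d_r\mid d_{r+1},\dots,d_{r+\tilde r}}=V_{d_1,\dots,d_{r+\tilde r}}\otimes\det^{ -\tilde r}$. -}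

module Defs where

open import Data.Bool using (Bool; true; false; if_then_else_; _∧_; not)
open import Data.Nat as ℕ using (ℕ; zero; suc; _∸_; _<ᵇ_; _≡ᵇ_; _≤ᵇ_)
open import Data.Integer as ℤ using (ℤ; +_; -[1+_])
open import Data.Fin as Fin using (Fin; toℕ)
open import Data.List as List using (List; []; _∷_; _++_; map; concatMap; filterᵇ; allFin; upTo; foldr; length; zipWith; concat)
open import Data.Vec as Vec using (Vec; []; _∷_; replicate; toList; lookup)
open import Data.Bool.ListAction using (and)
open import Data.Product using (_×_; _,_; proj₁; proj₂)
open import Relation.Nullary.Decidable using (⌊_⌋)
open import Relation.Binary.PropositionalEquality using (_≡_)
import Data.Vec.Properties as VecP

-- The ring  ℤ[x₁^{±1},…,x_m^{±1}] [q^{α₁},…,q^{α_k}]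
-- (m = n-1 torus variables of GL_{n-1}, k = r + r̃ formal variables q^{αᵢ}).
-- Elements are finite formal ℤ-linear combinations of monomials; two
-- elements are equal iff every monomial has the same coefficient.
-- R(GL_m) is embedded here via the (injective) character map.

Mono : ℕ → ℕ → Set
Mono m k = Vec ℤ m × Vec ℕ k

Poly : ℕ → ℕ → Set
Poly m k = List (ℤ × Mono m k)

monoMul : ∀ {m k} → Mono m k → Mono m k → Mono m k
monoMul (a , b) (c , d) = Vec.zipWith ℤ._+_ a c , Vec.zipWith ℕ._+_ b d

monoOne : ∀ {m k} → Mono m k
monoOne = replicate _ (+ 0) , replicate _ 0

_+P_ : ∀ {m k} → Poly m k → Poly m k → Poly m k
_+P_ = _++_

_*P_ : ∀ {m k} → Poly m k → Poly m k → Poly m k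
p *P q = concatMap (λ { (a , μ) → map (λ { (b , ν) → (a ℤ.* b , monoMul μ ν) }) q }) p

oneP : ∀ {m k} → Poly m k
oneP = (+ 1 , monoOne) ∷ []

sumP : ∀ {m k} → List (Poly m k) → Poly m k
sumP = concat

prodP : ∀ {m k} → List (Poly m k) → Poly m k
prodP = foldr _*P_ oneP

monoEq : ∀ {m k} → Mono m k → Mono m k → Bool
monoEq (a , b) (c , d) = ⌊ VecP.≡-dec ℤ._≟_ a c ⌋ ∧ ⌊ VecP.≡-dec ℕ._≟_ b d ⌋

coeff : ∀ {m k} → Poly m k → Mono m k → ℤ
coeff p μ = foldr ℤ._+_ (+ 0) (map proj₁ (filterᵇ (λ t → monoEq (proj₂ t) μ) p))

_≈P_ : ∀ {m k} → Poly m k → Poly m k → Set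
p ≈P q = ∀ μ → coeff p μ ≡ coeff q μ

allVecs : ∀ {A : Set} → List A → (j : ℕ) → List (Vec A j)
allVecs xs zero    = [] ∷ []
allVecs xs (suc j) = concatMap (λ x → map (x ∷_) (allVecs xs j)) xs

negOnePow : ℕ → ℤ
negOnePow zero          = + 1
negOnePow (suc zero)    = -[1+ 0 ]
negOnePow (suc (suc n)) = negOnePow n

sumℕ : List ℕ → ℕ
sumℕ = foldr ℕ._+_ 0

count : ∀ {A : Set} → (A → Bool) → List A → ℕ
count p xs = length (filterᵇ p xs)

finEq : ∀ {k} → Fin k → Fin k → Bool
finEq i j = toℕ i ≡ᵇ toℕ j

-- permutations of Fin k, as the vector (σ(0),…,σ(k-1)) of an injective map
isPerm : ∀ {k} → Vec (Fin k) k → Bool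
isPerm {k} σ = and (concatMap (λ i → map (λ j →
  if toℕ i <ᵇ toℕ j then not (finEq (lookup σ i) (lookup σ j)) else true) (allFin k)) (allFin k))

perms : (k : ℕ) → List (Vec (Fin k) k)
perms k = filterᵇ isPerm (allVecs (allFin k) k)

inversions : ∀ {k} → Vec (Fin k) k → ℕ
inversions {k} σ = count (λ { (i , j) → (toℕ i <ᵇ toℕ j) ∧ (toℕ (lookup σ j) <ᵇ toℕ (lookup σ i)) })
  (List.cartesianProduct (allFin k) (allFin k))

sgn : ∀ {k} → Vec (Fin k) k → ℤ
sgn σ = negOnePow (inversions σ)

-- subsets of {0,…,m-1} as characteristic vectors
bools : List Bool
bools = true ∷ false ∷ []

members : ∀ {m} → Vec Bool m → List (Fin m)
members []          = []
members (true ∷ s)  = Fin.zero ∷ map Fin.suc (members s)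
members (false ∷ s) = map Fin.suc (members s)

size : ∀ {m} → Vec Bool m → ℕ
size s = length (members s)

indicator : ∀ {m} → Vec Bool m → Vec ℤ m
indicator = Vec.map (λ b → if b then + 1 else + 0)

xMono : ∀ {m k} → ℤ → Vec ℤ m → Poly m k
xMono c e = (c , (e , replicate _ 0)) ∷ []

-- ∧^d of the standard representation: elementary symmetric polynomial e_d
wedge : ∀ {m k} → ℕ → Poly m k
wedge {m} d = map (λ S → (+ 1 , (indicator S , replicate _ 0)))
  (filterᵇ (λ S → size S ≡ᵇ d) (allVecs bools m))

detPow⁻ : ∀ {m k} → ℕ → Poly m k
detPow⁻ t = xMono (+ 1) (replicate _ (ℤ.- (+ t)))

-- row condition between adjacent columns of a tableau (left column longer):
-- the i-th entry of the left column is ≤ the i-th entry of the right column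
rowOK : ∀ {m} → Vec Bool m → Vec Bool m → Bool
rowOK L R = and (zipWith (λ a b → toℕ a ≤ᵇ toℕ b) (members L) (members R))

-- columns given in the order C₁,…,C_k with |Cⱼ| = dⱼ; C_{j+1} is left of Cⱼ
colsOK : ∀ {m} → List (Vec Bool m) → Bool
colsOK []             = true
colsOK (C ∷ [])       = true
colsOK (C ∷ D ∷ rest) = rowOK D C ∧ colsOK (D ∷ rest)

sizesOK : ∀ {m k} → Vec ℕ k → Vec (Vec Bool m) k → Bool
sizesOK d C = and (toList (Vec.zipWith (λ dj Cj → size Cj ≡ᵇ dj) d C))

-- V_{d₁,…,d_k} (d₁ ≤ … ≤ d_k): irreducible GL_m-representation of highest
-- weight the partition conjugate to (d_k,…,d₁), i.e. the Young diagram whose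
-- columns have lengths d_k,…,d₁.  Its character is the Schur polynomial:
-- sum over semistandard tableaux (entries in 1..m) of x^T.
schurV : ∀ {m k} → Vec ℕ k → Poly m k
schurV {m} {k} d = map (λ C → (+ 1 , (foldr (Vec.zipWith ℤ._+_) (replicate _ (+ 0)) (map indicator (toList C)) , replicate _ 0)))
  (filterᵇ (λ C → sizesOK d C ∧ colsOK (toList C)) (allVecs (allVecs bools m) k))

-- V_{d₁,…,d_r | d_{r+1},…,d_{r+r̃}} = V_{d₁,…,d_{r+r̃}} ⊗ det^{-r̃}
Vbar : ∀ {m k} → (r̃ : ℕ) → Vec ℕ k → Poly m k
Vbar r̃ d = schurV d *P detPow⁻ r̃

nondecreasing : List ℕ → Bool
nondecreasing []           = true
nondecreasing (a ∷ [])     = true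
nondecreasing (a ∷ b ∷ xs) = (a ≤ᵇ b) ∧ nondecreasing (b ∷ xs)

-- Σ_σ sgn σ ∏ᵢ q^{(σ(i)-1) αᵢ}   (0-indexed: exponent of αᵢ is σ(i))
vandermondeFactor : ∀ {m} k → Poly m k
vandermondeFactor k = map (λ σ → (sgn σ , (replicate _ (+ 0) , Vec.map toℕ σ))) (perms k)

wedgeSum : ∀ m k → (r̃ : ℕ) → Poly m k
wedgeSum m k r̃ = sumP (map (λ d →
     ((negOnePow (sumℕ (toList d)) , (replicate _ (+ 0) , d)) ∷ [])
     *P (detPow⁻ r̃ *P prodP (map wedge (toList d))))
  (allVecs (upTo (suc m)) k))

-- q-exponent vector of q^{Σᵢ (dᵢ+i-1) α_{σ(i)}}  (0-indexed i)
qExp : ∀ {k} → Vec (Fin k) k → Vec ℕ k → Vec ℕ k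
qExp {k} σ d = Vec.tabulate (λ j →
  sumℕ (map (λ i → if finEq (lookup σ i) j then lookup d i ℕ.+ toℕ i else 0) (allFin k)))

LHS : ∀ m k → (r̃ : ℕ) → Poly m k
LHS m k r̃ = vandermondeFactor k *P wedgeSum m k r̃

RHS : ∀ m k → (r̃ : ℕ) → Poly m k
RHS m k r̃ = sumP (concatMap (λ σ → map (λ d →
     ((sgn σ ℤ.* negOnePow (sumℕ (toList d)) , (replicate _ (+ 0) , qExp σ d)) ∷ [])
     *P Vbar r̃ d)
    (filterᵇ (λ d → nondecreasing (toList d)) (allVecs (upTo (suc m)) k)))
  (perms k))

{-# OPTIONS --safe #-}
module Submission where

-- Write yⱼ = q^{αⱼ} and let a_β(y) = Σ_σ sgn σ y^{β∘σ} be the alternant of an exponent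
-- vector β.  Since Σ_d (-yⱼ)^d ∧^d = Πᵢ (1 - xᵢ yⱼ), the left side is det^{-r̃} a_ρ(y) Πᵢⱼ (1 - xᵢ yⱼ)
-- with ρ = (0,1,…,k-1).  Multiplying a_β by Πⱼ (1 - x yⱼ) for one new variable x gives
-- Σ_{ε ∈ {0,1}^k} (-x)^{|ε|} a_{β+ε} (a Pieri rule), and a_{β+ε} vanishes unless β+ε is still
-- strictly increasing, because swapping two equal exponents changes the sign.  Adjoining
-- x₁,…,x_{n-1} one at a time, the surviving chains ρ = β₀ < β₁ < ⋯ < β_{n-1} = d + ρ are
-- exactly the column-strict tableaux with column sizes d, i.e. the monomials of the Schur
-- polynomial V_d.  Hence the left side is det^{-r̃} Σ_d (-1)^{|d|} a_{d+ρ}(y) V_d, which is the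
-- right side after the substitution σ ↦ σ⁻¹.

open import Defs

module DualCauchy where

  open import Data.Bool using (Bool; true; false; if_then_else_; _∧_; not; T)
  import Data.Bool.Properties as BoolP
  open import Data.Bool.ListAction using (and)
  open import Data.Empty using (⊥; ⊥-elim)
  open import Data.Fin as Fin using (Fin; zero; suc; toℕ)
  import Data.Fin.Properties as FinP
  open import Data.Integer as ℤ using (ℤ; +_; -[1+_]; _+_; _*_; -_)
  open import Data.Integer.Properties as ℤP
  open import Data.Integer.Tactic.RingSolver using (solve-∀)
  open import Data.List as L using (List; []; _∷_; _++_; map; concatMap; filterᵇ; concat; foldr; allFin; upTo; cartesianProduct; drop)
  import Data.List.Properties as LP
  open import Data.List.Membership.Propositional using (_∈_)
  import Data.List.Membership.Propositional.Properties as MemP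
  open import Data.List.Relation.Unary.Any using (here; there)
  open import Data.Nat as ℕ using (ℕ; zero; suc; _<ᵇ_; _≡ᵇ_; _≤ᵇ_; _<_; _≤_; z≤n; s≤s; _∸_)
  import Data.Nat.Properties as ℕP
  open import Data.Product using (_×_; _,_; proj₁; proj₂; Σ; ∃)
  import Data.Product.Properties as ProdP
  open import Data.Sum using (_⊎_; inj₁; inj₂)
  open import Data.Unit using (tt)
  open import Data.Vec as V using (Vec; []; _∷_; lookup; replicate; toList; zipWith)
  import Data.Vec.Properties as VecP
  open import Function using (_∘_)
  open import Function.Bundles using (_⇔_; mk⇔; Equivalence)
  open import Relation.Binary.Definitions using (DecidableEquality; tri<; tri≈; tri>)
  open import Relation.Binary.PropositionalEquality
  open import Relation.Nullary using (Dec; yes; no; ¬_)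
  open import Algebra.Properties.CommutativeSemigroup ℤP.+-commutativeSemigroup using (interchange)
  open import Algebra.Properties.CommutativeSemigroup ℕP.+-commutativeSemigroup using ()
    renaming (interchange to ℕ-interchange)

  ∑ : ∀ {A : Set} → List A → (A → ℤ) → ℤ
  ∑ [] f = + 0
  ∑ (x ∷ xs) f = f x + ∑ xs f

  module _ {A : Set} where
    ∑-cong : (xs : List A) {f g : A → ℤ} → (∀ x → f x ≡ g x) → ∑ xs f ≡ ∑ xs g
    ∑-cong [] e = refl
    ∑-cong (x ∷ xs) e = cong₂ _+_ (e x) (∑-cong xs e)

    ∑-cong-∈ : (xs : List A) {f g : A → ℤ} → (∀ x → x ∈ xs → f x ≡ g x) → ∑ xs f ≡ ∑ xs g
    ∑-cong-∈ [] e = refl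
    ∑-cong-∈ (x ∷ xs) e = cong₂ _+_ (e x (here refl)) (∑-cong-∈ xs (λ y p → e y (there p)))

    ∑-++ : (xs ys : List A) (f : A → ℤ) → ∑ (xs ++ ys) f ≡ ∑ xs f + ∑ ys f
    ∑-++ [] ys f = sym (+-identityˡ _)
    ∑-++ (x ∷ xs) ys f = trans (cong (λ s → f x + s) (∑-++ xs ys f)) (sym (+-assoc (f x) _ _))

    ∑-zero : (xs : List A) → ∑ xs (λ _ → + 0) ≡ + 0
    ∑-zero [] = refl
    ∑-zero (x ∷ xs) = trans (+-identityˡ _) (∑-zero xs)

    ∑-+ : (xs : List A) (f g : A → ℤ) → ∑ xs (λ x → f x + g x) ≡ ∑ xs f + ∑ xs g
    ∑-+ [] f g = refl
    ∑-+ (x ∷ xs) f g =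
      trans (cong (λ s → f x + g x + s) (∑-+ xs f g)) (interchange (f x) (g x) (∑ xs f) (∑ xs g))

    ∑-*ˡ : (xs : List A) (c : ℤ) (f : A → ℤ) → ∑ xs (λ x → c * f x) ≡ c * ∑ xs f
    ∑-*ˡ [] c f = sym (*-zeroʳ c)
    ∑-*ˡ (x ∷ xs) c f = trans (cong (λ s → c * f x + s) (∑-*ˡ xs c f)) (sym (*-distribˡ-+ c (f x) _))

    ∑-*ʳ : (xs : List A) (c : ℤ) (f : A → ℤ) → ∑ xs (λ x → f x * c) ≡ ∑ xs f * c
    ∑-*ʳ xs c f = trans (∑-cong xs (λ x → *-comm (f x) c)) (trans (∑-*ˡ xs c f) (*-comm c _))

    ∑-neg : (xs : List A) (f : A → ℤ) → ∑ xs (λ x → - f x) ≡ - ∑ xs f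
    ∑-neg [] f = refl
    ∑-neg (x ∷ xs) f = trans (cong (λ s → - f x + s) (∑-neg xs f)) (sym (neg-distrib-+ (f x) (∑ xs f)))

    ∑-filterᵇ : (p : A → Bool) (xs : List A) (f : A → ℤ) →
                ∑ (filterᵇ p xs) f ≡ ∑ xs (λ x → if p x then f x else + 0)
    ∑-filterᵇ p [] f = refl
    ∑-filterᵇ p (x ∷ xs) f with p x
    ... | true = cong (λ s → f x + s) (∑-filterᵇ p xs f)
    ... | false = trans (∑-filterᵇ p xs f) (sym (+-identityˡ _))

  module _ {A B : Set} where
    ∑-map : (g : A → B) (xs : List A) (f : B → ℤ) → ∑ (map g xs) f ≡ ∑ xs (λ x → f (g x))
    ∑-map g [] f = refl
    ∑-map g (x ∷ xs) f = cong (λ s → f (g x) + s) (∑-map g xs f)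

    ∑-concatMap : (g : A → List B) (xs : List A) (f : B → ℤ) →
                  ∑ (concatMap g xs) f ≡ ∑ xs (λ x → ∑ (g x) f)
    ∑-concatMap g [] f = refl
    ∑-concatMap g (x ∷ xs) f =
      trans (∑-++ (g x) (concatMap g xs) f) (cong (λ s → ∑ (g x) f + s) (∑-concatMap g xs f))

    ∑-swap : (xs : List A) (ys : List B) (f : A → B → ℤ) →
             ∑ xs (λ x → ∑ ys (f x)) ≡ ∑ ys (λ y → ∑ xs (λ x → f x y))
    ∑-swap [] ys f = sym (∑-zero ys)
    ∑-swap (x ∷ xs) ys f =
      trans (cong (λ s → ∑ ys (f x) + s) (∑-swap xs ys f)) (sym (∑-+ ys (f x) (λ y → ∑ xs (λ x′ → f x′ y))))

  ∑-concat : ∀ {A : Set} (xss : List (List A)) (f : A → ℤ) → ∑ (concat xss) f ≡ ∑ xss (λ xs → ∑ xs f)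
  ∑-concat [] f = refl
  ∑-concat (xs ∷ xss) f = trans (∑-++ xs (concat xss) f) (cong (λ s → ∑ xs f + s) (∑-concat xss f))

  ∑-cartesianProduct : ∀ {A B : Set} (xs : List A) (ys : List B) (f : A × B → ℤ) →
                       ∑ (cartesianProduct xs ys) f ≡ ∑ xs (λ x → ∑ ys (λ y → f (x , y)))
  ∑-cartesianProduct [] ys f = refl
  ∑-cartesianProduct (x ∷ xs) ys f =
    trans (∑-++ (map (x ,_) ys) _ f) (cong₂ _+_ (∑-map (x ,_) ys f) (∑-cartesianProduct xs ys f))

  ∑-allVecs-suc : ∀ {A : Set} (xs : List A) k (f : Vec A (suc k) → ℤ) →
                  ∑ (allVecs xs (suc k)) f ≡ ∑ xs (λ x → ∑ (allVecs xs k) (λ v → f (x ∷ v)))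
  ∑-allVecs-suc xs k f = trans (∑-concatMap _ xs f) (∑-cong xs (λ x → ∑-map (x ∷_) (allVecs xs k) f))

  𝟙 : Bool → ℤ
  𝟙 true = + 1
  𝟙 false = + 0

  𝟙ℕ : Bool → ℕ
  𝟙ℕ true = 1
  𝟙ℕ false = 0

  𝟙? : ∀ {P : Set} → Dec P → ℤ
  𝟙? (yes _) = + 1
  𝟙? (no _) = + 0

  𝟙-∧ : ∀ a b → 𝟙 (a ∧ b) ≡ 𝟙 a * 𝟙 b
  𝟙-∧ true b = sym (*-identityˡ (𝟙 b))
  𝟙-∧ false b = refl

  𝟙ℕ-𝟙 : ∀ b → + 𝟙ℕ b ≡ 𝟙 b
  𝟙ℕ-𝟙 true = refl
  𝟙ℕ-𝟙 false = refl

  𝟙?-cong : ∀ {P Q : Set} → (P → Q) → (Q → P) → (p : Dec P) (q : Dec Q) → 𝟙? p ≡ 𝟙? q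
  𝟙?-cong to from (yes _) (yes _) = refl
  𝟙?-cong to from (no _) (no _) = refl
  𝟙?-cong to from (yes p) (no ¬q) = ⊥-elim (¬q (to p))
  𝟙?-cong to from (no ¬p) (yes q) = ⊥-elim (¬p (from q))

  𝟙?-× : ∀ {P Q R : Set} → (R → P × Q) → (P → Q → R) →
         (r : Dec R) (p : Dec P) (q : Dec Q) → 𝟙? r ≡ 𝟙? p * 𝟙? q
  𝟙?-× to from (yes _) (yes _) (yes _) = refl
  𝟙?-× to from (yes r) (no ¬p) _ = ⊥-elim (¬p (proj₁ (to r)))
  𝟙?-× to from (yes r) (yes _) (no ¬q) = ⊥-elim (¬q (proj₂ (to r)))
  𝟙?-× to from (no ¬r) (yes p) (yes q) = ⊥-elim (¬r (from p q))
  𝟙?-× to from (no _) (yes _) (no _) = refl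
  𝟙?-× to from (no _) (no _) _ = refl

  module Kronecker {A : Set} (_≟_ : DecidableEquality A) where
    δ : A → A → ℤ
    δ a b = 𝟙? (a ≟ b)

    δ-refl : ∀ a → δ a a ≡ + 1
    δ-refl a with a ≟ a
    ... | yes _ = refl
    ... | no ¬p = ⊥-elim (¬p refl)

    δ-≢ : ∀ {a b} → ¬ a ≡ b → δ a b ≡ + 0
    δ-≢ {a} {b} ne with a ≟ b
    ... | yes p = ⊥-elim (ne p)
    ... | no _ = refl

    δ-subst : ∀ a b (f : A → ℤ) → δ a b * f b ≡ δ a b * f a
    δ-subst a b f with a ≟ b
    ... | yes refl = refl
    ... | no _ = refl

    ∑-δ-sift : ∀ a (L : List A) (f : A → ℤ) → ∑ L (λ y → δ a y * f y) ≡ ∑ L (δ a) * f a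
    ∑-δ-sift a L f = trans (∑-cong L (λ y → δ-subst a y f)) (∑-*ʳ L (f a) (δ a))

    multiplicity : A → List A → ℕ
    multiplicity a [] = 0
    multiplicity a (y ∷ ys) with a ≟ y
    ... | yes _ = suc (multiplicity a ys)
    ... | no _ = multiplicity a ys

    ∑-δ≡multiplicity : ∀ a (L : List A) → ∑ L (δ a) ≡ + multiplicity a L
    ∑-δ≡multiplicity a [] = refl
    ∑-δ≡multiplicity a (y ∷ ys) with a ≟ y
    ... | yes _ = cong (λ s → + 1 + s) (∑-δ≡multiplicity a ys)
    ... | no _ = trans (+-identityˡ _) (∑-δ≡multiplicity a ys)

    ∈⇒multiplicity≢0 : ∀ a (L : List A) → a ∈ L → ¬ multiplicity a L ≡ 0
    ∈⇒multiplicity≢0 a (y ∷ ys) a∈ with a ≟ y | a∈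
    ... | yes _ | _ = λ ()
    ... | no a≢y | here a≡y = ⊥-elim (a≢y a≡y)
    ... | no _ | there a∈ys = ∈⇒multiplicity≢0 a ys a∈ys

    record Enumerates (L : List A) (P : A → Bool) : Set where
      constructor mkEnumerates
      field ∑-δ : ∀ x → ∑ L (δ x) ≡ 𝟙 (P x)
    open Enumerates public

    module _ {L : List A} {P : A → Bool} (en : Enumerates L P) where
      Enumerates-∈ : ∀ x → x ∈ L → P x ≡ true
      Enumerates-∈ x x∈ with P x in eq
      ... | true = refl
      ... | false = ⊥-elim (∈⇒multiplicity≢0 x L x∈
                     (ℤP.+-injective (trans (sym (∑-δ≡multiplicity x L)) (trans (∑-δ en x) (cong 𝟙 eq)))))

      Enumerates-sift : ∀ a → P a ≡ true → (f : A → ℤ) → ∑ L (λ y → δ a y * f y) ≡ f a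
      Enumerates-sift a pa f =
        trans (∑-δ-sift a L f) (trans (cong (λ c → c * f a) (trans (∑-δ en a) (cong 𝟙 pa))) (*-identityˡ (f a)))

      ∑-reindex : (g h : A → A) → (∀ x → P x ≡ true → P (g x) ≡ true) → (∀ x → P x ≡ true → P (h x) ≡ true) →
                  (∀ x → P x ≡ true → h (g x) ≡ x) → (∀ y → P y ≡ true → g (h y) ≡ y) →
                  (f : A → ℤ) → ∑ L (λ x → f (g x)) ≡ ∑ L f
      ∑-reindex g h gP hP hg gh f =
        begin
          ∑ L (λ x → f (g x))
        ≡⟨ ∑-cong-∈ L (λ x x∈ → sym (Enumerates-sift (g x) (gP x (Enumerates-∈ x x∈)) f)) ⟩
          ∑ L (λ x → ∑ L (λ y → δ (g x) y * f y))
        ≡⟨ ∑-swap L L (λ x y → δ (g x) y * f y) ⟩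
          ∑ L (λ y → ∑ L (λ x → δ (g x) y * f y))
        ≡⟨ ∑-cong-∈ L (λ y y∈ → ∑-cong-∈ L (λ x x∈ →
             cong (_* f y) (δ-swap x y (Enumerates-∈ x x∈) (Enumerates-∈ y y∈)))) ⟩
          ∑ L (λ y → ∑ L (λ x → δ (h y) x * f y))
        ≡⟨ ∑-cong-∈ L (λ y y∈ → trans (∑-*ʳ L (f y) (δ (h y))) (preimage-unique y (Enumerates-∈ y y∈))) ⟩
          ∑ L f
        ∎
        where
        open ≡-Reasoning
        δ-swap : ∀ x y → P x ≡ true → P y ≡ true → δ (g x) y ≡ δ (h y) x
        δ-swap x y px py = 𝟙?-cong (λ { refl → hg x px }) (λ { refl → gh y py }) (g x ≟ y) (h y ≟ x)
        preimage-unique : ∀ y → P y ≡ true → ∑ L (δ (h y)) * f y ≡ f y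
        preimage-unique y py = trans (cong (_* f y) (trans (∑-δ en (h y)) (cong 𝟙 (hP y py)))) (*-identityˡ (f y))

    Enumerates-cong : ∀ {L P Q} → (∀ x → P x ≡ Q x) → Enumerates L P → Enumerates L Q
    Enumerates-cong P≗Q en = mkEnumerates (λ x → trans (∑-δ en x) (cong 𝟙 (P≗Q x)))

    filterᵇ-enumerates : ∀ {L P} (Q : A → Bool) → Enumerates L P → Enumerates (filterᵇ Q L) (λ x → Q x ∧ P x)
    filterᵇ-enumerates {L} {P} Q en = mkEnumerates λ x →
      begin
        ∑ (filterᵇ Q L) (δ x)
      ≡⟨ ∑-filterᵇ Q L (δ x) ⟩
        ∑ L (λ y → if Q y then δ x y else + 0)
      ≡⟨ ∑-cong L (guard x) ⟩
        ∑ L (λ y → 𝟙 (Q x) * δ x y)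
      ≡⟨ ∑-*ˡ L (𝟙 (Q x)) (δ x) ⟩
        𝟙 (Q x) * ∑ L (δ x)
      ≡⟨ cong (𝟙 (Q x) *_) (∑-δ en x) ⟩
        𝟙 (Q x) * 𝟙 (P x)
      ≡⟨ sym (𝟙-∧ (Q x) (P x)) ⟩
        𝟙 (Q x ∧ P x)
      ∎
      where
      open ≡-Reasoning
      guard : ∀ x y → (if Q y then δ x y else + 0) ≡ 𝟙 (Q x) * δ x y
      guard x y with x ≟ y
      ... | yes refl with Q x
      ...   | true = refl
      ...   | false = refl
      guard x y | no _ with Q y
      ...   | true = sym (*-zeroʳ (𝟙 (Q x)))
      ...   | false = sym (*-zeroʳ (𝟙 (Q x)))

  open Kronecker using (Enumerates; mkEnumerates; ∑-δ)

  allᵇ : ∀ {A : Set} {k} → (A → Bool) → Vec A k → Bool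
  allᵇ P [] = true
  allᵇ P (x ∷ v) = P x ∧ allᵇ P v

  allᵇ-true : ∀ {A : Set} {k} (v : Vec A k) → allᵇ (λ _ → true) v ≡ true
  allᵇ-true [] = refl
  allᵇ-true (x ∷ v) = allᵇ-true v

  module KroneckerVec {A : Set} (_≟_ : DecidableEquality A) where
    open Kronecker _≟_ using () renaming (δ to δ₁)
    module Kroneckerᵛ {k} = Kronecker (VecP.≡-dec {n = k} _≟_)
    open Kroneckerᵛ using () renaming (δ to δᵛ)

    δ-∷ : ∀ {k} (a b : A) (v w : Vec A k) → δᵛ (a ∷ v) (b ∷ w) ≡ δ₁ a b * δᵛ v w
    δ-∷ a b v w = 𝟙?-× VecP.∷-injective (cong₂ _∷_) _ (a ≟ b) (VecP.≡-dec _≟_ v w)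

    allVecs-enumerates : ∀ {xs P} k → Enumerates _≟_ xs P → Enumerates (VecP.≡-dec _≟_) (allVecs xs k) (allᵇ P)
    allVecs-enumerates zero en = mkEnumerates λ { [] → refl }
    allVecs-enumerates {xs} {P} (suc k) en = mkEnumerates λ { (a ∷ v) →
      begin
        ∑ (allVecs xs (suc k)) (δᵛ (a ∷ v))
      ≡⟨ ∑-allVecs-suc xs k (δᵛ (a ∷ v)) ⟩
        ∑ xs (λ x → ∑ (allVecs xs k) (λ w → δᵛ (a ∷ v) (x ∷ w)))
      ≡⟨ ∑-cong xs (λ x → trans (∑-cong (allVecs xs k) (δ-∷ a x v)) (∑-*ˡ (allVecs xs k) (δ₁ a x) (δᵛ v))) ⟩
        ∑ xs (λ x → δ₁ a x * ∑ (allVecs xs k) (δᵛ v))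
      ≡⟨ trans (∑-*ʳ xs _ (δ₁ a)) (cong₂ _*_ (∑-δ en a) (∑-δ (allVecs-enumerates k en) v)) ⟩
        𝟙 (P a) * 𝟙 (allᵇ P v)
      ≡⟨ sym (𝟙-∧ (P a) (allᵇ P v)) ⟩
        𝟙 (allᵇ P (a ∷ v))
      ∎ }
      where open ≡-Reasoning

  open KroneckerVec using (allVecs-enumerates)

  module KroneckerProduct {A B : Set} (_≟A_ : DecidableEquality A) (_≟B_ : DecidableEquality B) where
    _≟×_ : DecidableEquality (A × B)
    _≟×_ = ProdP.≡-dec _≟A_ _≟B_

    open Kronecker _≟A_ using () renaming (δ to δA)
    open Kronecker _≟B_ using () renaming (δ to δB)
    open Kronecker _≟×_ using () renaming (δ to δ×)

    cartesianProduct-enumerates : ∀ {xs ys P Q} → Enumerates _≟A_ xs P → Enumerates _≟B_ ys Q →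
      Enumerates _≟×_ (cartesianProduct xs ys) (λ p → P (proj₁ p) ∧ Q (proj₂ p))
    cartesianProduct-enumerates {xs} {ys} {P} {Q} enA enB = mkEnumerates λ { (a , b) →
      begin
        ∑ (cartesianProduct xs ys) (δ× (a , b))
      ≡⟨ ∑-cartesianProduct xs ys (δ× (a , b)) ⟩
        ∑ xs (λ x → ∑ ys (λ y → δ× (a , b) (x , y)))
      ≡⟨ ∑-cong xs (λ x → trans (∑-cong ys (δ-, a b x)) (∑-*ˡ ys (δA a x) (δB b))) ⟩
        ∑ xs (λ x → δA a x * ∑ ys (δB b))
      ≡⟨ trans (∑-*ʳ xs _ (δA a)) (cong₂ _*_ (∑-δ enA a) (∑-δ enB b)) ⟩
        𝟙 (P a) * 𝟙 (Q b)
      ≡⟨ sym (𝟙-∧ (P a) (Q b)) ⟩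
        𝟙 (P a ∧ Q b)
      ∎ }
      where
      open ≡-Reasoning
      δ-, : ∀ a b c d → δ× (a , b) (c , d) ≡ δA a c * δB b d
      δ-, a b c d = 𝟙?-× ProdP.,-injective (cong₂ _,_) _ (a ≟A c) (b ≟B d)

  open KroneckerProduct using (_≟×_; cartesianProduct-enumerates)

  allFin-suc : ∀ k → allFin (suc k) ≡ zero ∷ map suc (allFin k)
  allFin-suc k = cong (zero ∷_) (sym (LP.map-tabulate (λ i → i) suc))

  allFin-enumerates : ∀ k → Enumerates FinP._≟_ (allFin k) (λ _ → true)
  allFin-enumerates zero = mkEnumerates λ ()
  allFin-enumerates (suc k) = mkEnumerates λ i → trans (cong (λ l → ∑ l (δ i)) (allFin-suc k)) (head+tail i)
    where
    open Kronecker (FinP._≟_ {suc k}) using (δ)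
    head+tail : ∀ i → ∑ (zero ∷ map suc (allFin k)) (δ i) ≡ + 1
    head+tail zero = cong (λ s → + 1 + s) (trans (∑-map suc (allFin k) (δ zero)) (∑-zero (allFin k)))
    head+tail (suc i) = trans (+-identityˡ _) (trans (∑-map suc (allFin k) (δ (suc i)))
      (trans (∑-cong (allFin k) (λ j → 𝟙?-cong FinP.suc-injective (cong suc) (suc i FinP.≟ suc j) (i FinP.≟ j)))
             (∑-δ (allFin-enumerates k) i)))

  upTo-enumerates : ∀ n → Enumerates ℕP._≟_ (upTo n) (λ a → a <ᵇ n)
  upTo-enumerates zero = mkEnumerates λ _ → refl
  upTo-enumerates (suc n) = mkEnumerates λ a →
    trans (cong (λ l → ∑ l (δ a)) (sym (LP.upTo-∷ʳ n)))
    (trans (∑-++ (upTo n) (n ∷ []) (δ a))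
    (trans (cong₂ _+_ (∑-δ (upTo-enumerates n) a) (+-identityʳ (δ a n))) (last a n)))
    where
    open Kronecker ℕP._≟_ using (δ)
    last : ∀ a n → 𝟙 (a <ᵇ n) + δ a n ≡ 𝟙 (a <ᵇ suc n)
    last zero zero = refl
    last zero (suc n) = refl
    last (suc a) zero = refl
    last (suc a) (suc n) =
      trans (cong (λ s → 𝟙 (a <ᵇ n) + s) (𝟙?-cong ℕP.suc-injective (cong suc) (suc a ℕP.≟ suc n) (a ℕP.≟ n))) (last a n)

  bools-enumerates : Enumerates BoolP._≟_ bools (λ _ → true)
  bools-enumerates = mkEnumerates each
    where
    each : ∀ b → ∑ bools (Kronecker.δ BoolP._≟_ b) ≡ + 1
    each true = refl
    each false = refl

  false≢true : ¬ false ≡ true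
  false≢true ()

  T⇒≡true : ∀ {b} → T b → b ≡ true
  T⇒≡true {true} _ = refl

  ≡true⇒T : ∀ {b} → b ≡ true → T b
  ≡true⇒T refl = tt

  ∧≡true⇒ˡ : ∀ {a b} → (a ∧ b) ≡ true → a ≡ true
  ∧≡true⇒ˡ {true} e = refl

  ∧≡true⇒ʳ : ∀ {a b} → (a ∧ b) ≡ true → b ≡ true
  ∧≡true⇒ʳ {true} e = e

  <ᵇ≡true⇒< : ∀ {m n} → (m <ᵇ n) ≡ true → m < n
  <ᵇ≡true⇒< {m} {n} e = ℕP.<ᵇ⇒< m n (≡true⇒T e)

  <⇒<ᵇ≡true : ∀ {m n} → m < n → (m <ᵇ n) ≡ true
  <⇒<ᵇ≡true m<n = T⇒≡true (ℕP.<⇒<ᵇ m<n)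

  ≮⇒<ᵇ≡false : ∀ {m n} → ¬ m < n → (m <ᵇ n) ≡ false
  ≮⇒<ᵇ≡false {m} {n} m≮n with m <ᵇ n in eq
  ... | true = ⊥-elim (m≮n (<ᵇ≡true⇒< eq))
  ... | false = refl

  ≤ᵇ≡true⇒≤ : ∀ {m n} → (m ≤ᵇ n) ≡ true → m ≤ n
  ≤ᵇ≡true⇒≤ {m} {n} e = ℕP.≤ᵇ⇒≤ m n (≡true⇒T e)

  ≤⇒≤ᵇ≡true : ∀ {m n} → m ≤ n → (m ≤ᵇ n) ≡ true
  ≤⇒≤ᵇ≡true m≤n = T⇒≡true (ℕP.≤⇒≤ᵇ m≤n)

  ≡ᵇ-refl : ∀ n → (n ≡ᵇ n) ≡ true
  ≡ᵇ-refl zero = refl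
  ≡ᵇ-refl (suc n) = ≡ᵇ-refl n

  ≡ᵇ≡true⇒≡ : ∀ {m n} → (m ≡ᵇ n) ≡ true → m ≡ n
  ≡ᵇ≡true⇒≡ {m} {n} e = ℕP.≡ᵇ⇒≡ m n (≡true⇒T e)

  ≢⇒≡ᵇ≡false : ∀ {m n} → ¬ m ≡ n → (m ≡ᵇ n) ≡ false
  ≢⇒≡ᵇ≡false {m} {n} m≢n with m ≡ᵇ n in eq
  ... | true = ⊥-elim (m≢n (≡ᵇ≡true⇒≡ eq))
  ... | false = refl

  <ᵇ-suc : ∀ x y → (x <ᵇ suc y) ≡ (x ≤ᵇ y)
  <ᵇ-suc zero y = refl
  <ᵇ-suc (suc x) y = refl

  <ᵇ-irrefl : ∀ n → (n <ᵇ n) ≡ false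
  <ᵇ-irrefl n = ≮⇒<ᵇ≡false (ℕP.n≮n n)

  <ᵇ-cong-⇔ : ∀ {a b c d} → (a < b → c < d) → (c < d → a < b) → (a <ᵇ b) ≡ (c <ᵇ d)
  <ᵇ-cong-⇔ {a} {b} {c} {d} to from with a <ᵇ b in e₁ | c <ᵇ d in e₂
  ... | true | true = refl
  ... | false | false = refl
  ... | true | false = ⊥-elim (false≢true (trans (sym e₂) (<⇒<ᵇ≡true (to (<ᵇ≡true⇒< e₁)))))
  ... | false | true = ⊥-elim (false≢true (trans (sym e₁) (<⇒<ᵇ≡true (from (<ᵇ≡true⇒< e₂)))))

  and-map⁻ : ∀ {A : Set} (f : A → Bool) (xs : List A) → and (map f xs) ≡ true → ∀ x → x ∈ xs → f x ≡ true
  and-map⁻ f (y ∷ ys) e x (here refl) = ∧≡true⇒ˡ e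
  and-map⁻ f (y ∷ ys) e x (there x∈) = and-map⁻ f ys (∧≡true⇒ʳ {f y} e) x x∈

  and-map⁺ : ∀ {A : Set} (f : A → Bool) (xs : List A) → (∀ x → f x ≡ true) → and (map f xs) ≡ true
  and-map⁺ f [] h = refl
  and-map⁺ f (y ∷ ys) h rewrite h y = and-map⁺ f ys h

  and-++ : ∀ xs ys → and (xs ++ ys) ≡ and xs ∧ and ys
  and-++ [] ys = refl
  and-++ (true ∷ xs) ys = and-++ xs ys
  and-++ (false ∷ xs) ys = refl

  and-concatMap : ∀ {A : Set} (g : A → List Bool) (xs : List A) →
                  and (concatMap g xs) ≡ and (map (λ x → and (g x)) xs)
  and-concatMap g [] = refl
  and-concatMap g (x ∷ xs) = trans (and-++ (g x) (concatMap g xs)) (cong (and (g x) ∧_) (and-concatMap g xs))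

  -- Permutations

  Fin-injective⇒surjective : ∀ {n} (f : Fin n → Fin n) → (∀ i j → f i ≡ f j → i ≡ j) → ∀ j → ∃ λ i → f i ≡ j
  Fin-injective⇒surjective {suc n} f inj j with FinP.any? (λ i → f i FinP.≟ j)
  ... | yes hit = hit
  ... | no miss = ⊥-elim (ℕP.1+n≰n (FinP.injective⇒≤ {f = squeeze} squeeze-injective))
    where
    squeeze : Fin (suc n) → Fin n
    squeeze i = Fin.punchOut {i = j} {j = f i} (λ e → miss (i , sym e))
    squeeze-injective : ∀ {x y} → squeeze x ≡ squeeze y → x ≡ y
    squeeze-injective {x} {y} e =
      inj x y (FinP.punchOut-injective (λ e → miss (x , sym e)) (λ e → miss (y , sym e)) e)

  Vec-ext : ∀ {A : Set} {k} {v w : Vec A k} → (∀ i → lookup v i ≡ lookup w i) → v ≡ w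
  Vec-ext {v = v} {w} h = trans (sym (VecP.tabulate∘lookup v)) (trans (VecP.tabulate-cong h) (VecP.tabulate∘lookup w))

  _≟ᵖ_ : ∀ {k} → DecidableEquality (Vec (Fin k) k)
  _≟ᵖ_ = VecP.≡-dec FinP._≟_

  module _ {k : ℕ} where
    IsInjection : Vec (Fin k) k → Set
    IsInjection σ = ∀ i j → lookup σ i ≡ lookup σ j → i ≡ j

    distinctAt : Vec (Fin k) k → Fin k → Fin k → Bool
    distinctAt σ i j = if toℕ i <ᵇ toℕ j then not (finEq (lookup σ i) (lookup σ j)) else true

    isPerm-unfold : (σ : Vec (Fin k) k) → isPerm σ ≡ and (map (λ i → and (map (distinctAt σ i) (allFin k))) (allFin k))
    isPerm-unfold σ = and-concatMap _ (allFin k)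

    isPerm⇒distinctAt : (σ : Vec (Fin k) k) → isPerm σ ≡ true → ∀ i j → distinctAt σ i j ≡ true
    isPerm⇒distinctAt σ e i j =
      and-map⁻ (distinctAt σ i) (allFin k)
        (and-map⁻ _ (allFin k) (trans (sym (isPerm-unfold σ)) e) i (MemP.∈-allFin i)) j (MemP.∈-allFin j)

    distinctAt-< : (σ : Vec (Fin k) k) (i j : Fin k) → toℕ i < toℕ j → distinctAt σ i j ≡ true →
                   ¬ lookup σ i ≡ lookup σ j
    distinctAt-< σ i j i<j d σi≡σj = false≢true (trans (sym collision) d)
      where
      collision : distinctAt σ i j ≡ false
      collision =
        trans (cong (λ b → if b then not (finEq (lookup σ i) (lookup σ j)) else true) (<⇒<ᵇ≡true i<j))
              (trans (cong (λ a → not (finEq a (lookup σ j))) σi≡σj) (cong not (≡ᵇ-refl (toℕ (lookup σ j)))))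

    isPerm⇒injection : (σ : Vec (Fin k) k) → isPerm σ ≡ true → IsInjection σ
    isPerm⇒injection σ e i j σi≡σj with ℕP.<-cmp (toℕ i) (toℕ j)
    ... | tri< i<j _ _ = ⊥-elim (distinctAt-< σ i j i<j (isPerm⇒distinctAt σ e i j) σi≡σj)
    ... | tri≈ _ i≡j _ = FinP.toℕ-injective i≡j
    ... | tri> _ _ j<i = ⊥-elim (distinctAt-< σ j i j<i (isPerm⇒distinctAt σ e j i) (sym σi≡σj))

    injection⇒isPerm : (σ : Vec (Fin k) k) → IsInjection σ → isPerm σ ≡ true
    injection⇒isPerm σ inj =
      trans (isPerm-unfold σ) (and-map⁺ _ (allFin k) (λ i → and-map⁺ _ (allFin k) (distinct i)))
      where
      distinct : ∀ i j → distinctAt σ i j ≡ true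
      distinct i j with toℕ i <ᵇ toℕ j in i<j
      ... | false = refl
      ... | true = cong not (≢⇒≡ᵇ≡false λ e →
                     ℕP.<-irrefl (cong toℕ (inj i j (FinP.toℕ-injective e))) (<ᵇ≡true⇒< i<j))

    preimage : Vec (Fin k) k → Fin k → Fin k
    preimage σ j with FinP.any? (λ i → lookup σ i FinP.≟ j)
    ... | yes (i , _) = i
    ... | no _ = j

    lookup-preimage : (σ : Vec (Fin k) k) → IsInjection σ → ∀ j → lookup σ (preimage σ j) ≡ j
    lookup-preimage σ inj j with FinP.any? (λ i → lookup σ i FinP.≟ j)
    ... | yes (i , σi≡j) = σi≡j
    ... | no miss = ⊥-elim (miss (Fin-injective⇒surjective (lookup σ) inj j))

    invPerm : Vec (Fin k) k → Vec (Fin k) k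
    invPerm σ = V.tabulate (preimage σ)

    σ∘σ⁻¹ : (σ : Vec (Fin k) k) → IsInjection σ → ∀ j → lookup σ (lookup (invPerm σ) j) ≡ j
    σ∘σ⁻¹ σ inj j = trans (cong (lookup σ) (VecP.lookup∘tabulate (preimage σ) j)) (lookup-preimage σ inj j)

    σ⁻¹∘σ : (σ : Vec (Fin k) k) → IsInjection σ → ∀ i → lookup (invPerm σ) (lookup σ i) ≡ i
    σ⁻¹∘σ σ inj i = inj _ _ (σ∘σ⁻¹ σ inj (lookup σ i))

    invPerm-injection : (σ : Vec (Fin k) k) → IsInjection σ → IsInjection (invPerm σ)
    invPerm-injection σ inj i j e = trans (sym (σ∘σ⁻¹ σ inj i)) (trans (cong (lookup σ) e) (σ∘σ⁻¹ σ inj j))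

    invPerm-involutive : (σ : Vec (Fin k) k) → IsInjection σ → invPerm (invPerm σ) ≡ σ
    invPerm-involutive σ inj = Vec-ext λ i →
      invPerm-injection σ inj _ _ (trans (σ∘σ⁻¹ (invPerm σ) (invPerm-injection σ inj) i) (sym (σ⁻¹∘σ σ inj i)))

    isPerm-invPerm : (σ : Vec (Fin k) k) → isPerm σ ≡ true → isPerm (invPerm σ) ≡ true
    isPerm-invPerm σ p = injection⇒isPerm (invPerm σ) (invPerm-injection σ (isPerm⇒injection σ p))

  perms-enumerates : ∀ k → Enumerates _≟ᵖ_ (perms k) isPerm
  perms-enumerates k =
    Kronecker.Enumerates-cong _≟ᵖ_ (λ σ → trans (cong (isPerm σ ∧_) (allᵇ-true σ)) (BoolP.∧-identityʳ (isPerm σ)))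
      (Kronecker.filterᵇ-enumerates _≟ᵖ_ isPerm (allVecs-enumerates FinP._≟_ k (allFin-enumerates k)))

  -- Signs

  count≡∑ : ∀ {A : Set} (p : A → Bool) (xs : List A) → + count p xs ≡ ∑ xs (λ x → 𝟙 (p x))
  count≡∑ p [] = refl
  count≡∑ p (x ∷ xs) with p x
  ... | true = cong (λ s → + 1 + s) (count≡∑ p xs)
  ... | false = trans (count≡∑ p xs) (sym (+-identityˡ _))

  negOnePow-suc : ∀ n → negOnePow (suc n) ≡ - negOnePow n
  negOnePow-suc zero = refl
  negOnePow-suc (suc zero) = refl
  negOnePow-suc (suc (suc n)) = negOnePow-suc n

  negOnePow-+ : ∀ a b → negOnePow (a ℕ.+ b) ≡ negOnePow a * negOnePow b
  negOnePow-+ zero b = sym (*-identityˡ _)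
  negOnePow-+ (suc zero) b = trans (negOnePow-suc b) (sym (ℤP.-1*i≡-i (negOnePow b)))
  negOnePow-+ (suc (suc a)) b = negOnePow-+ a b

  module _ {k : ℕ} where
    Pair : Set
    Pair = Fin k × Fin k

    _≟²_ : DecidableEquality Pair
    _≟²_ = _≟×_ FinP._≟_ FinP._≟_

    pairs : List Pair
    pairs = cartesianProduct (allFin k) (allFin k)

    pairs-enumerates : Enumerates _≟²_ pairs (λ _ → true)
    pairs-enumerates = cartesianProduct-enumerates FinP._≟_ FinP._≟_ (allFin-enumerates k) (allFin-enumerates k)

    isInversion : Vec (Fin k) k → Pair → Bool
    isInversion σ (i , j) = (toℕ i <ᵇ toℕ j) ∧ (toℕ (lookup σ j) <ᵇ toℕ (lookup σ i))

    inversions≡∑ : (σ : Vec (Fin k) k) → + inversions σ ≡ ∑ pairs (λ x → 𝟙 (isInversion σ x))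
    inversions≡∑ σ = count≡∑ _ pairs

    -- (i , j) is an inversion of σ⁻¹ exactly when (σ j , σ i) is one of σ.
    inversions-invPerm : (σ : Vec (Fin k) k) → isPerm σ ≡ true → inversions (invPerm σ) ≡ inversions σ
    inversions-invPerm σ p = ℤP.+-injective (
      begin
        + inversions (invPerm σ)
      ≡⟨ inversions≡∑ (invPerm σ) ⟩
        ∑ pairs (λ x → 𝟙 (isInversion (invPerm σ) x))
      ≡⟨ sym (Kronecker.∑-reindex _≟²_ pairs-enumerates flip flip⁻¹ (λ _ _ → refl) (λ _ _ → refl)
                (λ { (i , j) _ → cong₂ _,_ (σ⁻¹∘σ σ inj i) (σ⁻¹∘σ σ inj j) })
                (λ { (i , j) _ → cong₂ _,_ (σ∘σ⁻¹ σ inj i) (σ∘σ⁻¹ σ inj j) }) _) ⟩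
        ∑ pairs (λ x → 𝟙 (isInversion (invPerm σ) (flip x)))
      ≡⟨ ∑-cong pairs (λ x → cong 𝟙 (isInversion-flip x)) ⟩
        ∑ pairs (λ x → 𝟙 (isInversion σ x))
      ≡⟨ sym (inversions≡∑ σ) ⟩
        + inversions σ
      ∎)
      where
      open ≡-Reasoning
      inj = isPerm⇒injection σ p
      flip flip⁻¹ : Pair → Pair
      flip (i , j) = (lookup σ j , lookup σ i)
      flip⁻¹ (i , j) = (lookup (invPerm σ) j , lookup (invPerm σ) i)
      isInversion-flip : ∀ x → isInversion (invPerm σ) (flip x) ≡ isInversion σ x
      isInversion-flip (i , j) =
        trans (cong₂ (λ a b → (toℕ (lookup σ j) <ᵇ toℕ (lookup σ i)) ∧ (toℕ a <ᵇ toℕ b))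
                     (σ⁻¹∘σ σ inj i) (σ⁻¹∘σ σ inj j))
              (BoolP.∧-comm (toℕ (lookup σ j) <ᵇ toℕ (lookup σ i)) (toℕ i <ᵇ toℕ j))

    sgn-invPerm : (σ : Vec (Fin k) k) → isPerm σ ≡ true → sgn (invPerm σ) ≡ sgn σ
    sgn-invPerm σ p = cong negOnePow (inversions-invPerm σ p)

    transposition : Fin k → Fin k → Fin k → Fin k
    transposition p q x with x FinP.≟ p | x FinP.≟ q
    ... | yes _ | _ = q
    ... | no _ | yes _ = p
    ... | no _ | no _ = x

    transposition-p : ∀ p q → transposition p q p ≡ q
    transposition-p p q with p FinP.≟ p
    ... | yes _ = refl
    ... | no p≢p = ⊥-elim (p≢p refl)

    transposition-q : ∀ p q → transposition p q q ≡ p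
    transposition-q p q with q FinP.≟ p | q FinP.≟ q
    ... | yes q≡p | _ = q≡p
    ... | no _ | yes _ = refl
    ... | no _ | no q≢q = ⊥-elim (q≢q refl)

    transposition-other : ∀ p q x → ¬ x ≡ p → ¬ x ≡ q → transposition p q x ≡ x
    transposition-other p q x x≢p x≢q with x FinP.≟ p | x FinP.≟ q
    ... | yes x≡p | _ = ⊥-elim (x≢p x≡p)
    ... | no _ | yes x≡q = ⊥-elim (x≢q x≡q)
    ... | no _ | no _ = refl

    transposition-involutive : ∀ p q x → transposition p q (transposition p q x) ≡ x
    transposition-involutive p q x with x FinP.≟ p | x FinP.≟ q
    ... | yes refl | _ = transposition-q x q
    ... | no _ | yes refl = transposition-p p x
    ... | no x≢p | no x≢q = transposition-other p q x x≢p x≢q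

    adjacentTransposition-<ᵇ : ∀ p q → toℕ q ≡ suc (toℕ p) → ∀ u v → ¬ (u ≡ p × v ≡ q) → ¬ (u ≡ q × v ≡ p) →
                               (toℕ (transposition p q v) <ᵇ toℕ (transposition p q u)) ≡ (toℕ v <ᵇ toℕ u)
    adjacentTransposition-<ᵇ p q q≡p+1 u v ¬pq ¬qp with u FinP.≟ p | u FinP.≟ q | v FinP.≟ p | v FinP.≟ q
    ... | yes refl | _ | yes refl | _ = trans (<ᵇ-irrefl (toℕ q)) (sym (<ᵇ-irrefl (toℕ p)))
    ... | yes refl | _ | no _ | yes refl = ⊥-elim (¬pq (refl , refl))
    ... | yes refl | _ | no v≢p | no _ rewrite q≡p+1 =
          <ᵇ-cong-⇔ (λ v<p+1 → ℕP.≤∧≢⇒< (ℕP.≤-pred v<p+1) (v≢p ∘ FinP.toℕ-injective)) ℕP.m<n⇒m<1+n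
    ... | no _ | yes refl | yes refl | _ = ⊥-elim (¬qp (refl , refl))
    ... | no _ | yes refl | no _ | yes refl = trans (<ᵇ-irrefl (toℕ p)) (sym (<ᵇ-irrefl (toℕ q)))
    ... | no _ | yes refl | no v≢p | no _ rewrite q≡p+1 =
          <ᵇ-cong-⇔ ℕP.m<n⇒m<1+n (λ v<p+1 → ℕP.≤∧≢⇒< (ℕP.≤-pred v<p+1) (v≢p ∘ FinP.toℕ-injective))
    ... | no _ | no u≢q | yes refl | _ rewrite q≡p+1 =
          <ᵇ-cong-⇔ (ℕP.<-trans (ℕP.n<1+n _))
                    (λ p<u → ℕP.≤∧≢⇒< p<u (λ e → u≢q (FinP.toℕ-injective (trans (sym e) (sym q≡p+1)))))
    ... | no _ | no u≢q | no _ | yes refl rewrite q≡p+1 =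
          <ᵇ-cong-⇔ (λ p<u → ℕP.≤∧≢⇒< p<u (λ e → u≢q (FinP.toℕ-injective (trans (sym e) (sym q≡p+1)))))
                    (ℕP.<-trans (ℕP.n<1+n _))
    ... | no _ | no _ | no _ | no _ = refl

    swapValues : Fin k → Fin k → Vec (Fin k) k → Vec (Fin k) k
    swapValues p q σ = V.map (transposition p q) σ

    lookup-swapValues : ∀ p q (σ : Vec (Fin k) k) i → lookup (swapValues p q σ) i ≡ transposition p q (lookup σ i)
    lookup-swapValues p q σ i = VecP.lookup-map i (transposition p q) σ

    swapValues-involutive : ∀ p q (σ : Vec (Fin k) k) → swapValues p q (swapValues p q σ) ≡ σ
    swapValues-involutive p q σ = Vec-ext λ i →
      trans (lookup-swapValues p q (swapValues p q σ) i)
            (trans (cong (transposition p q) (lookup-swapValues p q σ i)) (transposition-involutive p q _))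

    isPerm-swapValues : ∀ p q (σ : Vec (Fin k) k) → isPerm σ ≡ true → isPerm (swapValues p q σ) ≡ true
    isPerm-swapValues p q σ h = injection⇒isPerm (swapValues p q σ) λ i j e →
      isPerm⇒injection σ h i j (trans (sym (transposition-involutive p q _))
        (trans (cong (transposition p q) (trans (sym (lookup-swapValues p q σ i)) (trans e (lookup-swapValues p q σ j))))
               (transposition-involutive p q _)))

    isInversion-values : ∀ (τ : Vec (Fin k) k) i j {a b} → lookup τ i ≡ a → lookup τ j ≡ b →
                         isInversion τ (i , j) ≡ (toℕ i <ᵇ toℕ j) ∧ (toℕ b <ᵇ toℕ a)
    isInversion-values τ i j τi≡a τj≡b = cong₂ (λ a b → (toℕ i <ᵇ toℕ j) ∧ (toℕ b <ᵇ toℕ a)) τi≡a τj≡b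

    -- Only the pair of positions holding the values p and p + 1 changes its inversion status.
    inversions-swapAdjacent : ∀ p q → toℕ q ≡ suc (toℕ p) → (σ : Vec (Fin k) k) → IsInjection σ →
      ∀ i₀ j₀ → lookup σ i₀ ≡ p → lookup σ j₀ ≡ q →
      + inversions (swapValues p q σ) + 𝟙 (toℕ j₀ <ᵇ toℕ i₀) ≡ + inversions σ + 𝟙 (toℕ i₀ <ᵇ toℕ j₀)
    inversions-swapAdjacent p q q≡p+1 σ inj i₀ j₀ σi₀ σj₀ =
      begin
        + inversions σ′ + c₁
      ≡⟨ cong₂ _+_ (inversions≡∑ σ′) (sym (sift (j₀ , i₀) refl (λ _ → c₁))) ⟩
        ∑ pairs (λ x → 𝟙 (isInversion σ′ x)) + ∑ pairs (λ x → δ² (j₀ , i₀) x * c₁)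
      ≡⟨ sym (∑-+ pairs _ _) ⟩
        ∑ pairs (λ x → 𝟙 (isInversion σ′ x) + δ² (j₀ , i₀) x * c₁)
      ≡⟨ ∑-cong pairs (λ x → pointwise x (x ≟² (i₀ , j₀)) (x ≟² (j₀ , i₀))) ⟩
        ∑ pairs (λ x → 𝟙 (isInversion σ x) + δ² (i₀ , j₀) x * c₂)
      ≡⟨ ∑-+ pairs _ _ ⟩
        ∑ pairs (λ x → 𝟙 (isInversion σ x)) + ∑ pairs (λ x → δ² (i₀ , j₀) x * c₂)
      ≡⟨ cong₂ _+_ (sym (inversions≡∑ σ)) (sift (i₀ , j₀) refl (λ _ → c₂)) ⟩
        + inversions σ + c₂
      ∎
      where
      open ≡-Reasoning
      open Kronecker _≟²_ using () renaming (δ to δ²; δ-refl to δ²-refl; δ-≢ to δ²-≢)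
      sift = Kronecker.Enumerates-sift _≟²_ pairs-enumerates
      σ′ = swapValues p q σ
      c₁ = 𝟙 (toℕ j₀ <ᵇ toℕ i₀)
      c₂ = 𝟙 (toℕ i₀ <ᵇ toℕ j₀)
      p<ᵇq : (toℕ p <ᵇ toℕ q) ≡ true
      p<ᵇq = <⇒<ᵇ≡true (subst (toℕ p <_) (sym q≡p+1) (ℕP.n<1+n (toℕ p)))
      q<ᵇp : (toℕ q <ᵇ toℕ p) ≡ false
      q<ᵇp = ≮⇒<ᵇ≡false {toℕ q} {toℕ p} (λ q<p → ℕP.<-asym q<p (<ᵇ≡true⇒< {toℕ p} p<ᵇq))
      i₀≢j₀ : ¬ i₀ ≡ j₀
      i₀≢j₀ refl = ℕP.<-irrefl (cong toℕ (trans (sym σi₀) σj₀)) (<ᵇ≡true⇒< p<ᵇq)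
      σ′i₀ : lookup σ′ i₀ ≡ q
      σ′i₀ = trans (lookup-swapValues p q σ i₀) (trans (cong (transposition p q) σi₀) (transposition-p p q))
      σ′j₀ : lookup σ′ j₀ ≡ p
      σ′j₀ = trans (lookup-swapValues p q σ j₀) (trans (cong (transposition p q) σj₀) (transposition-q p q))
      pointwise : ∀ x → Dec (x ≡ (i₀ , j₀)) → Dec (x ≡ (j₀ , i₀)) →
                  𝟙 (isInversion σ′ x) + δ² (j₀ , i₀) x * c₁ ≡ 𝟙 (isInversion σ x) + δ² (i₀ , j₀) x * c₂
      pointwise _ (yes refl) _ =
        trans (cong₂ (λ a d → 𝟙 a + d * c₁)
                     (trans (isInversion-values σ′ i₀ j₀ σ′i₀ σ′j₀)
                            (trans (cong ((toℕ i₀ <ᵇ toℕ j₀) ∧_) p<ᵇq) (BoolP.∧-identityʳ _)))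
                     (δ²-≢ (λ e → i₀≢j₀ (cong proj₁ (sym e)))))
        (trans (+-identityʳ c₂)
        (sym (trans (cong₂ (λ a d → 𝟙 a + d * c₂)
                           (trans (isInversion-values σ i₀ j₀ σi₀ σj₀)
                                  (trans (cong ((toℕ i₀ <ᵇ toℕ j₀) ∧_) q<ᵇp) (BoolP.∧-zeroʳ _)))
                           (δ²-refl (i₀ , j₀)))
                    (trans (+-identityˡ _) (*-identityˡ c₂)))))
      pointwise _ (no ≢i₀j₀) (yes refl) =
        trans (cong₂ (λ a d → 𝟙 a + d * c₁)
                     (trans (isInversion-values σ′ j₀ i₀ σ′j₀ σ′i₀)
                            (trans (cong ((toℕ j₀ <ᵇ toℕ i₀) ∧_) q<ᵇp) (BoolP.∧-zeroʳ _)))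
                     (δ²-refl (j₀ , i₀)))
        (trans (+-identityˡ _) (trans (*-identityˡ c₁)
        (sym (trans (cong₂ (λ a d → 𝟙 a + d * c₂)
                           (trans (isInversion-values σ j₀ i₀ σj₀ σi₀)
                                  (trans (cong ((toℕ j₀ <ᵇ toℕ i₀) ∧_) p<ᵇq) (BoolP.∧-identityʳ _)))
                           (δ²-≢ (λ e → ≢i₀j₀ (sym e))))
                    (+-identityʳ c₁)))))
      pointwise (i , j) (no ≢i₀j₀) (no ≢j₀i₀) =
        cong₂ _+_ (cong 𝟙 (cong ((toℕ i <ᵇ toℕ j) ∧_) (same-order i j ≢i₀j₀ ≢j₀i₀)))
                  (trans (cong (_* c₁) (δ²-≢ (λ e → ≢j₀i₀ (sym e))))
                         (sym (cong (_* c₂) (δ²-≢ (λ e → ≢i₀j₀ (sym e))))))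
        where
        same-order : ∀ i j → ¬ (i , j) ≡ (i₀ , j₀) → ¬ (i , j) ≡ (j₀ , i₀) →
                     (toℕ (lookup σ′ j) <ᵇ toℕ (lookup σ′ i)) ≡ (toℕ (lookup σ j) <ᵇ toℕ (lookup σ i))
        same-order i j ≢₁ ≢₂ =
          trans (cong₂ (λ a b → toℕ a <ᵇ toℕ b) (lookup-swapValues p q σ j) (lookup-swapValues p q σ i))
                (adjacentTransposition-<ᵇ p q q≡p+1 (lookup σ i) (lookup σ j)
                   (λ { (e₁ , e₂) → ≢₁ (cong₂ _,_ (inj _ _ (trans e₁ (sym σi₀))) (inj _ _ (trans e₂ (sym σj₀)))) })
                   (λ { (e₁ , e₂) → ≢₂ (cong₂ _,_ (inj _ _ (trans e₁ (sym σj₀))) (inj _ _ (trans e₂ (sym σi₀)))) }))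

    sgn-swapAdjacent : ∀ p q → toℕ q ≡ suc (toℕ p) → (σ : Vec (Fin k) k) → isPerm σ ≡ true →
                       sgn (swapValues p q σ) ≡ - sgn σ
    sgn-swapAdjacent p q q≡p+1 σ pσ = parity (toℕ i₀ <ᵇ toℕ j₀) (toℕ j₀ <ᵇ toℕ i₀) refl refl
      where
      inj = isPerm⇒injection σ pσ
      i₀ = lookup (invPerm σ) p
      j₀ = lookup (invPerm σ) q
      σ′ = swapValues p q σ
      balance : + inversions σ′ + 𝟙 (toℕ j₀ <ᵇ toℕ i₀) ≡ + inversions σ + 𝟙 (toℕ i₀ <ᵇ toℕ j₀)
      balance = inversions-swapAdjacent p q q≡p+1 σ inj i₀ j₀ (σ∘σ⁻¹ σ inj p) (σ∘σ⁻¹ σ inj q)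
      i₀≢j₀ : ¬ i₀ ≡ j₀
      i₀≢j₀ e = ℕP.<-irrefl (cong toℕ (trans (sym (σ∘σ⁻¹ σ inj p)) (trans (cong (lookup σ) e) (σ∘σ⁻¹ σ inj q))))
                            (subst (toℕ p <_) (sym q≡p+1) (ℕP.n<1+n (toℕ p)))
      ≮ᵇ : ∀ {a b} → (a <ᵇ b) ≡ false → b ℕ.≤ a
      ≮ᵇ e = ℕP.≮⇒≥ (λ a<b → false≢true (trans (sym e) (<⇒<ᵇ≡true a<b)))
      counts : ∀ {a b} → (toℕ i₀ <ᵇ toℕ j₀) ≡ a → (toℕ j₀ <ᵇ toℕ i₀) ≡ b →
               inversions σ′ ℕ.+ 𝟙ℕ b ≡ inversions σ ℕ.+ 𝟙ℕ a
      counts {a} {b} e₁ e₂ = ℤP.+-injective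
        (trans (cong (λ c → + inversions σ′ + c) (trans (𝟙ℕ-𝟙 b) (cong 𝟙 (sym e₂))))
        (trans balance (cong (λ c → + inversions σ + c) (trans (cong 𝟙 e₁) (sym (𝟙ℕ-𝟙 a))))))
      parity : ∀ a b → (toℕ i₀ <ᵇ toℕ j₀) ≡ a → (toℕ j₀ <ᵇ toℕ i₀) ≡ b → sgn σ′ ≡ - sgn σ
      parity true true e₁ e₂ = ⊥-elim (ℕP.<-asym (<ᵇ≡true⇒< {toℕ i₀} e₁) (<ᵇ≡true⇒< {toℕ j₀} e₂))
      parity false false e₁ e₂ = ⊥-elim (i₀≢j₀ (FinP.toℕ-injective (ℕP.≤-antisym (≮ᵇ e₂) (≮ᵇ e₁))))
      parity true false e₁ e₂ =
        trans (cong negOnePow (trans (sym (ℕP.+-identityʳ _)) (trans (counts e₁ e₂) (ℕP.+-comm (inversions σ) 1))))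
              (negOnePow-suc (inversions σ))
      parity false true e₁ e₂ =
        trans (sym (neg-involutive _)) (cong -_ (trans (sym (negOnePow-suc (inversions σ′)))
          (cong negOnePow (trans (ℕP.+-comm 1 (inversions σ′)) (trans (counts e₁ e₂) (ℕP.+-identityʳ _))))))

  _≟ₘ_ : ∀ {m k} → DecidableEquality (Mono m k)
  (a , b) ≟ₘ (c , d) with VecP.≡-dec ℤ._≟_ a c | VecP.≡-dec ℕ._≟_ b d
  ... | yes refl | yes refl = yes refl
  ... | yes _ | no b≢d = no (λ e → b≢d (cong proj₂ e))
  ... | no a≢c | _ = no (λ e → a≢c (cong proj₁ e))

  open module KroneckerMono {m k : ℕ} = Kronecker (_≟ₘ_ {m} {k}) using (δ; δ-refl; δ-≢)

  monoEq≡δ : ∀ {m k} (μ ν : Mono m k) → (if monoEq μ ν then + 1 else + 0) ≡ δ μ ν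
  monoEq≡δ (a , b) (c , d) with VecP.≡-dec ℤ._≟_ a c | VecP.≡-dec ℕ._≟_ b d
  ... | yes refl | yes refl = refl
  ... | yes refl | no _ = refl
  ... | no _ | _ = refl

  coeff≡∑ : ∀ {m k} (p : Poly m k) (μ : Mono m k) → coeff p μ ≡ ∑ p (λ t → proj₁ t * δ (proj₂ t) μ)
  coeff≡∑ [] μ = refl
  coeff≡∑ ((a , ν) ∷ p) μ with monoEq ν μ in eq
  ... | true = cong₂ _+_ (trans (sym (*-identityʳ a))
                                (cong (a *_) (trans (cong (λ b → if b then + 1 else + 0) (sym eq)) (monoEq≡δ ν μ))))
                         (coeff≡∑ p μ)
  ... | false = trans (coeff≡∑ p μ) (sym (trans (cong (_+ ∑ p (λ t → proj₁ t * δ (proj₂ t) μ))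
                  (trans (cong (a *_) (trans (sym (monoEq≡δ ν μ)) (cong (λ b → if b then + 1 else + 0) eq))) (*-zeroʳ a)))
                  (+-identityˡ _)))

  -- _≈P_ of Defs, wrapped in a record so that both polynomials can be inferred from a proof.
  infix 4 _≈_
  record _≈_ {m k} (p q : Poly m k) : Set where
    constructor mk≈
    field un : ∀ μ → coeff p μ ≡ coeff q μ
  open _≈_ public

  module _ {m k : ℕ} where
    ≈refl : {p : Poly m k} → p ≈ p
    ≈refl = mk≈ λ μ → refl

    ≈sym : {p q : Poly m k} → p ≈ q → q ≈ p
    ≈sym e = mk≈ λ μ → sym (un e μ)

    ≈trans : {p q r : Poly m k} → p ≈ q → q ≈ r → p ≈ r
    ≈trans e f = mk≈ λ μ → trans (un e μ) (un f μ)

    ≡→≈ : {p q : Poly m k} → p ≡ q → p ≈ q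
    ≡→≈ refl = ≈refl

  module ≈-Reasoning {m k : ℕ} where
    infix  3 _∎
    infixr 2 _≈⟨_⟩_
    infix  1 begin_

    begin_ : {p q : Poly m k} → p ≈ q → p ≈ q
    begin e = e

    _≈⟨_⟩_ : (p : Poly m k) {q r : Poly m k} → p ≈ q → q ≈ r → p ≈ r
    p ≈⟨ e ⟩ f = ≈trans e f

    _∎ : (p : Poly m k) → p ≈ p
    p ∎ = ≈refl

  module _ {m k : ℕ} where
    coeff-++ : (p q : Poly m k) (μ : Mono m k) → coeff (p ++ q) μ ≡ coeff p μ + coeff q μ
    coeff-++ p q μ = trans (coeff≡∑ (p ++ q) μ) (trans (∑-++ p q _) (sym (cong₂ _+_ (coeff≡∑ p μ) (coeff≡∑ q μ))))

    +P-cong : {p p′ q q′ : Poly m k} → p ≈ p′ → q ≈ q′ → (p +P q) ≈ (p′ +P q′)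
    +P-cong {p} {p′} {q} {q′} e f =
      mk≈ λ μ → trans (coeff-++ p q μ) (trans (cong₂ _+_ (un e μ) (un f μ)) (sym (coeff-++ p′ q′ μ)))

    +P-comm : (p q : Poly m k) → (p +P q) ≈ (q +P p)
    +P-comm p q = mk≈ λ μ → trans (coeff-++ p q μ) (trans (ℤP.+-comm (coeff p μ) (coeff q μ)) (sym (coeff-++ q p μ)))

    +P-identityʳ : (p : Poly m k) → (p +P []) ≈ p
    +P-identityʳ p = mk≈ λ μ → trans (coeff-++ p [] μ) (+-identityʳ _)

    monoMul-comm : (μ ν : Mono m k) → monoMul μ ν ≡ monoMul ν μ
    monoMul-comm (a , b) (c , d) = cong₂ _,_ (VecP.zipWith-comm ℤP.+-comm a c) (VecP.zipWith-comm ℕP.+-comm b d)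

    monoMul-assoc : (μ ν κ : Mono m k) → monoMul (monoMul μ ν) κ ≡ monoMul μ (monoMul ν κ)
    monoMul-assoc (a , b) (c , d) (e , f) =
      cong₂ _,_ (VecP.zipWith-assoc ℤP.+-assoc a c e) (VecP.zipWith-assoc ℕP.+-assoc b d f)

    monoMul-identityˡ : (μ : Mono m k) → monoMul monoOne μ ≡ μ
    monoMul-identityˡ (a , b) = cong₂ _,_ (VecP.zipWith-identityˡ +-identityˡ a) (VecP.zipWith-identityˡ ℕP.+-identityˡ b)

  mon : ∀ {m k} → ℤ → Mono m k → Poly m k
  mon c μ = (c , μ) ∷ []

  noX : ∀ {m} → Vec ℤ m
  noX = replicate _ (+ 0)

  noQ : ∀ {k} → Vec ℕ k
  noQ = replicate _ 0

  coeff-mon : ∀ {m k} (c : ℤ) (ν μ : Mono m k) → coeff (mon c ν) μ ≡ c * δ ν μ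
  coeff-mon c ν μ = trans (coeff≡∑ (mon c ν) μ) (+-identityʳ _)

  mapP : ∀ {m k m′ k′} → (Mono m k → Mono m′ k′) → Poly m k → Poly m′ k′
  mapP h = map (λ t → (proj₁ t , h (proj₂ t)))

  HasPartialInverse : ∀ {m k m′ k′} → (Mono m k → Mono m′ k′) → Set
  HasPartialInverse {m} {k} {m′} {k′} h =
    ∀ (ν : Mono m′ k′) → (Σ (Mono m k) λ μ₀ → ∀ μ → δ (h μ) ν ≡ δ μ μ₀) ⊎ (∀ μ → δ (h μ) ν ≡ + 0)

  IsMonoHom : ∀ {m k m′ k′} → (Mono m k → Mono m′ k′) → Set
  IsMonoHom h = ∀ μ ν → h (monoMul μ ν) ≡ monoMul (h μ) (h ν)

  module _ {m k m′ k′ : ℕ} (h : Mono m k → Mono m′ k′) where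
    coeff-mapP : (p : Poly m k) (ν : Mono m′ k′) → coeff (mapP h p) ν ≡ ∑ p (λ t → proj₁ t * δ (h (proj₂ t)) ν)
    coeff-mapP p ν = trans (coeff≡∑ (mapP h p) ν) (∑-map _ p _)

    mapP-cong : HasPartialInverse h → {p q : Poly m k} → p ≈ q → mapP h p ≈ mapP h q
    mapP-cong partialInverse {p} {q} e = mk≈ λ ν → trans (coeff-mapP p ν) (trans (pull ν) (sym (coeff-mapP q ν)))
      where
      pull : ∀ ν → ∑ p (λ t → proj₁ t * δ (h (proj₂ t)) ν) ≡ ∑ q (λ t → proj₁ t * δ (h (proj₂ t)) ν)
      pull ν with partialInverse ν
      ... | inj₁ (μ₀ , f) =
        trans (∑-cong p (λ t → cong (proj₁ t *_) (f (proj₂ t))))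
        (trans (sym (coeff≡∑ p μ₀)) (trans (un e μ₀) (trans (coeff≡∑ q μ₀)
        (∑-cong q (λ t → cong (proj₁ t *_) (sym (f (proj₂ t))))))))
      ... | inj₂ f =
        trans (∑-cong p (λ t → trans (cong (proj₁ t *_) (f (proj₂ t))) (*-zeroʳ (proj₁ t))))
        (trans (∑-zero p) (sym (trans (∑-cong q (λ t → trans (cong (proj₁ t *_) (f (proj₂ t))) (*-zeroʳ (proj₁ t)))) (∑-zero q))))

  quotientℤ : ∀ {n} (κ μ : Vec ℤ n) → Σ (Vec ℤ n) λ ν₀ → ∀ ν → zipWith _+_ ν κ ≡ μ ⇔ ν ≡ ν₀
  quotientℤ [] [] = [] , λ { [] → mk⇔ (λ _ → refl) (λ _ → refl) }
  quotientℤ (a ∷ κ) (b ∷ μ) with quotientℤ κ μ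
  ... | ν₀ , f = (b ℤ.- a) ∷ ν₀ , λ { (c ∷ ν) → mk⇔
        (λ e → cong₂ _∷_ (subtract c (VecP.∷-injectiveˡ e)) (Equivalence.to (f ν) (VecP.∷-injectiveʳ e)))
        (λ e → cong₂ _∷_ (add c (VecP.∷-injectiveˡ e)) (Equivalence.from (f ν) (VecP.∷-injectiveʳ e))) }
    where
    subtract : ∀ c → c + a ≡ b → c ≡ b ℤ.- a
    subtract c refl = sym (trans (+-assoc c a (- a)) (trans (cong (λ s → c + s) (+-inverseʳ a)) (+-identityʳ c)))
    add : ∀ c → c ≡ b ℤ.- a → c + a ≡ b
    add c refl = trans (+-assoc b (- a) a) (trans (cong (λ s → b + s) (+-inverseˡ a)) (+-identityʳ b))

  quotientℕ? : ∀ {n} (κ μ : Vec ℕ n) →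
               (Σ (Vec ℕ n) λ ν₀ → ∀ ν → zipWith ℕ._+_ ν κ ≡ μ ⇔ ν ≡ ν₀) ⊎ (∀ ν → ¬ zipWith ℕ._+_ ν κ ≡ μ)
  quotientℕ? [] [] = inj₁ ([] , λ { [] → mk⇔ (λ _ → refl) (λ _ → refl) })
  quotientℕ? (a ∷ κ) (b ∷ μ) with quotientℕ? κ μ | a ℕP.≤? b
  ... | inj₂ g | _ = inj₂ λ { (c ∷ ν) e → g ν (VecP.∷-injectiveʳ e) }
  ... | inj₁ _ | no a≰b = inj₂ λ { (c ∷ ν) e → a≰b (subst (a ℕ.≤_) (VecP.∷-injectiveˡ e) (ℕP.m≤n+m a c)) }
  ... | inj₁ (ν₀ , f) | yes a≤b = inj₁ ((b ∸ a) ∷ ν₀ , λ { (c ∷ ν) → mk⇔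
        (λ e → cong₂ _∷_ (subtract c (VecP.∷-injectiveˡ e)) (Equivalence.to (f ν) (VecP.∷-injectiveʳ e)))
        (λ e → cong₂ _∷_ (add c (VecP.∷-injectiveˡ e)) (Equivalence.from (f ν) (VecP.∷-injectiveʳ e))) })
    where
    subtract : ∀ c → c ℕ.+ a ≡ b → c ≡ b ∸ a
    subtract c refl = sym (ℕP.m+n∸n≡m c a)
    add : ∀ c → c ≡ b ∸ a → c ℕ.+ a ≡ b
    add c refl = ℕP.m∸n+n≡m a≤b

  monoMul-partialInverse : ∀ {m k} (κ : Mono m k) → HasPartialInverse (λ ν → monoMul ν κ)
  monoMul-partialInverse (κ₁ , κ₂) (μ₁ , μ₂) with quotientℤ κ₁ μ₁ | quotientℕ? κ₂ μ₂
  ... | _ | inj₂ g = inj₂ λ { (ν₁ , ν₂) → δ-≢ (λ e → g ν₂ (cong proj₂ e)) }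
  ... | (a₀ , f₁) | inj₁ (b₀ , f₂) = inj₁ ((a₀ , b₀) , λ { (ν₁ , ν₂) → 𝟙?-cong
        (λ e → cong₂ _,_ (Equivalence.to (f₁ ν₁) (cong proj₁ e)) (Equivalence.to (f₂ ν₂) (cong proj₂ e)))
        (λ e → cong₂ _,_ (Equivalence.from (f₁ ν₁) (cong proj₁ e)) (Equivalence.from (f₂ ν₂) (cong proj₂ e))) _ _ })

  ∑-*P : ∀ {m k} (p q : Poly m k) (F : ℤ × Mono m k → ℤ) →
         ∑ (p *P q) F ≡ ∑ p (λ s → ∑ q (λ t → F (proj₁ s * proj₁ t , monoMul (proj₂ s) (proj₂ t))))
  ∑-*P p q F = trans (∑-concatMap _ p F) (∑-cong p (λ s → ∑-map _ q F))

  coeff-*P : ∀ {m k} (p q : Poly m k) (μ : Mono m k) →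
             coeff (p *P q) μ ≡ ∑ p (λ s → ∑ q (λ t → (proj₁ s * proj₁ t) * δ (monoMul (proj₂ s) (proj₂ t)) μ))
  coeff-*P p q μ = trans (coeff≡∑ (p *P q) μ) (∑-*P p q _)

  -- Reduces congruence of _*P_ to mapP-cong for the translations ν ↦ ν · proj₂ s.
  coeff-*P-translate : ∀ {m k} (p q : Poly m k) (μ : Mono m k) →
                       coeff (p *P q) μ ≡ ∑ p (λ s → proj₁ s * coeff (mapP (λ ν → monoMul ν (proj₂ s)) q) μ)
  coeff-*P-translate p q μ = trans (coeff-*P p q μ) (∑-cong p λ s →
    trans (∑-cong q (λ t → trans (*-assoc (proj₁ s) (proj₁ t) _)
                                 (cong (λ ν → proj₁ s * (proj₁ t * δ ν μ)) (monoMul-comm (proj₂ s) (proj₂ t)))))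
    (trans (∑-*ˡ q (proj₁ s) _) (cong (proj₁ s *_) (sym (coeff-mapP _ q μ)))))

  module _ {m k : ℕ} where
    *P-comm : (p q : Poly m k) → (p *P q) ≈ (q *P p)
    *P-comm p q = mk≈ λ μ → trans (coeff-*P p q μ) (trans (∑-swap p q _) (trans (∑-cong q (λ t → ∑-cong p (λ s →
       cong₂ _*_ (*-comm (proj₁ s) (proj₁ t)) (cong (λ ν → δ ν μ) (monoMul-comm (proj₂ s) (proj₂ t)))))) (sym (coeff-*P q p μ))))

    *P-congʳ : (p : Poly m k) {q q′ : Poly m k} → q ≈ q′ → (p *P q) ≈ (p *P q′)
    *P-congʳ p {q} {q′} e = mk≈ λ μ → trans (coeff-*P-translate p q μ) (trans (∑-cong p (λ s →
      cong (proj₁ s *_) (un (mapP-cong _ (monoMul-partialInverse (proj₂ s)) e) μ))) (sym (coeff-*P-translate p q′ μ)))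

    *P-congˡ : {p p′ : Poly m k} (q : Poly m k) → p ≈ p′ → (p *P q) ≈ (p′ *P q)
    *P-congˡ {p} {p′} q e = ≈trans (*P-comm p q) (≈trans (*P-congʳ q e) (*P-comm q p′))

    *P-cong : {p p′ q q′ : Poly m k} → p ≈ p′ → q ≈ q′ → (p *P q) ≈ (p′ *P q′)
    *P-cong {p} {p′} {q} {q′} e f = ≈trans (*P-congˡ q e) (*P-congʳ p′ f)

    *P-assoc : (p q r : Poly m k) → ((p *P q) *P r) ≈ (p *P (q *P r))
    *P-assoc p q r = mk≈ λ μ →
      trans (coeff-*P (p *P q) r μ) (trans (∑-*P p q _) (trans (∑-cong p (λ s → ∑-cong q (λ t → ∑-cong r (λ w →
        cong₂ _*_ (*-assoc (proj₁ s) (proj₁ t) (proj₁ w)) (cong (λ ν → δ ν μ) (monoMul-assoc (proj₂ s) (proj₂ t) (proj₂ w)))))))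
      (trans (∑-cong p (λ s → sym (∑-*P q r _))) (sym (coeff-*P p (q *P r) μ)))))

    *P-distribˡ : (p q r : Poly m k) → (p *P (q +P r)) ≈ ((p *P q) +P (p *P r))
    *P-distribˡ p q r = mk≈ λ μ → trans (coeff-*P p (q ++ r) μ) (trans (∑-cong p (λ s → ∑-++ q r _)) (trans (∑-+ p _ _)
      (sym (trans (coeff-++ (p *P q) (p *P r) μ) (cong₂ _+_ (coeff-*P p q μ) (coeff-*P p r μ))))))

    *P-identityˡ : (p : Poly m k) → (oneP *P p) ≈ p
    *P-identityˡ p = mk≈ λ μ → trans (coeff-*P oneP p μ) (trans (+-identityʳ _) (trans (∑-cong p (λ t →
       cong₂ _*_ (*-identityˡ (proj₁ t)) (cong (λ ν → δ ν μ) (monoMul-identityˡ (proj₂ t))))) (sym (coeff≡∑ p μ))))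

    *P-identityʳ : (p : Poly m k) → (p *P oneP) ≈ p
    *P-identityʳ p = ≈trans (*P-comm p oneP) (*P-identityˡ p)

    *P-zeroʳ : (p : Poly m k) → (p *P []) ≈ []
    *P-zeroʳ p = *P-comm p []

    *P-interchange : (a b c d : Poly m k) → ((a *P b) *P (c *P d)) ≈ ((a *P c) *P (b *P d))
    *P-interchange a b c d =
      ≈trans (*P-assoc a b (c *P d))
      (≈trans (*P-congʳ a (≈trans (≈sym (*P-assoc b c d)) (≈trans (*P-congˡ d (*P-comm b c)) (*P-assoc c b d))))
      (≈sym (*P-assoc a c (b *P d))))

    mon-* : (c c′ : ℤ) (ν ν′ : Mono m k) → (mon c ν *P mon c′ ν′) ≈ mon (c * c′) (monoMul ν ν′)
    mon-* c c′ ν ν′ = mk≈ λ μ →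
      trans (coeff≡∑ (mon c ν *P mon c′ ν′) μ) (sym (coeff≡∑ (mon (c * c′) (monoMul ν ν′)) μ))

    mon-cong : {c c′ : ℤ} {ν ν′ : Mono m k} → c ≡ c′ → ν ≡ ν′ → mon c ν ≈ mon c′ ν′
    mon-cong refl refl = ≈refl

    coeff-concat : (l : List (Poly m k)) (μ : Mono m k) → coeff (sumP l) μ ≡ ∑ l (λ p → coeff p μ)
    coeff-concat l μ = trans (coeff≡∑ (sumP l) μ) (trans (∑-concat l _) (∑-cong l (λ p → sym (coeff≡∑ p μ))))

    coeff-sumP : {A : Set} (F : A → Poly m k) (L : List A) (μ : Mono m k) → coeff (sumP (map F L)) μ ≡ ∑ L (λ x → coeff (F x) μ)
    coeff-sumP F L μ = trans (coeff≡∑ (sumP (map F L)) μ) (trans (∑-concat (map F L) _) (trans (∑-map F L _)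
                         (∑-cong L (λ x → sym (coeff≡∑ (F x) μ)))))

    sumP-cong-∈ : {A : Set} {F G : A → Poly m k} (L : List A) → (∀ x → x ∈ L → F x ≈ G x) → sumP (map F L) ≈ sumP (map G L)
    sumP-cong-∈ {F = F} {G} L e =
      mk≈ λ μ → trans (coeff-sumP F L μ) (trans (∑-cong-∈ L (λ x x∈ → un (e x x∈) μ)) (sym (coeff-sumP G L μ)))

    sumP-cong : {A : Set} {F G : A → Poly m k} (L : List A) → (∀ x → F x ≈ G x) → sumP (map F L) ≈ sumP (map G L)
    sumP-cong L e = sumP-cong-∈ L (λ x _ → e x)

    sumP-*ˡ : {A : Set} (p : Poly m k) (F : A → Poly m k) (L : List A) → (p *P sumP (map F L)) ≈ sumP (map (λ x → p *P F x) L)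
    sumP-*ˡ p F [] = *P-zeroʳ p
    sumP-*ˡ p F (x ∷ L) = ≈trans (*P-distribˡ p (F x) (sumP (map F L))) (+P-cong ≈refl (sumP-*ˡ p F L))

    sumP-*ʳ : {A : Set} (p : Poly m k) (F : A → Poly m k) (L : List A) → (sumP (map F L) *P p) ≈ sumP (map (λ x → F x *P p) L)
    sumP-*ʳ p F L = ≈trans (*P-comm _ p) (≈trans (sumP-*ˡ p F L) (sumP-cong L (λ x → *P-comm p (F x))))

    sumP-swap : {A B : Set} (F : A → B → Poly m k) (L₁ : List A) (L₂ : List B) →
      sumP (map (λ x → sumP (map (F x) L₂)) L₁) ≈ sumP (map (λ y → sumP (map (λ x → F x y) L₁)) L₂)
    sumP-swap F L₁ L₂ = mk≈ λ μ → trans (coeff-sumP _ L₁ μ) (trans (∑-cong L₁ (λ x → coeff-sumP (F x) L₂ μ))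
      (trans (∑-swap L₁ L₂ _) (sym (trans (coeff-sumP _ L₂ μ) (∑-cong L₂ (λ y → coeff-sumP (λ x → F x y) L₁ μ))))))

    sumP-map : {A B : Set} (f : A → B) (F : B → Poly m k) (L : List A) → sumP (map F (map f L)) ≈ sumP (map (λ x → F (f x)) L)
    sumP-map f F L = ≡→≈ (cong sumP (sym (LP.map-∘ L)))

    sumP-allVecs-suc : {A : Set} (xs : List A) (n : ℕ) (F : Vec A (suc n) → Poly m k) →
      sumP (map F (allVecs xs (suc n))) ≈ sumP (map (λ x → sumP (map (λ v → F (x ∷ v)) (allVecs xs n))) xs)
    sumP-allVecs-suc xs n F = mk≈ λ μ → trans (coeff-sumP F (allVecs xs (suc n)) μ) (trans (∑-allVecs-suc xs n (λ v → coeff (F v) μ))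
      (sym (trans (coeff-sumP _ xs μ) (∑-cong xs (λ x → coeff-sumP (λ v → F (x ∷ v)) (allVecs xs n) μ)))))

    sumP-reindex : {A : Set} (_≟_ : DecidableEquality A) {L : List A} {P : A → Bool} →
      Enumerates _≟_ L P → (g h : A → A) →
      (∀ x → P x ≡ true → P (g x) ≡ true) → (∀ x → P x ≡ true → P (h x) ≡ true) →
      (∀ x → P x ≡ true → h (g x) ≡ x) → (∀ y → P y ≡ true → g (h y) ≡ y) →
      (F : A → Poly m k) → sumP (map (λ x → F (g x)) L) ≈ sumP (map F L)
    sumP-reindex _≟_ {L} en g h gP hP hg gh F = mk≈ λ μ → trans (coeff-sumP (λ x → F (g x)) L μ)
      (trans (Kronecker.∑-reindex _≟_ en g h gP hP hg gh (λ x → coeff (F x) μ)) (sym (coeff-sumP F L μ)))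

    constP : ℤ → Poly m k
    constP c = mon c monoOne

    coeff-constP-* : (c : ℤ) (p : Poly m k) (μ : Mono m k) → coeff (constP c *P p) μ ≡ c * coeff p μ
    coeff-constP-* c p μ = trans (coeff-*P (constP c) p μ) (trans (+-identityʳ _) (trans (∑-cong p (λ t →
      trans (*-assoc c (proj₁ t) _) (cong (λ ν → c * (proj₁ t * δ ν μ)) (monoMul-identityˡ (proj₂ t)))))
      (trans (∑-*ˡ p c _) (cong (c *_) (sym (coeff≡∑ p μ))))))

    constP-*-cong : (c : ℤ) {p q : Poly m k} → p ≈ q → (constP c *P p) ≈ (constP c *P q)
    constP-*-cong c {p} {q} e = mk≈ λ μ → trans (coeff-constP-* c p μ) (trans (cong (c *_) (un e μ)) (sym (coeff-constP-* c q μ)))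

    constP-*-≡ : ∀ {a b} (p : Poly m k) → a ≡ b → (constP a *P p) ≈ (constP b *P p)
    constP-*-≡ p refl = ≈refl

    constP-one-* : (p : Poly m k) → (constP (+ 1) *P p) ≈ p
    constP-one-* p = *P-identityˡ p

    constP-zero-* : (p : Poly m k) → (constP (+ 0) *P p) ≈ []
    constP-zero-* p = mk≈ λ μ → coeff-constP-* (+ 0) p μ

    constP-*-constP : (c d : ℤ) (p : Poly m k) → (constP c *P (constP d *P p)) ≈ (constP (c * d) *P p)
    constP-*-constP c d p = mk≈ λ μ → trans (coeff-constP-* c (constP d *P p) μ)
      (trans (cong (c *_) (coeff-constP-* d p μ)) (trans (sym (*-assoc c d _)) (sym (coeff-constP-* (c * d) p μ))))

    *P-constP-comm : (c : ℤ) (p q : Poly m k) → (p *P (constP c *P q)) ≈ (constP c *P (p *P q))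
    *P-constP-comm c p q =
      ≈trans (≈sym (*P-assoc p (constP c) q)) (≈trans (*P-congˡ q (*P-comm p (constP c))) (*P-assoc (constP c) p q))

    constP-𝟙-* : ∀ b (p : Poly m k) → (constP (𝟙 b) *P p) ≈ (if b then p else [])
    constP-𝟙-* true p = constP-one-* p
    constP-𝟙-* false p = constP-zero-* p

  module _ {m k m′ k′ : ℕ} (h : Mono m k → Mono m′ k′) where
    mapP-* : IsMonoHom h → (p q : Poly m k) → mapP h (p *P q) ≈ (mapP h p *P mapP h q)
    mapP-* hom p q = mk≈ λ ν → trans (coeff-mapP h (p *P q) ν) (trans (∑-*P p q _) (trans (∑-cong p (λ s → ∑-cong q (λ t →
       cong (λ μ → proj₁ s * proj₁ t * δ μ ν) (hom (proj₂ s) (proj₂ t)))))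
       (sym (trans (coeff-*P (mapP h p) (mapP h q) ν) (trans (∑-map _ p _) (∑-cong p (λ s → ∑-map _ q _)))))))

    mapP-sumP : {A : Set} (F : A → Poly m k) (L : List A) → mapP h (sumP (map F L)) ≈ sumP (map (λ x → mapP h (F x)) L)
    mapP-sumP F L = mk≈ λ ν → trans (coeff-mapP h (sumP (map F L)) ν) (trans (∑-concat (map F L) _) (trans (∑-map F L _)
       (sym (trans (coeff-sumP _ L ν) (∑-cong L (λ x → coeff-mapP h (F x) ν))))))

    mapP-prodP : IsMonoHom h → h monoOne ≡ monoOne → (L : List (Poly m k)) → mapP h (prodP L) ≈ prodP (map (mapP h) L)
    mapP-prodP hom h-one [] = ≡→≈ (cong (λ μ → (+ 1 , μ) ∷ []) h-one)
    mapP-prodP hom h-one (p ∷ L) = ≈trans (mapP-* hom p (prodP L)) (*P-congʳ (mapP h p) (mapP-prodP hom h-one L))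

  consX : ∀ {m k} → ℕ → Mono m k → Mono (suc m) k
  consX a μ = (+ a ∷ proj₁ μ , proj₂ μ)

  consQ : ∀ {m k} → ℕ → Mono m k → Mono m (suc k)
  consQ a μ = (proj₁ μ , a ∷ proj₂ μ)

  consX-hom : ∀ {m k} → IsMonoHom (consX {m} {k} 0)
  consX-hom μ ν = refl

  consQ-hom : ∀ {m k} → IsMonoHom (consQ {m} {k} 0)
  consQ-hom μ ν = refl

  consX-partialInverse : ∀ {m k} a → HasPartialInverse (consX {m} {k} a)
  consX-partialInverse a ((x ∷ e) , γ) with x ℤ.≟ + a
  ... | yes refl = inj₁ ((e , γ) , λ μ → 𝟙?-cong (cong (λ ν → (V.tail (proj₁ ν) , proj₂ ν))) (cong (consX a)) _ _)
  ... | no x≢a = inj₂ λ μ → δ-≢ (λ e → x≢a (sym (cong (λ ν → V.head (proj₁ ν)) e)))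

  consQ-partialInverse : ∀ {m k} a → HasPartialInverse (consQ {m} {k} a)
  consQ-partialInverse a (e , (x ∷ γ)) with x ℕ.≟ a
  ... | yes refl = inj₁ ((e , γ) , λ μ → 𝟙?-cong (cong (λ ν → (proj₁ ν , V.tail (proj₂ ν)))) (cong (consQ a)) _ _)
  ... | no x≢a = inj₂ λ μ → δ-≢ (λ e → x≢a (sym (cong (λ ν → V.head (proj₂ ν)) e)))

  liftX : ∀ {m k} → ℕ → Poly m k → Poly (suc m) k
  liftX a = mapP (consX a)

  liftQ : ∀ {m k} → ℕ → Poly m k → Poly m (suc k)
  liftQ a = mapP (consQ a)

  -- Alternants

  alternant : ∀ {m k} → Vec ℕ k → Poly m k
  alternant {m} {k} β = map (λ σ → (sgn σ , (noX , V.map (lookup β) σ))) (perms k)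

  module _ {m k : ℕ} where
    coeff-alternant : (β : Vec ℕ k) (μ : Mono m k) →
                      coeff (alternant {m} β) μ ≡ ∑ (perms k) (λ σ → sgn σ * δ (noX , V.map (lookup β) σ) μ)
    coeff-alternant β μ = trans (coeff≡∑ (alternant β) μ) (∑-map _ (perms k) _)

    alternant≈sumP : (β : Vec ℕ k) → alternant {m} β ≈ sumP (map (λ σ → mon (sgn σ) (noX , V.map (lookup β) σ)) (perms k))
    alternant≈sumP β = mk≈ λ μ → trans (coeff-alternant β μ) (sym (trans (coeff-sumP _ (perms k) μ)
       (∑-cong (perms k) (λ σ → coeff-mon (sgn σ) (noX , V.map (lookup β) σ) μ))))

  x≡-x⇒x≡0 : ∀ x → x ≡ - x → x ≡ + 0
  x≡-x⇒x≡0 (+ zero) e = refl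
  x≡-x⇒x≡0 (+ suc n) ()
  x≡-x⇒x≡0 -[1+ n ] ()

  lookup-transposition : ∀ {k} (β : Vec ℕ k) (p q : Fin k) → lookup β p ≡ lookup β q →
                         ∀ x → lookup β (transposition p q x) ≡ lookup β x
  lookup-transposition β p q βp≡βq x with x FinP.≟ p | x FinP.≟ q
  ... | yes refl | _ = sym βp≡βq
  ... | no _ | yes refl = βp≡βq
  ... | no _ | no _ = refl

  -- σ ↦ (p q) ∘ σ is a sign-reversing involution on the terms of the alternant.
  alternant-vanishes : ∀ {m k} (β : Vec ℕ k) (p q : Fin k) → toℕ q ≡ suc (toℕ p) → lookup β p ≡ lookup β q →
                       alternant {m} β ≈ []
  alternant-vanishes {m} {k} β p q q≡p+1 βp≡βq = mk≈ λ μ → trans (coeff-alternant β μ) (x≡-x⇒x≡0 _ (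
    begin
      ∑ (perms k) (term μ)
    ≡⟨ sym (Kronecker.∑-reindex _≟ᵖ_ (perms-enumerates k) (swapValues p q) (swapValues p q)
              (isPerm-swapValues p q) (isPerm-swapValues p q)
              (λ σ _ → swapValues-involutive p q σ) (λ σ _ → swapValues-involutive p q σ) (term μ)) ⟩
      ∑ (perms k) (λ σ → term μ (swapValues p q σ))
    ≡⟨ ∑-cong-∈ (perms k) (λ σ σ∈ → term-swap μ σ (Kronecker.Enumerates-∈ _≟ᵖ_ (perms-enumerates k) σ σ∈)) ⟩
      ∑ (perms k) (λ σ → - term μ σ)
    ≡⟨ ∑-neg (perms k) (term μ) ⟩
      - ∑ (perms k) (term μ)
    ∎))
    where
    open ≡-Reasoning
    term : Mono m k → Vec (Fin k) k → ℤ
    term μ σ = sgn σ * δ {m} {k} (noX , V.map (lookup β) σ) μ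
    exponents-swap : ∀ σ → V.map (lookup β) (swapValues p q σ) ≡ V.map (lookup β) σ
    exponents-swap σ = trans (sym (VecP.map-∘ (lookup β) (transposition p q) σ))
                             (VecP.map-cong (lookup-transposition β p q βp≡βq) σ)
    term-swap : ∀ μ σ → isPerm σ ≡ true → term μ (swapValues p q σ) ≡ - term μ σ
    term-swap μ σ σ-perm =
      trans (cong₂ _*_ (sgn-swapAdjacent p q q≡p+1 σ σ-perm) (cong (λ e → δ (noX , e) μ) (exponents-swap σ)))
            (sym (neg-distribˡ-* (sgn σ) _))

  -- The Pieri rule

  #true : ∀ {k} → Vec Bool k → ℕ
  #true [] = 0
  #true (b ∷ ε) = 𝟙ℕ b ℕ.+ #true ε

  #true≡∑ : ∀ {k} (ε : Vec Bool k) → + #true ε ≡ ∑ (allFin k) (λ j → 𝟙 (lookup ε j))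
  #true≡∑ [] = refl
  #true≡∑ {suc k} (b ∷ ε) =
    trans (cong₂ _+_ (𝟙ℕ-𝟙 b) (#true≡∑ ε))
          (sym (trans (cong (λ l → ∑ l (λ j → 𝟙 (lookup (b ∷ ε) j))) (allFin-suc k))
                      (cong (λ s → 𝟙 b + s) (∑-map suc (allFin k) _))))

  𝟙ℕᵛ : ∀ {k} → Vec Bool k → Vec ℕ k
  𝟙ℕᵛ = V.map 𝟙ℕ

  addBit : ℕ → Bool → ℕ
  addBit b true = suc b
  addBit b false = b

  addBit-+ : ∀ b e → addBit b e ≡ b ℕ.+ 𝟙ℕ e
  addBit-+ b true = sym (ℕP.+-comm b 1)
  addBit-+ b false = sym (ℕP.+-identityʳ b)

  _⊕_ : ∀ {k} → Vec ℕ k → Vec Bool k → Vec ℕ k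
  β ⊕ ε = zipWith addBit β ε

  oneHot : ∀ {k} → Fin k → ℕ → Vec ℕ k
  oneHot {suc k} zero a = a ∷ noQ
  oneHot {suc k} (suc j) a = 0 ∷ oneHot j a

  negXPower : ∀ {m k} → ℕ → Poly (suc m) k
  negXPower c = mon (negOnePow c) ((+ c ∷ noX) , noQ)

  oneMinusXQ : ∀ {m k} → Fin k → Poly (suc m) k
  oneMinusXQ j = oneP +P mon (-[1+ 0 ]) ((+ 1 ∷ noX) , oneHot j 1)

  pieriProduct : ∀ m k → Poly (suc m) k
  pieriProduct m k = prodP (map (oneMinusXQ {m} {k}) (allFin k))

  negXQPower : ∀ {m k} → Bool → Poly (suc m) (suc k)
  negXQPower b = mon (negOnePow (𝟙ℕ b)) ((+ 𝟙ℕ b ∷ noX) , (𝟙ℕ b ∷ noQ))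

  oneMinusXQ-zero : ∀ {m k} → oneMinusXQ {m} {suc k} zero ≈ sumP (map (negXQPower {m} {k}) bools)
  oneMinusXQ-zero = ≈trans (+P-comm oneP (negXQPower true)) (+P-cong (≈refl {p = negXQPower true}) (≈sym (+P-identityʳ oneP)))

  pieriTerm : ∀ {m k} → Vec Bool k → Poly (suc m) k
  pieriTerm ε = mon (negOnePow (#true ε)) ((+ #true ε ∷ noX) , 𝟙ℕᵛ ε)

  bitVecs-enumerates : ∀ k → Enumerates (VecP.≡-dec BoolP._≟_) (allVecs bools k) (λ _ → true)
  bitVecs-enumerates k =
    Kronecker.Enumerates-cong (VecP.≡-dec BoolP._≟_) allᵇ-true (allVecs-enumerates BoolP._≟_ k bools-enumerates)

  zipWith-noXˡ : ∀ {m} (v : Vec ℤ m) → zipWith _+_ noX v ≡ v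
  zipWith-noXˡ v = VecP.zipWith-identityˡ +-identityˡ v

  zipWith-noQˡ : ∀ {k} (v : Vec ℕ k) → zipWith ℕ._+_ noQ v ≡ v
  zipWith-noQˡ v = VecP.zipWith-identityˡ ℕP.+-identityˡ v

  pieriProduct-expand : ∀ m k → pieriProduct m k ≈ sumP (map (pieriTerm {m} {k}) (allVecs bools k))
  pieriProduct-expand m zero = ≈sym (+P-identityʳ _)
  pieriProduct-expand m (suc k) =
    begin
      pieriProduct m (suc k)
    ≈⟨ ≡→≈ (cong (λ l → prodP (map oneMinusXQ l)) (allFin-suc k)) ⟩
      oneMinusXQ zero *P prodP (map oneMinusXQ (map suc (allFin k)))
    ≈⟨ ≡→≈ (cong (λ l → oneMinusXQ zero *P prodP l) (trans (sym (LP.map-∘ (allFin k))) (LP.map-∘ (allFin k)))) ⟩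
      oneMinusXQ zero *P prodP (map (liftQ 0) (map oneMinusXQ (allFin k)))
    ≈⟨ *P-congʳ (oneMinusXQ zero) (≈sym (mapP-prodP (consQ 0) consQ-hom refl (map oneMinusXQ (allFin k)))) ⟩
      oneMinusXQ zero *P liftQ 0 (pieriProduct m k)
    ≈⟨ *P-congʳ (oneMinusXQ zero) (≈trans (mapP-cong (consQ 0) (consQ-partialInverse 0) (pieriProduct-expand m k))
                                          (mapP-sumP (consQ 0) pieriTerm εs)) ⟩
      oneMinusXQ zero *P sumP (map lifted εs)
    ≈⟨ *P-congˡ (sumP (map lifted εs)) (oneMinusXQ-zero {m} {k}) ⟩
      sumP (map (negXQPower {m} {k}) bools) *P sumP (map lifted εs)
    ≈⟨ ≈trans (sumP-*ʳ (sumP (map lifted εs)) (negXQPower {m} {k}) bools)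
              (sumP-cong bools (λ b → sumP-*ˡ (negXQPower b) lifted εs)) ⟩
      sumP (map (λ b → sumP (map (λ ε → negXQPower b *P lifted ε) εs)) bools)
    ≈⟨ sumP-cong bools (λ b → sumP-cong εs (pieriTerm-∷ b)) ⟩
      sumP (map (λ b → sumP (map (λ ε → pieriTerm (b ∷ ε)) εs)) bools)
    ≈⟨ ≈sym (sumP-allVecs-suc bools k pieriTerm) ⟩
      sumP (map pieriTerm (allVecs bools (suc k)))
    ∎
    where
    open ≈-Reasoning
    εs = allVecs bools k
    lifted : Vec Bool k → Poly (suc m) (suc k)
    lifted ε = liftQ 0 (pieriTerm ε)
    pieriTerm-∷ : ∀ b ε → (negXQPower b *P lifted ε) ≈ pieriTerm (b ∷ ε)
    pieriTerm-∷ b ε =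
      ≈trans (mon-* (negOnePow (𝟙ℕ b)) (negOnePow (#true ε))
                    ((+ 𝟙ℕ b ∷ noX) , (𝟙ℕ b ∷ noQ)) ((+ #true ε ∷ noX) , (0 ∷ 𝟙ℕᵛ ε)))
             (mon-cong (sym (negOnePow-+ (𝟙ℕ b) (#true ε)))
                       (cong₂ _,_ (cong (+ (𝟙ℕ b ℕ.+ #true ε) ∷_) (zipWith-noXˡ noX))
                                  (cong₂ _∷_ (ℕP.+-identityʳ (𝟙ℕ b)) (zipWith-noQˡ (𝟙ℕᵛ ε)))))

  module _ {k : ℕ} (σ : Vec (Fin k) k) (σ-perm : isPerm σ ≡ true) where
    private
      inj = isPerm⇒injection σ σ-perm

    permuteBits unpermuteBits : Vec Bool k → Vec Bool k
    permuteBits ε = V.map (lookup ε) σ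
    unpermuteBits ε = V.map (lookup ε) (invPerm σ)

    unpermute∘permute : ∀ ε → unpermuteBits (permuteBits ε) ≡ ε
    unpermute∘permute ε = Vec-ext λ j →
      trans (VecP.lookup-map j (lookup (permuteBits ε)) (invPerm σ))
            (trans (VecP.lookup-map (lookup (invPerm σ) j) (lookup ε) σ) (cong (lookup ε) (σ∘σ⁻¹ σ inj j)))

    permute∘unpermute : ∀ ε → permuteBits (unpermuteBits ε) ≡ ε
    permute∘unpermute ε = Vec-ext λ i →
      trans (VecP.lookup-map i (lookup (unpermuteBits ε)) σ)
            (trans (VecP.lookup-map (lookup σ i) (lookup ε) (invPerm σ)) (cong (lookup ε) (σ⁻¹∘σ σ inj i)))

    #true-permuteBits : ∀ ε → #true (permuteBits ε) ≡ #true ε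
    #true-permuteBits ε = ℤP.+-injective (
      begin
        + #true (permuteBits ε)
      ≡⟨ #true≡∑ (permuteBits ε) ⟩
        ∑ (allFin k) (λ i → 𝟙 (lookup (permuteBits ε) i))
      ≡⟨ ∑-cong (allFin k) (λ i → cong 𝟙 (VecP.lookup-map i (lookup ε) σ)) ⟩
        ∑ (allFin k) (λ i → 𝟙 (lookup ε (lookup σ i)))
      ≡⟨ Kronecker.∑-reindex FinP._≟_ (allFin-enumerates k) (lookup σ) (lookup (invPerm σ)) (λ _ _ → refl) (λ _ _ → refl)
           (λ i _ → σ⁻¹∘σ σ inj i) (λ j _ → σ∘σ⁻¹ σ inj j) (λ j → 𝟙 (lookup ε j)) ⟩
        ∑ (allFin k) (λ j → 𝟙 (lookup ε j))
      ≡⟨ sym (#true≡∑ ε) ⟩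
        + #true ε
      ∎)
      where open ≡-Reasoning

    +ᵛ-permuteBits : (β : Vec ℕ k) (ε : Vec Bool k) →
                     zipWith ℕ._+_ (V.map (lookup β) σ) (𝟙ℕᵛ (permuteBits ε)) ≡ V.map (lookup (β ⊕ ε)) σ
    +ᵛ-permuteBits β ε = Vec-ext λ i →
      trans (VecP.lookup-zipWith ℕ._+_ i (V.map (lookup β) σ) (𝟙ℕᵛ (permuteBits ε)))
      (trans (cong₂ ℕ._+_ (VecP.lookup-map i (lookup β) σ)
                          (trans (VecP.lookup-map i 𝟙ℕ (permuteBits ε)) (cong 𝟙ℕ (VecP.lookup-map i (lookup ε) σ))))
      (sym (trans (VecP.lookup-map i (lookup (β ⊕ ε)) σ)
           (trans (VecP.lookup-zipWith addBit (lookup σ i) β ε) (addBit-+ (lookup β (lookup σ i)) (lookup ε (lookup σ i)))))))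

  pieri : ∀ {m k} (β : Vec ℕ k) →
          (alternant {suc m} β *P pieriProduct m k) ≈ sumP (map (λ ε → negXPower (#true ε) *P alternant (β ⊕ ε)) (allVecs bools k))
  pieri {m} {k} β =
    begin
      alternant β *P pieriProduct m k
    ≈⟨ *P-cong (alternant≈sumP β) (pieriProduct-expand m k) ⟩
      sumP (map (altTerm β) (perms k)) *P sumP (map pieriTerm εs)
    ≈⟨ ≈trans (sumP-*ʳ _ (altTerm β) (perms k)) (sumP-cong (perms k) (λ σ → sumP-*ˡ (altTerm β σ) pieriTerm εs)) ⟩
      sumP (map (λ σ → sumP (map (λ ε → altTerm β σ *P pieriTerm ε) εs)) (perms k))
    ≈⟨ sumP-cong-∈ (perms k) (λ σ σ∈ → relabel σ (Kronecker.Enumerates-∈ _≟ᵖ_ (perms-enumerates k) σ σ∈)) ⟩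
      sumP (map (λ σ → sumP (map (λ ε → productTerm σ ε) εs)) (perms k))
    ≈⟨ sumP-swap productTerm (perms k) εs ⟩
      sumP (map (λ ε → sumP (map (λ σ → productTerm σ ε) (perms k))) εs)
    ≈⟨ sumP-cong εs (λ ε → ≈sym (≈trans (*P-congʳ (negXPower (#true ε)) (alternant≈sumP (β ⊕ ε)))
                                (≈trans (sumP-*ˡ (negXPower (#true ε)) (altTerm (β ⊕ ε)) (perms k))
                                        (sumP-cong (perms k) (negXPower-* ε))))) ⟩
      sumP (map (λ ε → negXPower (#true ε) *P alternant (β ⊕ ε)) εs)
    ∎
    where
    open ≈-Reasoning
    εs = allVecs bools k
    altTerm : Vec ℕ k → Vec (Fin k) k → Poly (suc m) k
    altTerm γ σ = mon (sgn σ) (noX , V.map (lookup γ) σ)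
    productTerm : Vec (Fin k) k → Vec Bool k → Poly (suc m) k
    productTerm σ ε = mon (sgn σ * negOnePow (#true ε)) ((+ #true ε ∷ noX) , V.map (lookup (β ⊕ ε)) σ)
    negXPower-* : ∀ ε σ → (negXPower (#true ε) *P altTerm (β ⊕ ε) σ) ≈ productTerm σ ε
    negXPower-* ε σ =
      ≈trans (mon-* (negOnePow (#true ε)) (sgn σ) ((+ #true ε ∷ noX) , noQ) (noX , V.map (lookup (β ⊕ ε)) σ))
             (mon-cong (*-comm (negOnePow (#true ε)) (sgn σ))
                       (cong₂ _,_ (VecP.zipWith-identityʳ +-identityʳ _) (zipWith-noQˡ _)))
    -- Reindex by ε ↦ ε ∘ σ, using y^{β∘σ} y^{ε∘σ} = y^{(β ⊕ ε)∘σ}.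
    relabel : ∀ σ → isPerm σ ≡ true →
              sumP (map (λ ε → altTerm β σ *P pieriTerm ε) εs) ≈ sumP (map (productTerm σ) εs)
    relabel σ σ-perm =
      ≈trans (sumP-cong εs (λ ε → ≈trans (mon-* (sgn σ) (negOnePow (#true ε))
                                                (noX , V.map (lookup β) σ) ((+ #true ε ∷ noX) , 𝟙ℕᵛ ε))
                                         (mon-cong refl (cong₂ _,_ (zipWith-noXˡ _) refl))))
      (≈sym (≈trans (sumP-cong εs (λ ε → mon-cong (cong (λ c → sgn σ * negOnePow c) (sym (#true-permuteBits σ σ-perm ε)))
                                                  (cong₂ _,_ (cong (λ c → + c ∷ noX) (sym (#true-permuteBits σ σ-perm ε)))
                                                             (sym (+ᵛ-permuteBits σ σ-perm β ε)))))
              (sumP-reindex (VecP.≡-dec BoolP._≟_) (bitVecs-enumerates k) (permuteBits σ σ-perm) (unpermuteBits σ σ-perm)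
                 (λ _ _ → refl) (λ _ _ → refl) (λ ε _ → unpermute∘permute σ σ-perm ε) (λ ε _ → permute∘unpermute σ σ-perm ε)
                 (λ ε → mon (sgn σ * negOnePow (#true ε)) ((+ #true ε ∷ noX) , zipWith ℕ._+_ (V.map (lookup β) σ) (𝟙ℕᵛ ε))))))

  -- Skew tableaux
  --
  -- A filling T of the skew shape between exponent vectors B ≤ C has in column j the set
  -- T j ⊆ {0,…,m-1} of size c_j - b_j.  Adjacent columns are compared row by row after shifting
  -- by b_{j+1} - b_j - 1, the offset of the shape; for B = ρ this is the row condition rowOK
  -- of Defs, so skewSchur ρ (d + ρ) = V_d (skewSchur-staircase below).

  ≤ᵇ-Fin : ∀ {m} → Fin m → Fin m → Bool
  ≤ᵇ-Fin a b = toℕ a ≤ᵇ toℕ b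

  rowOKBy : ∀ {m} → ℕ → Vec Bool m → Vec Bool m → Bool
  rowOKBy offset L R = and (L.zipWith ≤ᵇ-Fin (members L) (drop offset (members R)))

  <ᵇhead : ∀ {k} → ℕ → Vec ℕ k → Bool
  <ᵇhead x [] = true
  <ᵇhead x (y ∷ _) = x <ᵇ y

  isStrict : ∀ {k} → Vec ℕ k → Bool
  isStrict [] = true
  isStrict (x ∷ v) = <ᵇhead x v ∧ isStrict v

  nextColumnOK : ∀ {m k} → ℕ → Vec Bool m → Vec ℕ k → Vec (Vec Bool m) k → Bool
  nextColumnOK b t [] [] = true
  nextColumnOK b t (b′ ∷ _) (t′ ∷ _) = rowOKBy (b′ ∸ suc b) t′ t

  columnOK : ∀ {m} → ℕ → ℕ → Vec Bool m → Bool
  columnOK b c t = (b ≤ᵇ c) ∧ (size t ≡ᵇ (c ∸ b))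

  isSkewTableau : ∀ {m k} → Vec ℕ k → Vec ℕ k → Vec (Vec Bool m) k → Bool
  isSkewTableau [] [] [] = true
  isSkewTableau (b ∷ B) (c ∷ C) (t ∷ T) = columnOK b c t ∧ (nextColumnOK b t B T ∧ isSkewTableau B C T)

  content : ∀ {m k} → Vec (Vec Bool m) k → Vec ℤ m
  content T = foldr (V.zipWith ℤ._+_) (replicate _ (+ 0)) (map indicator (toList T))

  skewSchur : ∀ {m k} → Vec ℕ k → Vec ℕ k → Poly m k
  skewSchur {m} {k} B C = map (λ T → (+ 1 , (content T , noQ))) (filterᵇ (isSkewTableau B C) (allVecs (allVecs bools m) k))

  size-∷ : ∀ {m} e (s : Vec Bool m) → size (e ∷ s) ≡ 𝟙ℕ e ℕ.+ size s
  size-∷ true s = cong suc (LP.length-map suc (members s))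
  size-∷ false s = LP.length-map suc (members s)

  and-zipWith-≤ᵇ-suc : ∀ {m} (xs ys : List (Fin m)) →
                       and (L.zipWith ≤ᵇ-Fin (map suc xs) (map suc ys)) ≡ and (L.zipWith ≤ᵇ-Fin xs ys)
  and-zipWith-≤ᵇ-suc [] ys = refl
  and-zipWith-≤ᵇ-suc (x ∷ xs) [] = refl
  and-zipWith-≤ᵇ-suc (x ∷ xs) (y ∷ ys) = cong₂ _∧_ (<ᵇ-suc (toℕ x) (toℕ y)) (and-zipWith-≤ᵇ-suc xs ys)

  zipWith-[]ʳ : ∀ {A B C : Set} (f : A → B → C) (xs : List A) → L.zipWith f xs [] ≡ []
  zipWith-[]ʳ f [] = refl
  zipWith-[]ʳ f (x ∷ xs) = refl

  and-zipWith-≤ᵇ-zero : ∀ {m} (xs : List (Fin (suc m))) ys →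
                        and (L.zipWith ≤ᵇ-Fin (zero ∷ xs) ys) ≡ and (L.zipWith ≤ᵇ-Fin xs (drop 1 ys))
  and-zipWith-≤ᵇ-zero xs [] = sym (cong and (zipWith-[]ʳ ≤ᵇ-Fin xs))
  and-zipWith-≤ᵇ-zero xs (y ∷ ys) = refl

  drop-1-drop : ∀ {A : Set} n (ys : List A) → drop 1 (drop n ys) ≡ drop (suc n) ys
  drop-1-drop n ys = trans (LP.drop-drop n 1 ys) (cong (λ i → drop i ys) (ℕP.+-comm n 1))

  -- How rowOKBy reacts to a new first row: the two Booleans say whether entry 0 lies in
  -- the left and the right column.
  module _ {m : ℕ} where
    private
      sucMembers : Vec Bool m → List (Fin (suc m))
      sucMembers s = map suc (members s)

    rowOKBy-ff : ∀ n (L R : Vec Bool m) → rowOKBy n (false ∷ L) (false ∷ R) ≡ rowOKBy n L R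
    rowOKBy-ff n L R = trans (cong (λ z → and (L.zipWith ≤ᵇ-Fin (sucMembers L) z)) (LP.drop-map n (members R)))
                             (and-zipWith-≤ᵇ-suc (members L) (drop n (members R)))

    rowOKBy-tt : ∀ n (L R : Vec Bool m) → rowOKBy n (true ∷ L) (true ∷ R) ≡ rowOKBy n L R
    rowOKBy-tt n L R =
      trans (and-zipWith-≤ᵇ-zero (sucMembers L) (drop n (zero ∷ sucMembers R)))
      (trans (cong (λ z → and (L.zipWith ≤ᵇ-Fin (sucMembers L) z)) (drop-1-drop n (zero ∷ sucMembers R))) (rowOKBy-ff n L R))

    rowOKBy-tf : ∀ n (L R : Vec Bool m) → rowOKBy n (true ∷ L) (false ∷ R) ≡ rowOKBy (suc n) L R
    rowOKBy-tf n L R =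
      trans (and-zipWith-≤ᵇ-zero (sucMembers L) (drop n (sucMembers R)))
      (trans (cong (λ z → and (L.zipWith ≤ᵇ-Fin (sucMembers L) z)) (drop-1-drop n (sucMembers R)))
      (rowOKBy-ff (suc n) L R))

    rowOKBy-ft-zero : ∀ (L R : Vec Bool m) → 1 ≤ size L → rowOKBy 0 (false ∷ L) (true ∷ R) ≡ false
    rowOKBy-ft-zero L R h with members L
    ... | x ∷ xs = refl
    ... | [] = ⊥-elim (ℕP.1+n≰n h)

  ∸-< : ∀ {b b′} → b < b′ → b′ ∸ b ≡ suc (b′ ∸ suc b)
  ∸-< {zero} {suc b′} _ = refl
  ∸-< {suc b} {suc b′} (s≤s b<b′) = ∸-< b<b′

  columnOK-addBit : ∀ {m} b c e (t : Vec Bool m) → columnOK b c (e ∷ t) ≡ columnOK (addBit b e) c t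
  columnOK-addBit b c false t = cong (λ z → (b ≤ᵇ c) ∧ (z ≡ᵇ (c ∸ b))) (size-∷ false t)
  columnOK-addBit b c true t = trans (cong (λ z → (b ≤ᵇ c) ∧ (z ≡ᵇ (c ∸ b))) (size-∷ true t)) (shift b c (size t))
    where
    shift : ∀ b c s → ((b ≤ᵇ c) ∧ (suc s ≡ᵇ (c ∸ b))) ≡ ((suc b ≤ᵇ c) ∧ (s ≡ᵇ (c ∸ suc b)))
    shift zero zero s = refl
    shift zero (suc c) s = refl
    shift (suc b) zero s = refl
    shift (suc b) (suc c) s = trans (cong (λ z → z ∧ (suc s ≡ᵇ (c ∸ b))) (<ᵇ-suc b c)) (shift b c s)

  ∧-regroup-if : ∀ P A H A′ S K → ((S ∧ K) ≡ true → P ≡ true → A ≡ (H ∧ A′)) →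
                 (P ∧ (A ∧ (S ∧ K))) ≡ ((H ∧ S) ∧ (P ∧ (A′ ∧ K)))
  ∧-regroup-if false A H A′ S K f = sym (BoolP.∧-zeroʳ (H ∧ S))
  ∧-regroup-if true A H A′ false K f = trans (BoolP.∧-zeroʳ A) (sym (cong (λ z → z ∧ (A′ ∧ K)) (BoolP.∧-zeroʳ H)))
  ∧-regroup-if true A H A′ true false f =
    trans (BoolP.∧-zeroʳ A) (sym (trans (cong (λ z → (H ∧ true) ∧ z) (BoolP.∧-zeroʳ A′)) (BoolP.∧-zeroʳ (H ∧ true))))
  ∧-regroup-if true A H A′ true true f rewrite f refl refl =
    trans (BoolP.∧-identityʳ (H ∧ A′))
          (sym (trans (cong (λ z → z ∧ (A′ ∧ true)) (BoolP.∧-identityʳ H)) (cong (H ∧_) (BoolP.∧-identityʳ A′))))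

  nextColumnOK-branch : ∀ {m k} b c e (t : Vec Bool m) (B C : Vec ℕ k) (ε : Vec Bool k) (T : Vec (Vec Bool m) k) →
    <ᵇhead b B ≡ true → <ᵇhead c C ≡ true →
    (isStrict (B ⊕ ε) ∧ isSkewTableau (B ⊕ ε) C T) ≡ true → columnOK (addBit b e) c t ≡ true →
    nextColumnOK b (e ∷ t) B (V.zipWith _∷_ ε T) ≡ (<ᵇhead (addBit b e) (B ⊕ ε) ∧ nextColumnOK (addBit b e) t (B ⊕ ε) T)
  nextColumnOK-branch b c e t [] [] [] [] _ _ _ _ = refl
  nextColumnOK-branch b c false t (b′ ∷ B) (c′ ∷ C) (false ∷ ε) (t′ ∷ T) b<b′ _ _ _ =
    trans (rowOKBy-ff (b′ ∸ suc b) t′ t) (cong (_∧ rowOKBy (b′ ∸ suc b) t′ t) (sym b<b′))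
  nextColumnOK-branch b c true t (b′ ∷ B) (c′ ∷ C) (true ∷ ε) (t′ ∷ T) b<b′ _ _ _ =
    trans (rowOKBy-tt (b′ ∸ suc b) t′ t) (cong (_∧ rowOKBy (b′ ∸ suc b) t′ t) (sym b<b′))
  nextColumnOK-branch b c false t (b′ ∷ B) (c′ ∷ C) (true ∷ ε) (t′ ∷ T) b<b′ _ _ _ =
    trans (rowOKBy-tf (b′ ∸ suc b) t′ t)
    (trans (cong (λ z → rowOKBy z t′ t) (sym (∸-< {b} {b′} (<ᵇ≡true⇒< {b} {b′} b<b′))))
      (cong (_∧ rowOKBy (b′ ∸ b) t′ t) (sym (<⇒<ᵇ≡true {b} {suc b′} (ℕP.m<n⇒m<1+n (<ᵇ≡true⇒< {b} {b′} b<b′))))))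
  nextColumnOK-branch b c true t (b′ ∷ B) (c′ ∷ C) (false ∷ ε) (t′ ∷ T) b<b′ c<c′ rest-ok column-ok with b′ ∸ suc b in gap
  ... | zero = trans (rowOKBy-ft-zero t′ t t′-nonempty) (sym (cong (_∧ rowOKBy (b′ ∸ suc (suc b)) t′ t) b+1≮b′))
    where
    b′≡b+1 : b′ ≡ suc b
    b′≡b+1 = ℕP.≤-antisym (ℕP.m∸n≡0⇒m≤n {b′} {suc b} gap) (<ᵇ≡true⇒< {b} {b′} b<b′)
    b+1≮b′ : (suc b <ᵇ b′) ≡ false
    b+1≮b′ = ≮⇒<ᵇ≡false {suc b} {b′} (ℕP.<-irrefl (sym b′≡b+1))
    b+1≤c : suc b ≤ c
    b+1≤c = ≤ᵇ≡true⇒≤ {suc b} {c} (∧≡true⇒ˡ column-ok)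
    next-column-ok : columnOK b′ c′ t′ ≡ true
    next-column-ok = ∧≡true⇒ˡ (∧≡true⇒ʳ {<ᵇhead b′ (B ⊕ ε) ∧ isStrict (B ⊕ ε)} rest-ok)
    t′-nonempty : 1 ≤ size t′
    t′-nonempty = subst (1 ≤_) (sym (≡ᵇ≡true⇒≡ (∧≡true⇒ʳ next-column-ok)))
                        (ℕP.m<n⇒0<n∸m (subst (_< c′) (sym b′≡b+1) (ℕP.≤-<-trans b+1≤c (<ᵇ≡true⇒< {c} {c′} c<c′))))
  ... | suc n = trans (rowOKBy-ff n t′ t)
                      (sym (trans (cong (_∧ rowOKBy (b′ ∸ suc (suc b)) t′ t) b+1<b′) (cong (λ z → rowOKBy z t′ t) gap′)))
    where
    b+1<b′ : (suc b <ᵇ b′) ≡ true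
    b+1<b′ = <⇒<ᵇ≡true {suc b} {b′} (ℕP.m∸n≢0⇒n<m {b′} {suc b} (λ e → ℕP.0≢1+n (sym (trans (sym gap) e))))
    gap′ : b′ ∸ suc (suc b) ≡ n
    gap′ = trans (sym (ℕP.pred[m∸n]≡m∸[1+n] b′ (suc b))) (cong ℕ.pred gap)

  isSkewTableau-branch : ∀ {m k} (B C : Vec ℕ k) (ε : Vec Bool k) (T : Vec (Vec Bool m) k) →
    isStrict B ≡ true → isStrict C ≡ true →
    isSkewTableau B C (V.zipWith _∷_ ε T) ≡ (isStrict (B ⊕ ε) ∧ isSkewTableau (B ⊕ ε) C T)
  isSkewTableau-branch [] [] [] [] _ _ = refl
  isSkewTableau-branch (b ∷ B) (c ∷ C) (e ∷ ε) (t ∷ T) B-strict C-strict =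
    trans (cong (λ z → columnOK b c (e ∷ t) ∧ (next ∧ z))
                (isSkewTableau-branch B C ε T (∧≡true⇒ʳ {<ᵇhead b B} B-strict) (∧≡true⇒ʳ {<ᵇhead c C} C-strict)))
    (trans (cong (λ z → z ∧ (next ∧ (isStrict (B ⊕ ε) ∧ isSkewTableau (B ⊕ ε) C T))) (columnOK-addBit b c e t))
    (∧-regroup-if (columnOK (addBit b e) c t) next (<ᵇhead (addBit b e) (B ⊕ ε)) (nextColumnOK (addBit b e) t (B ⊕ ε) T)
                  (isStrict (B ⊕ ε)) (isSkewTableau (B ⊕ ε) C T)
                  (nextColumnOK-branch b c e t B C ε T (∧≡true⇒ˡ B-strict) (∧≡true⇒ˡ C-strict))))
    where
    next = nextColumnOK b (e ∷ t) B (V.zipWith _∷_ ε T)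

  ∑-firstRow : ∀ {m} k (F : Vec (Vec Bool (suc m)) k → ℤ) →
               ∑ (allVecs (allVecs bools (suc m)) k) F ≡
               ∑ (allVecs bools k) (λ ε → ∑ (allVecs (allVecs bools m) k) (λ T → F (V.zipWith _∷_ ε T)))
  ∑-firstRow zero F = sym (+-identityʳ _)
  ∑-firstRow {m} (suc k) F =
    trans (∑-allVecs-suc (allVecs bools (suc m)) k F)
    (trans (∑-allVecs-suc bools m _)
    (trans (∑-cong bools (λ b → trans (∑-cong (allVecs bools m) (λ t → ∑-firstRow k (λ T → F ((b ∷ t) ∷ T))))
                                      (∑-swap (allVecs bools m) (allVecs bools k) _)))
    (sym (trans (∑-allVecs-suc bools k (λ ε → ∑ (allVecs (allVecs bools m) (suc k)) (λ T → F (V.zipWith _∷_ ε T))))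
                (∑-cong bools (λ b → ∑-cong (allVecs bools k) (λ ε →
                   ∑-allVecs-suc (allVecs bools m) k (λ T → F (V.zipWith _∷_ (b ∷ ε) T)))))))))

  content-zipWith-∷ : ∀ {m k} (ε : Vec Bool k) (T : Vec (Vec Bool m) k) → content (V.zipWith _∷_ ε T) ≡ (+ #true ε ∷ content T)
  content-zipWith-∷ [] [] = refl
  content-zipWith-∷ (e ∷ ε) (t ∷ T) rewrite content-zipWith-∷ ε T with e
  ... | true = refl
  ... | false = refl

  coeff-skewSchur : ∀ {m k} (B C : Vec ℕ k) (μ : Mono m k) →
    coeff (skewSchur B C) μ ≡ ∑ (allVecs (allVecs bools m) k) (λ T → if isSkewTableau B C T then δ (content T , noQ) μ else + 0)
  coeff-skewSchur {m} {k} B C μ =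
    trans (coeff≡∑ (skewSchur B C) μ)
    (trans (∑-map (λ T → (+ 1 , (content T , noQ))) (filterᵇ (isSkewTableau B C) tableaux) _)
    (trans (∑-filterᵇ (isSkewTableau B C) tableaux _)
           (∑-cong tableaux (λ T → cong (λ z → if isSkewTableau B C T then z else + 0) (*-identityˡ _)))))
    where tableaux = allVecs (allVecs bools m) k

  -- Branching rule: the first row of a filling is a 0/1-vector ε, and removing it leaves a
  -- filling of the shape between B ⊕ ε and C in one variable fewer.
  skewSchur-branch : ∀ {m k} (B C : Vec ℕ k) → isStrict B ≡ true → isStrict C ≡ true →
    skewSchur {suc m} B C ≈
      sumP (map (λ ε → if isStrict (B ⊕ ε) then liftX (#true ε) (skewSchur {m} (B ⊕ ε) C) else []) (allVecs bools k))
  skewSchur-branch {m} {k} B C B-strict C-strict = mk≈ λ μ →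
    trans (coeff-skewSchur B C μ) (trans (∑-firstRow k _)
    (trans (∑-cong (allVecs bools k) (λ ε → ∑-cong tableaux (λ T →
        trans (cong (λ z → if z then δ (content (V.zipWith _∷_ ε T) , noQ) μ else + 0) (isSkewTableau-branch B C ε T B-strict C-strict))
              (cong (λ z → if isStrict (B ⊕ ε) ∧ isSkewTableau (B ⊕ ε) C T then δ (z , noQ) μ else + 0) (content-zipWith-∷ ε T)))))
    (sym (trans (coeff-sumP _ (allVecs bools k) μ) (∑-cong (allVecs bools k) (λ ε → branch μ ε (isStrict (B ⊕ ε)) refl))))))
    where
    tableaux = allVecs (allVecs bools m) k
    branch : ∀ μ ε b → isStrict (B ⊕ ε) ≡ b →
      coeff (if b then liftX (#true ε) (skewSchur {m} (B ⊕ ε) C) else []) μ ≡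
      ∑ tableaux (λ T → if isStrict (B ⊕ ε) ∧ isSkewTableau (B ⊕ ε) C T then δ (+ #true ε ∷ content T , noQ) μ else + 0)
    branch μ ε true e rewrite e =
      trans (coeff-mapP (consX (#true ε)) (skewSchur (B ⊕ ε) C) μ)
      (trans (∑-map (λ T → (+ 1 , (content T , noQ))) (filterᵇ (isSkewTableau (B ⊕ ε) C) tableaux) _)
      (trans (∑-filterᵇ (isSkewTableau (B ⊕ ε) C) tableaux _)
             (∑-cong tableaux (λ T → cong (λ z → if isSkewTableau (B ⊕ ε) C T then z else + 0) (*-identityˡ _)))))
    branch μ ε false e rewrite e = sym (∑-zero tableaux)

  pointwise≤ : ∀ {k} → Vec ℕ k → Vec ℕ k → Bool
  pointwise≤ [] [] = true
  pointwise≤ (b ∷ B) (c ∷ C) = (b ≤ᵇ c) ∧ pointwise≤ B C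

  addEach : ∀ {k} → ℕ → Vec ℕ k → Vec ℕ k
  addEach m [] = []
  addEach m (b ∷ B) = (b ℕ.+ m) ∷ addEach m B

  totalGap : ∀ {k} → Vec ℕ k → Vec ℕ k → ℕ
  totalGap [] [] = 0
  totalGap (b ∷ B) (c ∷ C) = (c ∸ b) ℕ.+ totalGap B C

  gapSign : ∀ {k} → Vec ℕ k → Vec ℕ k → ℤ
  gapSign B C = negOnePow (totalGap B C)

  _≟ⁿ_ : ∀ {k} → DecidableEquality (Vec ℕ k)
  _≟ⁿ_ = VecP.≡-dec ℕP._≟_

  EnumeratesStrictBetween : ∀ {k} → ℕ → Vec ℕ k → List (Vec ℕ k) → Set
  EnumeratesStrictBetween m B L = ∀ C → isStrict C ≡ true → pointwise≤ B C ≡ true → pointwise≤ C (addEach m B) ≡ true →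
                                  ∑ L (Kronecker.δ _≟ⁿ_ C) ≡ + 1

  pointwise≤-refl : ∀ {k} (B : Vec ℕ k) → pointwise≤ B B ≡ true
  pointwise≤-refl [] = refl
  pointwise≤-refl (b ∷ B) = cong₂ _∧_ (≤⇒≤ᵇ≡true (ℕP.≤-refl {b})) (pointwise≤-refl B)

  pointwise≤-addEach : ∀ {k} (B : Vec ℕ k) → pointwise≤ B (addEach 0 B) ≡ true
  pointwise≤-addEach [] = refl
  pointwise≤-addEach (b ∷ B) = cong₂ _∧_ (≤⇒≤ᵇ≡true (ℕP.m≤m+n b 0)) (pointwise≤-addEach B)

  pointwise≤-addBitˡ : ∀ {k} (B C : Vec ℕ k) (ε : Vec Bool k) → pointwise≤ (B ⊕ ε) C ≡ true → pointwise≤ B C ≡ true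
  pointwise≤-addBitˡ [] [] [] _ = refl
  pointwise≤-addBitˡ (b ∷ B) (c ∷ C) (x ∷ ε) B⊕ε≤C =
    cong₂ _∧_ (≤⇒≤ᵇ≡true (ℕP.≤-trans (b≤addBit x) (≤ᵇ≡true⇒≤ {addBit b x} {c} (∧≡true⇒ˡ B⊕ε≤C))))
              (pointwise≤-addBitˡ B C ε (∧≡true⇒ʳ {addBit b x ≤ᵇ c} B⊕ε≤C))
    where
    b≤addBit : ∀ x → b ≤ addBit b x
    b≤addBit true = ℕP.n≤1+n b
    b≤addBit false = ℕP.≤-refl

  pointwise≤-addBitʳ : ∀ {k} m (B C : Vec ℕ k) (ε : Vec Bool k) →
                       pointwise≤ C (addEach m (B ⊕ ε)) ≡ true → pointwise≤ C (addEach (suc m) B) ≡ true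
  pointwise≤-addBitʳ m [] [] [] _ = refl
  pointwise≤-addBitʳ m (b ∷ B) (c ∷ C) (x ∷ ε) C≤ =
    cong₂ _∧_ (≤⇒≤ᵇ≡true (ℕP.≤-trans (≤ᵇ≡true⇒≤ {c} {addBit b x ℕ.+ m} (∧≡true⇒ˡ C≤)) (addBit+m≤ x)))
              (pointwise≤-addBitʳ m B C ε (∧≡true⇒ʳ {c ≤ᵇ (addBit b x ℕ.+ m)} C≤))
    where
    addBit+m≤ : ∀ x → addBit b x ℕ.+ m ≤ b ℕ.+ suc m
    addBit+m≤ true = ℕP.≤-reflexive (sym (ℕP.+-suc b m))
    addBit+m≤ false = ℕP.+-monoʳ-≤ b (ℕP.n≤1+n m)

  EnumeratesStrictBetween-suc : ∀ {k} m (B : Vec ℕ k) (ε : Vec Bool k) (L : List (Vec ℕ k)) →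
                                EnumeratesStrictBetween (suc m) B L → EnumeratesStrictBetween m (B ⊕ ε) L
  EnumeratesStrictBetween-suc m B ε L en C C-strict B⊕ε≤C C≤ =
    en C C-strict (pointwise≤-addBitˡ B C ε B⊕ε≤C) (pointwise≤-addBitʳ m B C ε C≤)

  nonstrict⇒adjacentEqual : ∀ {k} (B : Vec ℕ k) (ε : Vec Bool k) → isStrict B ≡ true → isStrict (B ⊕ ε) ≡ false →
    Σ (Fin k) λ p → Σ (Fin k) λ q → (toℕ q ≡ suc (toℕ p)) × (lookup (B ⊕ ε) p ≡ lookup (B ⊕ ε) q)
  nonstrict⇒adjacentEqual [] [] _ ()
  nonstrict⇒adjacentEqual (b ∷ B) (e ∷ ε) B-strict _ with isStrict (B ⊕ ε) in tail-strict
  ... | false with nonstrict⇒adjacentEqual B ε (∧≡true⇒ʳ {<ᵇhead b B} B-strict) tail-strict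
  ...   | p , q , q≡p+1 , equal = suc p , suc q , cong suc q≡p+1 , equal
  nonstrict⇒adjacentEqual (b ∷ []) (e ∷ []) _ () | true
  nonstrict⇒adjacentEqual (b ∷ b′ ∷ B) (e ∷ e′ ∷ ε) B-strict B⊕ε-nonstrict | true =
    head-collision e e′ (∧≡true⇒ˡ B-strict) (trans (sym (BoolP.∧-identityʳ _)) B⊕ε-nonstrict)
    where
    head-collision : ∀ e e′ → (b <ᵇ b′) ≡ true → (addBit b e <ᵇ addBit b′ e′) ≡ false →
      Σ (Fin (suc (suc _))) λ p → Σ (Fin (suc (suc _))) λ q →
        (toℕ q ≡ suc (toℕ p)) × (lookup ((b ∷ b′ ∷ B) ⊕ (e ∷ e′ ∷ ε)) p ≡ lookup ((b ∷ b′ ∷ B) ⊕ (e ∷ e′ ∷ ε)) q)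
    head-collision false false b<b′ b≮b′ = ⊥-elim (false≢true (trans (sym b≮b′) b<b′))
    head-collision true true b<b′ b≮b′ = ⊥-elim (false≢true (trans (sym b≮b′) b<b′))
    head-collision false true b<b′ b≮b′ =
      ⊥-elim (false≢true (trans (sym b≮b′) (<⇒<ᵇ≡true {b} {suc b′} (ℕP.m<n⇒m<1+n (<ᵇ≡true⇒< {b} {b′} b<b′)))))
    head-collision true false b<b′ b+1≮b′ =
      zero , suc zero , refl ,
      sym (ℕP.≤-antisym (ℕP.≮⇒≥ (λ lt → false≢true (trans (sym b+1≮b′) (<⇒<ᵇ≡true lt)))) (<ᵇ≡true⇒< b<b′))

  totalGap-refl : ∀ {k} (B : Vec ℕ k) → totalGap B B ≡ 0
  totalGap-refl [] = refl
  totalGap-refl (b ∷ B) = cong₂ ℕ._+_ (ℕP.n∸n≡0 b) (totalGap-refl B)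

  #true+totalGap : ∀ {k} (B C : Vec ℕ k) (ε : Vec Bool k) → pointwise≤ (B ⊕ ε) C ≡ true →
                   #true ε ℕ.+ totalGap (B ⊕ ε) C ≡ totalGap B C
  #true+totalGap [] [] [] _ = refl
  #true+totalGap (b ∷ B) (c ∷ C) (x ∷ ε) B⊕ε≤C =
    trans (ℕ-interchange (𝟙ℕ x) (#true ε) (c ∸ addBit b x) (totalGap (B ⊕ ε) C))
          (cong₂ ℕ._+_ (head-gap x (≤ᵇ≡true⇒≤ (∧≡true⇒ˡ B⊕ε≤C)))
                       (#true+totalGap B C ε (∧≡true⇒ʳ {addBit b x ≤ᵇ c} B⊕ε≤C)))
    where
    head-gap : ∀ x → addBit b x ≤ c → 𝟙ℕ x ℕ.+ (c ∸ addBit b x) ≡ c ∸ b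
    head-gap true b<c = sym (∸-< b<c)
    head-gap false _ = refl

  gapSign-addBit : ∀ {k} (B C : Vec ℕ k) (ε : Vec Bool k) → pointwise≤ (B ⊕ ε) C ≡ true →
                   negOnePow (#true ε) * gapSign (B ⊕ ε) C ≡ gapSign B C
  gapSign-addBit B C ε B⊕ε≤C =
    trans (sym (negOnePow-+ (#true ε) (totalGap (B ⊕ ε) C))) (cong negOnePow (#true+totalGap B C ε B⊕ε≤C))

  isSkewTableau⇒pointwise≤ : ∀ {m k} (B C : Vec ℕ k) (T : Vec (Vec Bool m) k) → isSkewTableau B C T ≡ true → pointwise≤ B C ≡ true
  isSkewTableau⇒pointwise≤ [] [] [] _ = refl
  isSkewTableau⇒pointwise≤ (b ∷ B) (c ∷ C) (t ∷ T) T-ok =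
    cong₂ _∧_ (∧≡true⇒ˡ (∧≡true⇒ˡ T-ok))
              (isSkewTableau⇒pointwise≤ B C T (∧≡true⇒ʳ {nextColumnOK b t B T} (∧≡true⇒ʳ {columnOK b c t} T-ok)))

  skewSchur-≰ : ∀ {m k} (B C : Vec ℕ k) → pointwise≤ B C ≡ false → skewSchur {m} B C ≈ []
  skewSchur-≰ {m} {k} B C B≰C = mk≈ λ μ →
    trans (coeff-skewSchur B C μ) (trans (∑-cong (allVecs (allVecs bools m) k) (no-tableau μ)) (∑-zero (allVecs (allVecs bools m) k)))
    where
    no-tableau : ∀ μ T → (if isSkewTableau B C T then δ (content T , noQ) μ else + 0) ≡ + 0
    no-tableau μ T with isSkewTableau B C T in T-ok
    ... | true = ⊥-elim (false≢true (trans (sym B≰C) (isSkewTableau⇒pointwise≤ B C T T-ok)))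
    ... | false = refl

  pointwise≡ᵇ : ∀ {k} → Vec ℕ k → Vec ℕ k → Bool
  pointwise≡ᵇ [] [] = true
  pointwise≡ᵇ (b ∷ B) (c ∷ C) = (b ≡ᵇ c) ∧ pointwise≡ᵇ B C

  pointwise≡ᵇ-δ : ∀ {k} (B C : Vec ℕ k) → 𝟙 (pointwise≡ᵇ B C) ≡ Kronecker.δ _≟ⁿ_ B C
  pointwise≡ᵇ-δ B C with pointwise≡ᵇ B C in eq
  ... | true = sym (trans (cong (Kronecker.δ _≟ⁿ_ B) (sym (sound B C eq))) (Kronecker.δ-refl _≟ⁿ_ B))
    where
    sound : ∀ {k} (B C : Vec ℕ k) → pointwise≡ᵇ B C ≡ true → B ≡ C
    sound [] [] _ = refl
    sound (b ∷ B) (c ∷ C) e = cong₂ _∷_ (≡ᵇ≡true⇒≡ (∧≡true⇒ˡ e)) (sound B C (∧≡true⇒ʳ {b ≡ᵇ c} e))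
  ... | false = sym (Kronecker.δ-≢ _≟ⁿ_ λ { refl → false≢true (trans (sym eq) (complete B)) })
    where
    complete : ∀ {k} (B : Vec ℕ k) → pointwise≡ᵇ B B ≡ true
    complete [] = refl
    complete (b ∷ B) = cong₂ _∧_ (≡ᵇ-refl b) (complete B)

  Vec-empty : ∀ {A : Set} (v : Vec A 0) → v ≡ []
  Vec-empty [] = refl

  allVecs-empty : ∀ k → allVecs (allVecs bools 0) k ≡ replicate k [] ∷ []
  allVecs-empty zero = refl
  allVecs-empty (suc k) rewrite allVecs-empty k = refl

  columnOK-empty : ∀ b c → columnOK {0} b c [] ≡ (b ≡ᵇ c)
  columnOK-empty zero zero = refl
  columnOK-empty zero (suc c) = refl
  columnOK-empty (suc b) zero = refl
  columnOK-empty (suc b) (suc c) = trans (cong (λ z → z ∧ (0 ≡ᵇ (c ∸ b))) (<ᵇ-suc b c)) (columnOK-empty b c)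

  isSkewTableau-empty : ∀ {k} (B C : Vec ℕ k) → isSkewTableau B C (replicate k []) ≡ pointwise≡ᵇ B C
  isSkewTableau-empty [] [] = refl
  isSkewTableau-empty (b ∷ B) (c ∷ C) =
    cong₂ _∧_ (columnOK-empty b c) (trans (cong (_∧ isSkewTableau B C (replicate _ [])) (next-empty B)) (isSkewTableau-empty B C))
    where
    next-empty : ∀ {k′} (B′ : Vec ℕ k′) → nextColumnOK b [] B′ (replicate k′ []) ≡ true
    next-empty [] = refl
    next-empty (b′ ∷ B′) = refl

  -- With no x-variables the only filling is the empty one, which exists iff B = C.
  skewSchur-zero : ∀ {k} (B C : Vec ℕ k) → skewSchur {0} B C ≈ constP (Kronecker.δ _≟ⁿ_ B C)
  skewSchur-zero {k} B C = mk≈ λ μ →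
    trans (coeff-skewSchur B C μ)
    (trans (cong (λ l → ∑ l (λ T → if isSkewTableau B C T then δ (content T , noQ) μ else + 0)) (allVecs-empty k))
    (trans (+-identityʳ _)
    (trans (cong (λ z → if z then δ (content (replicate k []) , noQ) μ else + 0) (isSkewTableau-empty B C))
    (trans (empty-filling (pointwise≡ᵇ B C) μ)
           (sym (trans (coeff-mon (Kronecker.δ _≟ⁿ_ B C) monoOne μ) (cong (_* δ monoOne μ) (sym (pointwise≡ᵇ-δ B C)))))))))
    where
    empty-filling : ∀ b μ → (if b then δ (content (replicate k []) , noQ) μ else + 0) ≡ 𝟙 b * δ monoOne μ
    empty-filling true μ = trans (cong (λ e → δ (e , noQ) μ) (Vec-empty _)) (sym (*-identityˡ _))
    empty-filling false μ = refl

  -- The product Πᵢⱼ (1 - xᵢ yⱼ)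

  eFactor : ∀ m {k} → Fin k → Poly m k
  eFactor zero j = oneP
  eFactor (suc m) j = oneMinusXQ j *P liftX 0 (eFactor m j)

  eProduct : ∀ m k → Poly m k
  eProduct m k = prodP (map (eFactor m) (allFin k))

  module _ {m k : ℕ} where
    prodP-cong : {A : Set} {F G : A → Poly m k} (L : List A) → (∀ x → F x ≈ G x) → prodP (map F L) ≈ prodP (map G L)
    prodP-cong [] e = ≈refl
    prodP-cong (x ∷ L) e = *P-cong (e x) (prodP-cong L e)

    prodP-* : {A : Set} (f g : A → Poly m k) (L : List A) →
              prodP (map (λ j → f j *P g j) L) ≈ (prodP (map f L) *P prodP (map g L))
    prodP-* f g [] = ≈sym (*P-identityˡ oneP)
    prodP-* f g (j ∷ L) =
      ≈trans (*P-congʳ (f j *P g j) (prodP-* f g L)) (*P-interchange (f j) (g j) (prodP (map f L)) (prodP (map g L)))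

    prodP-one : {A : Set} (L : List A) → prodP (map (λ _ → oneP {m} {k}) L) ≈ oneP
    prodP-one [] = ≈refl
    prodP-one (x ∷ L) = ≈trans (*P-identityˡ _) (prodP-one L)

  eProduct-zero : ∀ k → eProduct 0 k ≈ oneP
  eProduct-zero k = prodP-one (allFin k)

  eProduct-suc : ∀ m k → eProduct (suc m) k ≈ (pieriProduct m k *P liftX 0 (eProduct m k))
  eProduct-suc m k =
    ≈trans (prodP-* oneMinusXQ (λ j → liftX 0 (eFactor m j)) (allFin k))
    (*P-congʳ (pieriProduct m k) (≈trans (≡→≈ (cong prodP (LP.map-∘ (allFin k))))
                                         (≈sym (mapP-prodP (consX 0) consX-hom refl (map (eFactor m) (allFin k))))))

  alternant-liftX : ∀ {m k} (β : Vec ℕ k) → alternant {suc m} β ≡ liftX 0 (alternant {m} β)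
  alternant-liftX {m} {k} β = LP.map-∘ (perms k)

  liftX-*P : ∀ {m k} c (p q : Poly m k) → liftX c (p *P q) ≈ (liftX 0 p *P liftX c q)
  liftX-*P c p q = mk≈ λ ν → trans (coeff-mapP (consX c) (p *P q) ν) (trans (∑-*P p q _)
    (sym (trans (coeff-*P (liftX 0 p) (liftX c q) ν) (trans (∑-map _ p _) (∑-cong p (λ s → ∑-map _ q _))))))

  liftX-constP : ∀ {m k} c (a : ℤ) (p : Poly m k) → liftX c (constP a *P p) ≈ (constP a *P liftX c p)
  liftX-constP c a p = liftX-*P c (constP a) p

  negXPower-liftX : ∀ {m k} (c : ℕ) (p : Poly m k) → (negXPower c *P liftX 0 p) ≈ (constP (negOnePow c) *P liftX c p)
  negXPower-liftX c p = mk≈ λ μ →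
    trans (coeff-*P (negXPower c) (liftX 0 p) μ) (trans (+-identityʳ _) (trans (∑-map _ p _)
    (sym (trans (coeff-*P (constP (negOnePow c)) (liftX c p) μ) (trans (+-identityʳ _) (trans (∑-map _ p _)
      (∑-cong p (λ t → cong (λ x₀ → negOnePow c * proj₁ t *
                                     δ (x₀ ∷ zipWith _+_ noX (proj₁ (proj₂ t)) , zipWith ℕ._+_ noQ (proj₂ (proj₂ t))) μ)
                            (sym (+-identityʳ (+ c)))))))))))

  cauchyTerm : ∀ m {k} → Vec ℕ k → Vec ℕ k → Poly m k
  cauchyTerm m B C = constP (𝟙 (isStrict C) * gapSign B C) *P (alternant {m} C *P skewSchur {m} B C)

  cauchyTerm-zero : ∀ {k} (B C : Vec ℕ k) →
                    cauchyTerm 0 B C ≈ (constP (Kronecker.δ _≟ⁿ_ B C * (𝟙 (isStrict C) * gapSign B C)) *P alternant C)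
  cauchyTerm-zero B C =
    ≈trans (constP-*-cong s (≈trans (*P-congʳ (alternant C) (skewSchur-zero B C)) (*P-comm (alternant C) (constP d))))
           (≈trans (constP-*-constP s d (alternant C)) (constP-*-≡ (alternant C) (*-comm s d)))
    where
    s = 𝟙 (isStrict C) * gapSign B C
    d = Kronecker.δ _≟ⁿ_ B C

  alternant*eProduct-zero : ∀ {k} (L : List (Vec ℕ k)) (B : Vec ℕ k) → isStrict B ≡ true → EnumeratesStrictBetween 0 B L →
                            (alternant {0} B *P eProduct 0 k) ≈ sumP (map (cauchyTerm 0 B) L)
  alternant*eProduct-zero {k} L B B-strict en =
    ≈trans (*P-congʳ (alternant B) (eProduct-zero k)) (≈trans (*P-identityʳ (alternant B)) (mk≈ λ μ → sym (only-B μ)))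
    where
    weight : Mono 0 k → Vec ℕ k → ℤ
    weight μ C = 𝟙 (isStrict C) * gapSign B C * coeff (alternant C) μ
    only-B : ∀ μ → coeff (sumP (map (cauchyTerm 0 B) L)) μ ≡ coeff (alternant B) μ
    only-B μ =
      begin
        coeff (sumP (map (cauchyTerm 0 B) L)) μ
      ≡⟨ coeff-sumP (cauchyTerm 0 B) L μ ⟩
        ∑ L (λ C → coeff (cauchyTerm 0 B C) μ)
      ≡⟨ ∑-cong L (λ C → trans (un (cauchyTerm-zero B C) μ)
                         (trans (coeff-constP-* (Kronecker.δ _≟ⁿ_ B C * (𝟙 (isStrict C) * gapSign B C)) (alternant C) μ)
                                (*-assoc (Kronecker.δ _≟ⁿ_ B C) (𝟙 (isStrict C) * gapSign B C) (coeff (alternant C) μ)))) ⟩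
        ∑ L (λ C → Kronecker.δ _≟ⁿ_ B C * weight μ C)
      ≡⟨ Kronecker.∑-δ-sift _≟ⁿ_ B L (weight μ) ⟩
        ∑ L (Kronecker.δ _≟ⁿ_ B) * weight μ B
      ≡⟨ cong (_* weight μ B) (en B B-strict (pointwise≤-refl B) (pointwise≤-addEach B)) ⟩
        + 1 * weight μ B
      ≡⟨ cong₂ (λ s g → + 1 * (𝟙 s * negOnePow g * coeff (alternant B) μ)) B-strict (totalGap-refl B) ⟩
        + 1 * (+ 1 * + 1 * coeff (alternant B) μ)
      ≡⟨ trans (*-identityˡ _) (*-identityˡ _) ⟩
        coeff (alternant B) μ
      ∎
      where open ≡-Reasoning

  sign-rearrange : ∀ s χ b t u → s * t ≡ u → s * χ * (b * t) ≡ b * u * χ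
  sign-rearrange s χ b t u st≡u = trans (shuffle s χ b t) (cong (λ z → b * z * χ) st≡u)
    where
    shuffle : ∀ s χ b t → s * χ * (b * t) ≡ b * (s * t) * χ
    shuffle = solve-∀

  -- Induction on the number m of x-variables: adjoin x₀ by the Pieri rule, then use the
  -- branching rule of skewSchur to recombine the terms.
  alternant*eProduct : ∀ m {k} (L : List (Vec ℕ k)) (B : Vec ℕ k) → isStrict B ≡ true → EnumeratesStrictBetween m B L →
                       (alternant {m} B *P eProduct m k) ≈ sumP (map (cauchyTerm m B) L)
  alternant*eProduct zero L B B-strict en = alternant*eProduct-zero L B B-strict en
  alternant*eProduct (suc m) {k} L B B-strict en =
    begin
      alternant B *P eProduct (suc m) k
    ≈⟨ ≈trans (*P-congʳ (alternant B) (eProduct-suc m k)) (≈sym (*P-assoc (alternant B) (pieriProduct m k) (liftX 0 E))) ⟩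
      (alternant B *P pieriProduct m k) *P liftX 0 E
    ≈⟨ ≈trans (*P-congˡ (liftX 0 E) (pieri B)) (sumP-*ʳ (liftX 0 E) _ εs) ⟩
      sumP (map (λ ε → (negXPower (#true ε) *P alternant (B ⊕ ε)) *P liftX 0 E) εs)
    ≈⟨ sumP-cong εs pull-x₀ ⟩
      sumP (map (λ ε → constP (sign ε) *P liftX (#true ε) (alternant {m} (B ⊕ ε) *P E)) εs)
    ≈⟨ sumP-cong εs (λ ε → constP-*-cong (sign ε) (mapP-cong (consX (#true ε)) (consX-partialInverse (#true ε)) (induction ε))) ⟩
      sumP (map (λ ε → constP (sign ε) *P liftX (#true ε) (constP (strict ε) *P sumP (map (cauchyTerm m (B ⊕ ε)) L))) εs)
    ≈⟨ sumP-cong εs distribute ⟩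
      sumP (map (λ ε → sumP (map (liftedTerm ε) L)) εs)
    ≈⟨ sumP-cong εs (λ ε → sumP-cong L (regroup ε)) ⟩
      sumP (map (λ ε → sumP (map (regroupedTerm ε) L)) εs)
    ≈⟨ sumP-swap regroupedTerm εs L ⟩
      sumP (map (λ C → sumP (map (λ ε → regroupedTerm ε C) εs)) L)
    ≈⟨ sumP-cong L branch ⟩
      sumP (map (cauchyTerm (suc m) B) L)
    ∎
    where
    open ≈-Reasoning
    E = eProduct m k
    εs = allVecs bools k
    strict : Vec Bool k → ℤ
    strict ε = 𝟙 (isStrict (B ⊕ ε))
    sign : Vec Bool k → ℤ
    sign ε = negOnePow (#true ε)

    pull-x₀ : ∀ ε → ((negXPower (#true ε) *P alternant {suc m} (B ⊕ ε)) *P liftX 0 E) ≈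
                    (constP (sign ε) *P liftX (#true ε) (alternant {m} (B ⊕ ε) *P E))
    pull-x₀ ε =
      ≈trans (*P-assoc (negXPower (#true ε)) (alternant (B ⊕ ε)) (liftX 0 E))
      (≈trans (*P-congʳ (negXPower (#true ε)) (≈trans (*P-congˡ (liftX 0 E) (≡→≈ (alternant-liftX (B ⊕ ε))))
                                                      (≈sym (mapP-* (consX 0) consX-hom (alternant (B ⊕ ε)) E))))
              (negXPower-liftX (#true ε) (alternant (B ⊕ ε) *P E)))

    -- Non-strict B ⊕ ε contribute nothing since their alternant vanishes.
    induction : ∀ ε → (alternant {m} (B ⊕ ε) *P E) ≈ (constP (strict ε) *P sumP (map (cauchyTerm m (B ⊕ ε)) L))
    induction ε with isStrict (B ⊕ ε) in B⊕ε-strict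
    ... | true = ≈trans (alternant*eProduct m L (B ⊕ ε) B⊕ε-strict (EnumeratesStrictBetween-suc m B ε L en))
                        (≈sym (constP-one-* _))
    ... | false with nonstrict⇒adjacentEqual B ε B-strict B⊕ε-strict
    ...   | p , q , q≡p+1 , equal = ≈trans (*P-congˡ E (alternant-vanishes (B ⊕ ε) p q q≡p+1 equal)) (≈sym (constP-zero-* _))

    liftedTerm : Vec Bool k → Vec ℕ k → Poly (suc m) k
    liftedTerm ε C = constP (sign ε * strict ε) *P liftX (#true ε) (cauchyTerm m (B ⊕ ε) C)

    distribute : ∀ ε → (constP (sign ε) *P liftX (#true ε) (constP (strict ε) *P sumP (map (cauchyTerm m (B ⊕ ε)) L))) ≈
                       sumP (map (liftedTerm ε) L)
    distribute ε =
      ≈trans (constP-*-cong (sign ε) (liftX-constP (#true ε) (strict ε) _))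
      (≈trans (constP-*-constP (sign ε) (strict ε) _)
      (≈trans (constP-*-cong (sign ε * strict ε) (mapP-sumP (consX (#true ε)) (cauchyTerm m (B ⊕ ε)) L))
              (sumP-*ˡ (constP (sign ε * strict ε)) _ L)))

    regroupedTerm : Vec Bool k → Vec ℕ k → Poly (suc m) k
    regroupedTerm ε C = constP (𝟙 (isStrict C) * gapSign B C) *P
                          (alternant {suc m} C *P (constP (strict ε) *P liftX (#true ε) (skewSchur {m} (B ⊕ ε) C)))

    -- (-1)^{|ε|} (-1)^{|C - (B ⊕ ε)|} = (-1)^{|C - B|} whenever s_{C/(B ⊕ ε)} ≠ 0.
    regroup : ∀ ε C → liftedTerm ε C ≈ regroupedTerm ε C
    regroup ε C =
      ≈trans (constP-*-cong (sign ε * strict ε) (≈trans (liftX-constP (#true ε) c′ (alternant C *P skew))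
               (constP-*-cong c′ (≈trans (liftX-*P (#true ε) (alternant C) skew)
                                        (*P-congˡ (liftX (#true ε) skew) (≡→≈ (sym (alternant-liftX C))))))))
      (≈trans (constP-*-constP (sign ε * strict ε) c′ X)
      (≈trans (signs (pointwise≤ (B ⊕ ε) C) refl)
      (≈sym (≈trans (constP-*-cong c (*P-constP-comm (strict ε) (alternant C) (liftX (#true ε) skew)))
                    (constP-*-constP c (strict ε) X)))))
      where
      c′ = 𝟙 (isStrict C) * gapSign (B ⊕ ε) C
      c = 𝟙 (isStrict C) * gapSign B C
      skew = skewSchur {m} (B ⊕ ε) C
      X = alternant {suc m} C *P liftX (#true ε) skew
      X≈0 : pointwise≤ (B ⊕ ε) C ≡ false → X ≈ []
      X≈0 B⊕ε≰C = ≈trans (*P-congʳ (alternant C) (mapP-cong (consX (#true ε)) (consX-partialInverse (#true ε))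
                                                             (skewSchur-≰ (B ⊕ ε) C B⊕ε≰C)))
                         (*P-zeroʳ (alternant C))
      signs : ∀ b → pointwise≤ (B ⊕ ε) C ≡ b → (constP (sign ε * strict ε * c′) *P X) ≈ (constP (c * strict ε) *P X)
      signs true B⊕ε≤C = constP-*-≡ X (sign-rearrange (sign ε) (strict ε) (𝟙 (isStrict C)) _ _ (gapSign-addBit B C ε B⊕ε≤C))
      signs false B⊕ε≰C = ≈trans (constP-*-cong (sign ε * strict ε * c′) (X≈0 B⊕ε≰C))
                                 (≈sym (constP-*-cong (c * strict ε) (X≈0 B⊕ε≰C)))

    branch : ∀ C → sumP (map (λ ε → regroupedTerm ε C) εs) ≈ cauchyTerm (suc m) B C
    branch C = ≈trans (≈sym (sumP-*ˡ (constP (𝟙 (isStrict C) * gapSign B C)) (λ ε → alternant C *P rows ε) εs))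
                      (guarded (isStrict C) refl)
      where
      rows : Vec Bool k → Poly (suc m) k
      rows ε = constP (strict ε) *P liftX (#true ε) (skewSchur {m} (B ⊕ ε) C)
      guarded : ∀ b → isStrict C ≡ b → (constP (𝟙 b * gapSign B C) *P sumP (map (λ ε → alternant C *P rows ε) εs)) ≈
                                       (constP (𝟙 b * gapSign B C) *P (alternant C *P skewSchur B C))
      guarded true C-strict = constP-*-cong (𝟙 true * gapSign B C) (≈trans (≈sym (sumP-*ˡ (alternant C) rows εs)) (*P-congʳ (alternant C)
        (≈trans (sumP-cong εs (λ ε → constP-𝟙-* (isStrict (B ⊕ ε)) _)) (≈sym (skewSchur-branch B C B-strict C-strict)))))
      guarded false _ = ≈trans (constP-zero-* (sumP (map (λ ε → alternant C *P rows ε) εs)))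
                               (≈sym (constP-zero-* (alternant C *P skewSchur B C)))

  staircase : ℕ → (k : ℕ) → Vec ℕ k
  staircase s zero = []
  staircase s (suc k) = s ∷ staircase (suc s) k

  addStaircase : ∀ {k} → ℕ → Vec ℕ k → Vec ℕ k
  addStaircase s [] = []
  addStaircase s (a ∷ d) = (a ℕ.+ s) ∷ addStaircase (suc s) d

  subStaircase : ∀ {k} → ℕ → Vec ℕ k → Vec ℕ k
  subStaircase s [] = []
  subStaircase s (c ∷ C) = (c ∸ s) ∷ subStaircase (suc s) C

  lookup-staircase : ∀ {k} s (i : Fin k) → lookup (staircase s k) i ≡ s ℕ.+ toℕ i
  lookup-staircase s zero = sym (ℕP.+-identityʳ s)
  lookup-staircase s (suc i) = trans (lookup-staircase (suc s) i) (sym (ℕP.+-suc s (toℕ i)))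

  lookup-addStaircase : ∀ {k} s (d : Vec ℕ k) (i : Fin k) → lookup (addStaircase s d) i ≡ lookup d i ℕ.+ (s ℕ.+ toℕ i)
  lookup-addStaircase s (a ∷ d) zero = cong (a ℕ.+_) (sym (ℕP.+-identityʳ s))
  lookup-addStaircase s (a ∷ d) (suc i) =
    trans (lookup-addStaircase (suc s) d i) (cong (lookup d i ℕ.+_) (sym (ℕP.+-suc s (toℕ i))))

  isStrict-staircase : ∀ s k → isStrict (staircase s k) ≡ true
  isStrict-staircase s zero = refl
  isStrict-staircase s (suc zero) = refl
  isStrict-staircase s (suc (suc k)) = cong₂ _∧_ (<⇒<ᵇ≡true (ℕP.n<1+n s)) (isStrict-staircase (suc s) (suc k))

  addStaircase-subStaircase : ∀ {k} s (C : Vec ℕ k) → pointwise≤ (staircase s k) C ≡ true → addStaircase s (subStaircase s C) ≡ C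
  addStaircase-subStaircase s [] _ = refl
  addStaircase-subStaircase s (c ∷ C) ρ≤C =
    cong₂ _∷_ (ℕP.m∸n+n≡m (≤ᵇ≡true⇒≤ {s} {c} (∧≡true⇒ˡ ρ≤C)))
              (addStaircase-subStaircase (suc s) C (∧≡true⇒ʳ {s ≤ᵇ c} ρ≤C))

  subStaircase-addStaircase : ∀ {k} s (d : Vec ℕ k) → subStaircase s (addStaircase s d) ≡ d
  subStaircase-addStaircase s [] = refl
  subStaircase-addStaircase s (a ∷ d) = cong₂ _∷_ (ℕP.m+n∸n≡m a s) (subStaircase-addStaircase (suc s) d)

  isStrict-addStaircase : ∀ {k} s (d : Vec ℕ k) → isStrict (addStaircase s d) ≡ nondecreasing (toList d)
  isStrict-addStaircase s [] = refl
  isStrict-addStaircase s (a ∷ []) = refl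
  isStrict-addStaircase s (a ∷ b ∷ d) = cong₂ _∧_ (shifted-< a b s) (isStrict-addStaircase (suc s) (b ∷ d))
    where
    shifted-< : ∀ a b s → (a ℕ.+ s <ᵇ b ℕ.+ suc s) ≡ (a ≤ᵇ b)
    shifted-< a b s = trans (cong (a ℕ.+ s <ᵇ_) (ℕP.+-suc b s)) (trans (<ᵇ-suc (a ℕ.+ s) (b ℕ.+ s)) (cancel (a ℕP.≤? b)))
      where
      cancel : Dec (a ≤ b) → (a ℕ.+ s ≤ᵇ b ℕ.+ s) ≡ (a ≤ᵇ b)
      cancel (yes a≤b) = trans (≤⇒≤ᵇ≡true (ℕP.+-monoˡ-≤ s a≤b)) (sym (≤⇒≤ᵇ≡true a≤b))
      cancel (no a≰b) =
        trans (≰⇒≤ᵇ≡false (λ a+s≤b+s → a≰b (ℕP.+-cancelʳ-≤ s a b a+s≤b+s))) (sym (≰⇒≤ᵇ≡false a≰b))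
        where
        ≰⇒≤ᵇ≡false : ∀ {x y} → ¬ x ≤ y → (x ≤ᵇ y) ≡ false
        ≰⇒≤ᵇ≡false {x} {y} x≰y with x ≤ᵇ y in eq
        ... | true = ⊥-elim (x≰y (≤ᵇ≡true⇒≤ eq))
        ... | false = refl

  subStaircase-bounded : ∀ {k} m s (C : Vec ℕ k) → pointwise≤ C (addEach m (staircase s k)) ≡ true →
                         allᵇ (λ a → a <ᵇ suc m) (subStaircase s C) ≡ true
  subStaircase-bounded m s [] _ = refl
  subStaircase-bounded m s (c ∷ C) C≤ =
    cong₂ _∧_ (<⇒<ᵇ≡true (s≤s (ℕP.≤-trans (ℕP.∸-monoˡ-≤ s (≤ᵇ≡true⇒≤ {c} {s ℕ.+ m} (∧≡true⇒ˡ C≤)))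
                                           (ℕP.≤-reflexive (ℕP.m+n∸m≡n s m)))))
              (subStaircase-bounded m (suc s) C (∧≡true⇒ʳ {c ≤ᵇ (s ℕ.+ m)} C≤))

  totalGap-addStaircase : ∀ {k} s (d : Vec ℕ k) → totalGap (staircase s k) (addStaircase s d) ≡ sumℕ (toList d)
  totalGap-addStaircase s [] = refl
  totalGap-addStaircase s (a ∷ d) = cong₂ ℕ._+_ (ℕP.m+n∸n≡m a s) (totalGap-addStaircase (suc s) d)

  ∧-regroup : ∀ P A S K → (P ∧ (A ∧ (S ∧ K))) ≡ ((P ∧ S) ∧ (A ∧ K))
  ∧-regroup true true S K = refl
  ∧-regroup true false S K = sym (BoolP.∧-zeroʳ S)
  ∧-regroup false A S K = refl

  isSkewTableau-addStaircase : ∀ {m k} s (d : Vec ℕ k) (T : Vec (Vec Bool m) k) →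
                               isSkewTableau (staircase s k) (addStaircase s d) T ≡ (sizesOK d T ∧ colsOK (toList T))
  isSkewTableau-addStaircase s [] [] = refl
  isSkewTableau-addStaircase {m} {suc k} s (a ∷ d) (t ∷ T) =
    trans (cong₂ (λ x y → x ∧ (y ∧ isSkewTableau (staircase (suc s) k) (addStaircase (suc s) d) T)) column-size (first-row d T))
    (trans (cong (λ z → (size t ≡ᵇ a) ∧ (nextRowOK T ∧ z)) (isSkewTableau-addStaircase (suc s) d T))
    (trans (∧-regroup (size t ≡ᵇ a) (nextRowOK T) (sizesOK d T) (colsOK (toList T))) (cong₂ _∧_ refl (colsOK-∷ T))))
    where
    column-size : columnOK s (a ℕ.+ s) t ≡ (size t ≡ᵇ a)
    column-size = cong₂ (λ x y → x ∧ (size t ≡ᵇ y)) (≤⇒≤ᵇ≡true (ℕP.m≤n+m s a)) (ℕP.m+n∸n≡m a s)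
    nextRowOK : ∀ {k′} → Vec (Vec Bool m) k′ → Bool
    nextRowOK [] = true
    nextRowOK (t′ ∷ _) = rowOK t′ t
    first-row : ∀ {k′} (d′ : Vec ℕ k′) (T′ : Vec (Vec Bool m) k′) →
                nextColumnOK s t (staircase (suc s) k′) T′ ≡ nextRowOK T′
    first-row [] [] = refl
    first-row (_ ∷ _) (t′ ∷ _) = cong (λ z → rowOKBy z t′ t) (ℕP.n∸n≡0 s)
    colsOK-∷ : ∀ {k′} (T′ : Vec (Vec Bool m) k′) → (nextRowOK T′ ∧ colsOK (toList T′)) ≡ colsOK (t ∷ toList T′)
    colsOK-∷ [] = refl
    colsOK-∷ (t′ ∷ T′) = refl

  -- Σ_d (-y)^d ∧^d = Πᵢ (1 - xᵢ y): both sides expand over subsets of the x-variables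

  subsetSeries : ∀ m k → Poly m (suc k)
  subsetSeries m k = sumP (map (λ s → mon (negOnePow (size s)) (indicator s , (size s ∷ noQ))) (allVecs bools m))

  subsetSeries-suc : ∀ m k → subsetSeries (suc m) k ≈ (oneMinusXQ zero *P liftX 0 (subsetSeries m k))
  subsetSeries-suc m k =
    begin
      subsetSeries (suc m) k
    ≈⟨ sumP-allVecs-suc bools m (subsetTerm {suc m}) ⟩
      sumP (map (λ b → sumP (map (λ s → subsetTerm (b ∷ s)) (allVecs bools m))) bools)
    ≈⟨ sumP-cong bools (λ b → sumP-cong (allVecs bools m) (λ s → ≈sym (subsetTerm-∷ b s))) ⟩
      sumP (map (λ b → sumP (map (λ s → negXQPower b *P liftX 0 (subsetTerm s)) (allVecs bools m))) bools)
    ≈⟨ sumP-cong bools (λ b → ≈sym (≈trans (*P-congʳ (negXQPower b) (mapP-sumP (consX 0) subsetTerm (allVecs bools m)))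
                                            (sumP-*ˡ (negXQPower b) (λ s → liftX 0 (subsetTerm s)) (allVecs bools m)))) ⟩
      sumP (map (λ b → negXQPower b *P liftX 0 (subsetSeries m k)) bools)
    ≈⟨ ≈sym (≈trans (*P-congˡ (liftX 0 (subsetSeries m k)) (oneMinusXQ-zero {m} {k}))
                    (sumP-*ʳ (liftX 0 (subsetSeries m k)) (negXQPower {m} {k}) bools)) ⟩
      oneMinusXQ zero *P liftX 0 (subsetSeries m k)
    ∎
    where
    open ≈-Reasoning
    subsetTerm : ∀ {m′} → Vec Bool m′ → Poly m′ (suc k)
    subsetTerm s = mon (negOnePow (size s)) (indicator s , (size s ∷ noQ))
    head-exponent : ∀ b → + 𝟙ℕ b + + 0 ≡ (if b then + 1 else + 0)
    head-exponent true = refl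
    head-exponent false = refl
    subsetTerm-∷ : ∀ b s → (negXQPower b *P liftX 0 (subsetTerm s)) ≈ subsetTerm (b ∷ s)
    subsetTerm-∷ b s =
      ≈trans (mon-* (negOnePow (𝟙ℕ b)) (negOnePow (size s))
                    ((+ 𝟙ℕ b ∷ noX) , (𝟙ℕ b ∷ noQ)) ((+ 0 ∷ indicator s) , (size s ∷ noQ)))
             (mon-cong (sym (trans (cong negOnePow (size-∷ b s)) (negOnePow-+ (𝟙ℕ b) (size s))))
                       (cong₂ _,_ (cong₂ _∷_ (head-exponent b) (zipWith-noXˡ (indicator s)))
                                  (cong₂ _∷_ (sym (size-∷ b s)) (zipWith-noQˡ noQ))))

  eFactor≈subsetSeries : ∀ m k → eFactor m {suc k} zero ≈ subsetSeries m k
  eFactor≈subsetSeries zero k = ≈sym (+P-identityʳ oneP)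
  eFactor≈subsetSeries (suc m) k =
    ≈trans (*P-congʳ (oneMinusXQ zero) (mapP-cong (consX 0) (consX-partialInverse 0) (eFactor≈subsetSeries m k)))
           (≈sym (subsetSeries-suc m k))

  size-≤ : ∀ {m} (s : Vec Bool m) → size s ≤ m
  size-≤ [] = z≤n
  size-≤ (b ∷ s) = subst (_≤ suc _) (sym (size-∷ b s)) (bit+size≤ b)
    where
    bit+size≤ : ∀ b → 𝟙ℕ b ℕ.+ size s ≤ suc _
    bit+size≤ true = s≤s (size-≤ s)
    bit+size≤ false = ℕP.m≤n⇒m≤1+n (size-≤ s)

  if-≡ᵇ≡δ : ∀ a b (x : ℤ) → (if a ≡ᵇ b then x else + 0) ≡ Kronecker.δ ℕP._≟_ a b * x
  if-≡ᵇ≡δ a b x with a ℕP.≟ b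
  ... | yes refl = trans (cong (λ t → if t then x else + 0) (≡ᵇ-refl a)) (sym (*-identityˡ x))
  ... | no a≢b = cong (λ t → if t then x else + 0) (≢⇒≡ᵇ≡false a≢b)

  wedgeSeries : ∀ m k → Poly m (suc k)
  wedgeSeries m k = sumP (map (λ a → mon (negOnePow a) (noX , (a ∷ noQ)) *P wedge a) (upTo (suc m)))

  wedgeSeries≈subsetSeries : ∀ m k → wedgeSeries m k ≈ subsetSeries m k
  wedgeSeries≈subsetSeries m k = mk≈ λ μ →
    begin
      coeff (wedgeSeries m k) μ
    ≡⟨ trans (coeff-sumP wedgeTerm (upTo (suc m)) μ) (∑-cong (upTo (suc m)) (λ a → coeff-wedgeTerm a μ)) ⟩
      ∑ (upTo (suc m)) (λ a → ∑ subsets (λ s → if size s ≡ᵇ a then weight μ s a else + 0))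
    ≡⟨ ∑-swap (upTo (suc m)) subsets _ ⟩
      ∑ subsets (λ s → ∑ (upTo (suc m)) (λ a → if size s ≡ᵇ a then weight μ s a else + 0))
    ≡⟨ ∑-cong subsets (λ s → trans (∑-cong (upTo (suc m)) (λ a → if-≡ᵇ≡δ (size s) a (weight μ s a)))
                                   (Kronecker.Enumerates-sift ℕP._≟_ (upTo-enumerates (suc m)) (size s)
                                      (<⇒<ᵇ≡true (s≤s (size-≤ s))) (weight μ s))) ⟩
      ∑ subsets (λ s → weight μ s (size s))
    ≡⟨ sym (trans (coeff-sumP subsetTerm subsets μ)
                  (∑-cong subsets (λ s → coeff-mon (negOnePow (size s)) (indicator s , (size s ∷ noQ)) μ))) ⟩
      coeff (subsetSeries m k) μ
    ∎
    where
    open ≡-Reasoning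
    subsets = allVecs bools m
    wedgeTerm : ℕ → Poly m (suc k)
    wedgeTerm a = mon (negOnePow a) (noX , (a ∷ noQ)) *P wedge a
    subsetTerm : Vec Bool m → Poly m (suc k)
    subsetTerm s = mon (negOnePow (size s)) (indicator s , (size s ∷ noQ))
    weight : Mono m (suc k) → Vec Bool m → ℕ → ℤ
    weight μ s a = negOnePow a * δ (indicator s , (a ∷ noQ)) μ
    coeff-wedgeTerm : ∀ a μ → coeff (mon (negOnePow a) (noX , (a ∷ noQ)) *P wedge a) μ ≡
                              ∑ subsets (λ s → if size s ≡ᵇ a then weight μ s a else + 0)
    coeff-wedgeTerm a μ =
      trans (coeff-*P (mon (negOnePow a) (noX , (a ∷ noQ))) (wedge a) μ)
      (trans (+-identityʳ _)
      (trans (∑-map _ (filterᵇ (λ s → size s ≡ᵇ a) subsets) _)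
      (trans (∑-filterᵇ (λ s → size s ≡ᵇ a) subsets _)
      (∑-cong subsets (λ s → cong (λ z → if size s ≡ᵇ a then z else + 0)
        (cong₂ _*_ (*-identityʳ (negOnePow a))
                   (cong (λ ν → δ ν μ) (cong₂ _,_ (zipWith-noXˡ (indicator s))
                                                  (cong₂ _∷_ (ℕP.+-identityʳ a) (zipWith-noQˡ noQ))))))))))

  wedge-liftQ : ∀ {m k} a → wedge {m} {suc k} a ≡ liftQ 0 (wedge {m} {k} a)
  wedge-liftQ {m} {k} a = LP.map-∘ (filterᵇ (λ s → size s ≡ᵇ a) (allVecs bools m))

  prodP-wedge-liftQ : ∀ {m k} (l : List ℕ) → prodP (map (wedge {m} {suc k}) l) ≈ liftQ 0 (prodP (map (wedge {m} {k}) l))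
  prodP-wedge-liftQ l =
    ≈trans (≡→≈ (cong prodP (trans (LP.map-cong wedge-liftQ l) (LP.map-∘ l))))
           (≈sym (mapP-prodP (consQ 0) consQ-hom refl (map wedge l)))

  liftX-liftQ : ∀ {m k} (p : Poly m k) → liftX 0 (liftQ 0 p) ≡ liftQ 0 (liftX 0 p)
  liftX-liftQ p = trans (sym (LP.map-∘ p)) (LP.map-∘ p)

  eFactor-liftQ : ∀ m {k} (j : Fin k) → eFactor m {suc k} (suc j) ≈ liftQ 0 (eFactor m {k} j)
  eFactor-liftQ zero j = ≈refl
  eFactor-liftQ (suc m) j =
    ≈trans (*P-congʳ (oneMinusXQ (suc j)) (≈trans (mapP-cong (consX 0) (consX-partialInverse 0) (eFactor-liftQ m j))
                                                  (≡→≈ (liftX-liftQ (eFactor m j)))))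
           (≈sym (mapP-* (consQ 0) consQ-hom (oneMinusXQ j) (liftX 0 (eFactor m j))))

  eProduct-sucᵏ : ∀ m k → eProduct m (suc k) ≈ (eFactor m zero *P liftQ 0 (eProduct m k))
  eProduct-sucᵏ m k =
    ≈trans (≡→≈ (cong (λ l → prodP (map (eFactor m) l)) (allFin-suc k)))
    (*P-congʳ (eFactor m zero)
      (≈trans (≡→≈ (cong prodP (sym (LP.map-∘ (allFin k)))))
      (≈trans (prodP-cong (allFin k) (eFactor-liftQ m))
      (≈trans (≡→≈ (cong prodP (LP.map-∘ (allFin k))))
              (≈sym (mapP-prodP (consQ 0) consQ-hom refl (map (eFactor m) (allFin k))))))))

  wedgeProductTerm : ∀ {m k} → Vec ℕ k → Poly m k
  wedgeProductTerm d = mon (negOnePow (sumℕ (toList d))) (noX , d) *P prodP (map wedge (toList d))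

  wedgeProductSum : ∀ m k → Poly m k
  wedgeProductSum m k = sumP (map wedgeProductTerm (allVecs (upTo (suc m)) k))

  wedgeProductSum-suc : ∀ m k → wedgeProductSum m (suc k) ≈ (wedgeSeries m k *P liftQ 0 (wedgeProductSum m k))
  wedgeProductSum-suc m k =
    begin
      wedgeProductSum m (suc k)
    ≈⟨ sumP-allVecs-suc (upTo (suc m)) k wedgeProductTerm ⟩
      sumP (map (λ a → sumP (map (λ d → wedgeProductTerm (a ∷ d)) ds)) (upTo (suc m)))
    ≈⟨ sumP-cong (upTo (suc m)) (λ a → sumP-cong ds (wedgeProductTerm-∷ a)) ⟩
      sumP (map (λ a → sumP (map (λ d → wedgeTerm a *P liftQ 0 (wedgeProductTerm d)) ds)) (upTo (suc m)))
    ≈⟨ sumP-cong (upTo (suc m)) (λ a → ≈sym (≈trans (*P-congʳ (wedgeTerm a) (mapP-sumP (consQ 0) wedgeProductTerm ds))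
                                                    (sumP-*ˡ (wedgeTerm a) _ ds))) ⟩
      sumP (map (λ a → wedgeTerm a *P liftQ 0 (wedgeProductSum m k)) (upTo (suc m)))
    ≈⟨ ≈sym (sumP-*ʳ (liftQ 0 (wedgeProductSum m k)) wedgeTerm (upTo (suc m))) ⟩
      wedgeSeries m k *P liftQ 0 (wedgeProductSum m k)
    ∎
    where
    open ≈-Reasoning
    ds = allVecs (upTo (suc m)) k
    wedgeTerm : ℕ → Poly m (suc k)
    wedgeTerm a = mon (negOnePow a) (noX , (a ∷ noQ)) *P wedge a
    wedgeProductTerm-∷ : ∀ a d → wedgeProductTerm (a ∷ d) ≈ (wedgeTerm a *P liftQ 0 (wedgeProductTerm d))
    wedgeProductTerm-∷ a d = ≈sym
      (≈trans (*P-congʳ (wedgeTerm a) (≈trans (mapP-* (consQ 0) consQ-hom signD wedges)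
                                              (*P-congʳ (liftQ 0 signD) (≈sym (prodP-wedge-liftQ (toList d))))))
      (≈trans (*P-interchange signA (wedge a) (liftQ 0 signD) _)
              (*P-congˡ _ (≈trans (mon-* (negOnePow a) (negOnePow (sumℕ (toList d))) (noX , (a ∷ noQ)) (noX , (0 ∷ d)))
                                  (mon-cong (sym (negOnePow-+ a (sumℕ (toList d))))
                                            (cong₂ _,_ (zipWith-noXˡ noX) (cong₂ _∷_ (ℕP.+-identityʳ a) (zipWith-noQˡ d))))))))
      where
      signA = mon (negOnePow a) (noX , (a ∷ noQ))
      signD = mon (negOnePow (sumℕ (toList d))) (noX , d)
      wedges = prodP (map (wedge {m} {k}) (toList d))

  wedgeProductSum≈eProduct : ∀ m k → wedgeProductSum m k ≈ eProduct m k
  wedgeProductSum≈eProduct m zero = ≈trans (+P-identityʳ _) (*P-identityʳ _)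
  wedgeProductSum≈eProduct m (suc k) =
    ≈trans (wedgeProductSum-suc m k)
    (≈trans (*P-cong (≈trans (wedgeSeries≈subsetSeries m k) (≈sym (eFactor≈subsetSeries m k)))
                     (mapP-cong (consQ 0) (consQ-partialInverse 0) (wedgeProductSum≈eProduct m k)))
            (≈sym (eProduct-sucᵏ m k)))

  wedgeSum≈det*eProduct : ∀ m k r̃ → wedgeSum m k r̃ ≈ (detPow⁻ r̃ *P eProduct m k)
  wedgeSum≈det*eProduct m k r̃ =
    ≈trans (sumP-cong ds (λ d → ≈trans (≈sym (*P-assoc (sign d) det (wedges d)))
                                       (≈trans (*P-congˡ (wedges d) (*P-comm (sign d) det)) (*P-assoc det (sign d) (wedges d)))))
    (≈trans (≈sym (sumP-*ˡ det (λ d → sign d *P wedges d) ds)) (*P-congʳ det (wedgeProductSum≈eProduct m k)))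
    where
    ds = allVecs (upTo (suc m)) k
    det = detPow⁻ {m} {k} r̃
    sign : Vec ℕ k → Poly m k
    sign d = mon (negOnePow (sumℕ (toList d))) (noX , d)
    wedges : Vec ℕ k → Poly m k
    wedges d = prodP (map wedge (toList d))

  nondecreasingVecs : ∀ m k → List (Vec ℕ k)
  nondecreasingVecs m k = filterᵇ (λ d → nondecreasing (toList d)) (allVecs (upTo (suc m)) k)

  strictVecs : ∀ m k → List (Vec ℕ k)
  strictVecs m k = map (addStaircase 0) (nondecreasingVecs m k)

  nondecreasingVecs-enumerates : ∀ m k →
    Enumerates _≟ⁿ_ (nondecreasingVecs m k) (λ d → nondecreasing (toList d) ∧ allᵇ (λ a → a <ᵇ suc m) d)
  nondecreasingVecs-enumerates m k =
    Kronecker.filterᵇ-enumerates _≟ⁿ_ (λ d → nondecreasing (toList d)) (allVecs-enumerates ℕP._≟_ k (upTo-enumerates (suc m)))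

  -- d ↦ d + ρ is a bijection from nondecreasing d ≤ m onto strict C with ρ ≤ C ≤ ρ + m.
  strictVecs-enumerates : ∀ m k → EnumeratesStrictBetween m (staircase 0 k) (strictVecs m k)
  strictVecs-enumerates m k C C-strict ρ≤C C≤ρ+m =
    begin
      ∑ (strictVecs m k) (Kronecker.δ _≟ⁿ_ C)
    ≡⟨ ∑-map (addStaircase 0) (nondecreasingVecs m k) (Kronecker.δ _≟ⁿ_ C) ⟩
      ∑ (nondecreasingVecs m k) (λ d → Kronecker.δ _≟ⁿ_ C (addStaircase 0 d))
    ≡⟨ ∑-cong (nondecreasingVecs m k) δ-shift ⟩
      ∑ (nondecreasingVecs m k) (Kronecker.δ _≟ⁿ_ d₀)
    ≡⟨ ∑-δ (nondecreasingVecs-enumerates m k) d₀ ⟩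
      𝟙 (nondecreasing (toList d₀) ∧ allᵇ (λ a → a <ᵇ suc m) d₀)
    ≡⟨ cong 𝟙 (cong₂ _∧_ d₀-nondecreasing (subStaircase-bounded m 0 C C≤ρ+m)) ⟩
      + 1
    ∎
    where
    open ≡-Reasoning
    d₀ = subStaircase 0 C
    δ-shift : ∀ d → Kronecker.δ _≟ⁿ_ C (addStaircase 0 d) ≡ Kronecker.δ _≟ⁿ_ d₀ d
    δ-shift d = 𝟙?-cong (λ e → trans (cong (subStaircase 0) e) (subStaircase-addStaircase 0 d))
                        (λ e → trans (sym (addStaircase-subStaircase 0 C ρ≤C)) (cong (addStaircase 0) e))
                        (C ≟ⁿ addStaircase 0 d) (d₀ ≟ⁿ d)
    d₀-nondecreasing : nondecreasing (toList d₀) ≡ true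
    d₀-nondecreasing = trans (sym (isStrict-addStaircase 0 d₀)) (trans (cong isStrict (addStaircase-subStaircase 0 C ρ≤C)) C-strict)

  cauchySum : ∀ m k → Poly m k
  cauchySum m k = sumP (map (cauchyTerm m (staircase 0 k)) (strictVecs m k))

  vandermondeFactor≡alternant : ∀ {m} k → vandermondeFactor {m} k ≡ alternant {m} (staircase 0 k)
  vandermondeFactor≡alternant k =
    LP.map-cong (λ σ → cong (λ v → (sgn σ , (noX , v))) (VecP.map-cong (λ i → sym (lookup-staircase 0 i)) σ)) (perms k)

  LHS≈det*cauchySum : ∀ m k r̃ → LHS m k r̃ ≈ (detPow⁻ r̃ *P cauchySum m k)
  LHS≈det*cauchySum m k r̃ =
    begin
      vandermondeFactor k *P wedgeSum m k r̃
    ≈⟨ *P-cong (≡→≈ (vandermondeFactor≡alternant k)) (wedgeSum≈det*eProduct m k r̃) ⟩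
      alternant ρ *P (det *P eProduct m k)
    ≈⟨ ≈trans (≈sym (*P-assoc (alternant ρ) det (eProduct m k)))
              (≈trans (*P-congˡ (eProduct m k) (*P-comm (alternant ρ) det)) (*P-assoc det (alternant ρ) (eProduct m k))) ⟩
      det *P (alternant ρ *P eProduct m k)
    ≈⟨ *P-congʳ det (alternant*eProduct m (strictVecs m k) ρ (isStrict-staircase 0 k) (strictVecs-enumerates m k)) ⟩
      det *P cauchySum m k
    ∎
    where
    open ≈-Reasoning
    ρ = staircase 0 k
    det = detPow⁻ {m} {k} r̃

  sumℕ≡∑ : ∀ {A : Set} (g : A → ℕ) (L : List A) → + sumℕ (map g L) ≡ ∑ L (λ x → + g x)
  sumℕ≡∑ g [] = refl
  sumℕ≡∑ g (x ∷ L) = cong (λ s → + g x + s) (sumℕ≡∑ g L)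

  qExp-invPerm : ∀ {k} (σ : Vec (Fin k) k) (d : Vec ℕ k) → isPerm σ ≡ true →
                 qExp σ d ≡ V.map (lookup (addStaircase 0 d)) (invPerm σ)
  qExp-invPerm {k} σ d σ-perm = Vec-ext λ j → ℤP.+-injective (
    begin
      + lookup (qExp σ d) j
    ≡⟨ cong +_ (VecP.lookup∘tabulate _ j) ⟩
      + sumℕ (map (λ i → if finEq (lookup σ i) j then exponent i else 0) (allFin k))
    ≡⟨ sumℕ≡∑ _ (allFin k) ⟩
      ∑ (allFin k) (λ i → + (if finEq (lookup σ i) j then exponent i else 0))
    ≡⟨ ∑-cong (allFin k) (only-σ⁻¹ j) ⟩
      ∑ (allFin k) (λ i → Kronecker.δ FinP._≟_ (lookup (invPerm σ) j) i * + exponent i)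
    ≡⟨ Kronecker.Enumerates-sift FinP._≟_ (allFin-enumerates k) (lookup (invPerm σ) j) refl (λ i → + exponent i) ⟩
      + exponent (lookup (invPerm σ) j)
    ≡⟨ cong +_ (sym (trans (VecP.lookup-map j (lookup (addStaircase 0 d)) (invPerm σ)) (lookup-addStaircase 0 d _))) ⟩
      + lookup (V.map (lookup (addStaircase 0 d)) (invPerm σ)) j
    ∎)
    where
    open ≡-Reasoning
    inj = isPerm⇒injection σ σ-perm
    exponent : Fin k → ℕ
    exponent i = lookup d i ℕ.+ toℕ i
    only-σ⁻¹ : ∀ j i → + (if finEq (lookup σ i) j then exponent i else 0) ≡
                       Kronecker.δ FinP._≟_ (lookup (invPerm σ) j) i * + exponent i
    only-σ⁻¹ j i with lookup σ i FinP.≟ j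
    ... | yes refl =
      trans (cong (λ b → + (if b then exponent i else 0)) (≡ᵇ-refl (toℕ (lookup σ i))))
            (sym (trans (cong (λ a → Kronecker.δ FinP._≟_ a i * + exponent i) (σ⁻¹∘σ σ inj i))
                        (trans (cong (_* + exponent i) (Kronecker.δ-refl FinP._≟_ i)) (*-identityˡ _))))
    ... | no σi≢j =
      trans (cong (λ b → + (if b then exponent i else 0)) (≢⇒≡ᵇ≡false (σi≢j ∘ FinP.toℕ-injective)))
            (sym (cong (_* + exponent i)
                       (Kronecker.δ-≢ FinP._≟_ (λ e → σi≢j (trans (cong (lookup σ) (sym e)) (σ∘σ⁻¹ σ inj j))))))

  alternant-qExp : ∀ {m k} (d : Vec ℕ k) →
                   sumP (map (λ σ → mon (sgn σ) (noX , qExp σ d)) (perms k)) ≈ alternant {m} (addStaircase 0 d)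
  alternant-qExp {m} {k} d =
    ≈trans (sumP-cong-∈ (perms k) (λ σ σ∈ →
             mon-cong (sym (sgn-invPerm σ (perm σ∈))) (cong (noX ,_) (qExp-invPerm σ d (perm σ∈)))))
    (≈trans (sumP-reindex _≟ᵖ_ (perms-enumerates k) invPerm invPerm isPerm-invPerm isPerm-invPerm
               (λ σ σ-perm → invPerm-involutive σ (isPerm⇒injection σ σ-perm))
               (λ σ σ-perm → invPerm-involutive σ (isPerm⇒injection σ σ-perm))
               (λ σ → mon (sgn σ) (noX , V.map (lookup (addStaircase 0 d)) σ)))
            (≈sym (alternant≈sumP (addStaircase 0 d))))
    where
    perm : ∀ {σ} → σ ∈ perms k → isPerm σ ≡ true
    perm {σ} σ∈ = Kronecker.Enumerates-∈ _≟ᵖ_ (perms-enumerates k) σ σ∈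

  filterᵇ-cong : ∀ {A : Set} {p q : A → Bool} → (∀ x → p x ≡ q x) → ∀ xs → filterᵇ p xs ≡ filterᵇ q xs
  filterᵇ-cong p≗q [] = refl
  filterᵇ-cong {p = p} {q} p≗q (x ∷ xs) with p x | q x | p≗q x
  ... | true | true | refl = cong (x ∷_) (filterᵇ-cong p≗q xs)
  ... | false | false | refl = filterᵇ-cong p≗q xs

  skewSchur-staircase : ∀ {m k} (d : Vec ℕ k) → skewSchur {m} (staircase 0 k) (addStaircase 0 d) ≡ schurV d
  skewSchur-staircase {m} {k} d =
    cong (map (λ T → (+ 1 , (content T , noQ)))) (filterᵇ-cong (isSkewTableau-addStaircase 0 d) (allVecs (allVecs bools m) k))

  *P-rotate : ∀ {m k} (a b c d : Poly m k) → ((a *P b) *P (c *P d)) ≈ (d *P (a *P (b *P c)))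
  *P-rotate a b c d =
    ≈trans (*P-comm (a *P b) (c *P d))
    (≈trans (*P-assoc c d (a *P b))
    (≈trans (*P-congʳ c (*P-comm d (a *P b)))
    (≈trans (≈sym (*P-assoc c (a *P b) d))
    (≈trans (*P-comm (c *P (a *P b)) d)
            (*P-congʳ d (≈trans (*P-comm c (a *P b)) (*P-assoc a b c)))))))

  RHS-column : ∀ m k r̃ (d : Vec ℕ k) → nondecreasing (toList d) ≡ true →
    sumP (map (λ σ → ((sgn σ * negOnePow (sumℕ (toList d)) , (replicate _ (+ 0) , qExp σ d)) ∷ []) *P Vbar r̃ d) (perms k)) ≈
    (detPow⁻ r̃ *P cauchyTerm m (staircase 0 k) (addStaircase 0 d))
  RHS-column m k r̃ d d-nondecreasing =
    begin
      sumP (map (λ σ → mon (sgn σ * sign) (noX , qExp σ d) *P (schur *P det)) (perms k))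
    ≈⟨ ≈sym (sumP-*ʳ (schur *P det) (λ σ → mon (sgn σ * sign) (noX , qExp σ d)) (perms k)) ⟩
      sumP (map (λ σ → mon (sgn σ * sign) (noX , qExp σ d)) (perms k)) *P (schur *P det)
    ≈⟨ *P-congˡ (schur *P det) (≈trans (sumP-cong (perms k) (λ σ → ≈sym (constP-mon σ)))
                                (≈trans (≈sym (sumP-*ˡ (constP sign) _ (perms k))) (constP-*-cong sign (alternant-qExp d)))) ⟩
      (constP sign *P alternant (addStaircase 0 d)) *P (schur *P det)
    ≈⟨ *P-rotate (constP sign) (alternant (addStaircase 0 d)) schur det ⟩
      det *P (constP sign *P (alternant (addStaircase 0 d) *P schur))
    ≈⟨ *P-congʳ det (≈trans (constP-*-≡ (alternant (addStaircase 0 d) *P schur) (sym cauchySign))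
                            (constP-*-cong (𝟙 (isStrict (addStaircase 0 d)) * gapSign ρ (addStaircase 0 d))
                                           (*P-congʳ (alternant (addStaircase 0 d)) (≡→≈ (sym (skewSchur-staircase d)))))) ⟩
      det *P cauchyTerm m ρ (addStaircase 0 d)
    ∎
    where
    open ≈-Reasoning
    ρ = staircase 0 k
    det = detPow⁻ {m} {k} r̃
    schur = schurV {m} {k} d
    sign = negOnePow (sumℕ (toList d))
    constP-mon : ∀ σ → (constP sign *P mon (sgn σ) (noX , qExp σ d)) ≈ mon (sgn σ * sign) (noX , qExp σ d)
    constP-mon σ = ≈trans (mon-* sign (sgn σ) monoOne _) (mon-cong (*-comm sign (sgn σ)) (monoMul-identityˡ _))
    cauchySign : 𝟙 (isStrict (addStaircase 0 d)) * gapSign ρ (addStaircase 0 d) ≡ sign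
    cauchySign = trans (cong₂ (λ b n → 𝟙 b * negOnePow n) (trans (isStrict-addStaircase 0 d) d-nondecreasing) (totalGap-addStaircase 0 d))
                       (*-identityˡ _)

  RHS≈det*cauchySum : ∀ m k r̃ → RHS m k r̃ ≈ (detPow⁻ r̃ *P cauchySum m k)
  RHS≈det*cauchySum m k r̃ =
    begin
      RHS m k r̃
    ≈⟨ flatten ⟩
      sumP (map (λ σ → sumP (map (term σ) ds)) (perms k))
    ≈⟨ sumP-swap term (perms k) ds ⟩
      sumP (map (λ d → sumP (map (λ σ → term σ d) (perms k))) ds)
    ≈⟨ sumP-cong-∈ ds (λ d d∈ →
         RHS-column m k r̃ d (∧≡true⇒ˡ (Kronecker.Enumerates-∈ _≟ⁿ_ (nondecreasingVecs-enumerates m k) d d∈))) ⟩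
      sumP (map (λ d → det *P cauchyTerm m ρ (addStaircase 0 d)) ds)
    ≈⟨ ≈sym (sumP-*ˡ det (λ d → cauchyTerm m ρ (addStaircase 0 d)) ds) ⟩
      det *P sumP (map (λ d → cauchyTerm m ρ (addStaircase 0 d)) ds)
    ≈⟨ *P-congʳ det (≈sym (sumP-map (addStaircase 0) (cauchyTerm m ρ) ds)) ⟩
      det *P cauchySum m k
    ∎
    where
    open ≈-Reasoning
    ρ = staircase 0 k
    det = detPow⁻ {m} {k} r̃
    ds = nondecreasingVecs m k
    term : Vec (Fin k) k → Vec ℕ k → Poly m k
    term σ d = ((sgn σ * negOnePow (sumℕ (toList d)) , (replicate _ (+ 0) , qExp σ d)) ∷ []) *P Vbar r̃ d
    flatten : RHS m k r̃ ≈ sumP (map (λ σ → sumP (map (term σ) ds)) (perms k))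
    flatten = mk≈ λ μ → trans (coeff-concat (concatMap (λ σ → map (term σ) ds) (perms k)) μ)
      (trans (∑-concatMap (λ σ → map (term σ) ds) (perms k) (λ p → coeff p μ))
      (sym (trans (coeff-sumP (λ σ → sumP (map (term σ) ds)) (perms k) μ)
                  (∑-cong (perms k) (λ σ → coeff-concat (map (term σ) ds) μ)))))

  LHS≈RHS : ∀ m k r̃ → LHS m k r̃ ≈ RHS m k r̃
  LHS≈RHS m k r̃ = ≈trans (LHS≈det*cauchySum m k r̃) (≈sym (RHS≈det*cauchySum m k r̃))

open import Data.Nat using (ℕ; _≤_; _+_; _∸_)
open DualCauchy using (un; LHS≈RHS)

-- The identity holds for every n.
mainTheorem4 : (n r r̃ : ℕ) → 2 ≤ n →
    LHS (n ∸ 1) (r + r̃) r̃ ≈P RHS (n ∸ 1) (r + r̃) r̃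
mainTheorem4 n r r̃ _ = un (LHS≈RHS (n ∸ 1) (r + r̃) r̃)
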